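{- Let $N\ge1$ and let $\mathit{Fifo}$, $\mathit{Pipe}$, $\mathit{Buff}$ be the three bounded buffers of capacity $N+2$ defined below. Then for every $n\ge1$, $rp_{\mathit{Fifo}}(n)\le rp_{\mathit{Pipe}}(n)$ and $rp_{\mathit{Fifo}}(n)\le rp_{\mathit{Buff}}(n)$ (Fifo is more efficient than both Pipe and Buff); and for $n\ge1$, $rp_{\mathit{Buff}}(n)\le rp_{\mathit{Pipe}}(n)$ (Buff is more efficient than Pipe) if and only if $n\le\lfloor (N+1)/2\rfloor$. Definitions. $\mathit{Fifo}\equiv\mathit{Fifo}(0)$ with $\mathit{Fifo}(0)\equiv in.\mathit{Fifo}(1)$, $\mathit{Fifo}(i)\equiv in.\mathit{Fifo}(i+1)+out.\mathit{Fifo}(i-1)$ for $0<i<N+2$, $\mathit{Fifo}(N+2)\equiv out.\mathit{Fifo}(N+1)$. $C\equiv in.C'$, $C'\equiv out.C$. For $0\le i\le N+1$, $C_i\equiv C[\Phi_i]$ with $\Phi_i(in)=\delta_i$ if $i\le N$, $\Phi_i(out)=\delta_{i-1}$ if $i\ge1$, identity otherwise; $\mathit{Pipe}\equiv(C_0\|_{\{\delta_0\}}C_1\|_{\{\delta_1\}}\cdots\|_{\{\delta_N\}}C_{N+1})/\{\delta_0,\dots,\delta_{N+1}\}$. For $0\le i\le N-1$, $B_i\equiv C[\Phi'_i]$ with $\Phi'_i(in)=w_i$, $\Phi'_i(out)=\rho_i$, identity otherwise; $B=\{w_j,\rho_j\mid 0\le j\le N-1\}$; $\mathit{Mem}\equiv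 B_0\|_\emptyset\cdots\|_\emptyset B_{N-1}$; with $a\oplus b=(a+b)\bmod N$, $x,y\in\{\perp,\square\}$, $0\le i\le N-1$, $0\le m\le N$: $BC(\perp,\perp,i,0)\equiv in.BC(\square,\perp,i,0)$; for $m>0$, $BC(\perp,\perp,i,m)\equiv in.BC(\square,\perp,i,m)+\rho_i.BC(\perp,\square,i\oplus1,m-1)$; $BC(\square,\perp,i,0)\equiv w_i.BC(\perp,\perp,i,1)$; for $0<m<N$, $BC(\square,\perp,i,m)\equiv w_{i\oplus m}.BC(\perp,\perp,i,m+1)+\rho_i.BC(\square,\square,i\oplus1,m-1)$; $BC(\square,\perp,i,N)\equiv\rho_i.BC(\square,\square,i\oplus1,N-1)$; $BC(\perp,\square,i,m)\equiv in.BC(\square,\square,i,m)+out.BC(\perp,\perp,i,m)$; for $m<N$, $BC(\square,\square,i,m)\equiv w_{i\oplus m}.BC(\perp,\square,i,m+1)+out.BC(\square,\perp,i,m)$; $BC(\square,\square,i,N)\equiv out.BC(\square,\perp,i,N)$; $\mathit{Buff}\equiv(\mathit{Mem}\|_B BC(\perp,\perp,0,0))/B$. Here $\delta_j,w_j,\rho_j$ are distinct visible actions different from $in,out,\omega$, and $P/S$ denotes $P[\Phi_S]$ with $\Phi_S(\alpha)=\tau$ for $\alpha\in S$ and $\Phi_S(\alpha)=\alpha$ otherwise.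
   Context: PAFAS (a timed process algebra). $\mathcal{A}$ is an infinite set of visible actions containing a special success action $\omega$ and the actions $in, out$; $\tau\notin\mathcal{A}$ is the internal action, $\mathcal{A}_\tau=\mathcal{A}\cup\{\tau\}$. For each $\alpha\in\mathcal{A}_\tau$ there is an urgent version $\underline{\alpha}$. A general relabelling function is $\Phi:\mathcal{A}_\tau\to\mathcal{A}_\tau$ with $\Phi(\tau)=\tau$ changing only finitely many actions. Processes are closed, guarded terms of the grammar $P ::= \mathbf{0} \mid \gamma.P \mid P+P \mid P\|_A P \mid P[\Phi] \mid x \mid \mu x.P$ with $\gamma\in\{\alpha,\underline{\alpha}\}$, $\alpha\in\mathcal{A}_\tau$, $A\subseteq\mathcal{A}$; recursive defining equations ($\equiv$) abbreviate $\mu$-terms, and a trailing $\mathbf 0$ is omitted. $P\|Q$ abbreviates $P\|_{\mathcal{A}\setminus\{\omega\}}Q$. Refusal semantics: transitions $P\xrightarrow{\alpha}_r P'$ ($\alpha\in\mathcal{A}_\tau$) and $P\xrightarrow{X}_r P'$ ($X\subseteq\mathcal{A}$) are the least relations closed under: $\alpha.P\xrightarrow{\alpha}_r P$; $\underline{\alpha}.P\xrightarrow{\alpha}_r P$; if $P_1\xrightarrow{\alpha}_r P_1'$ then $P_1+P_2\xrightarrow{\alpha}_r P_1'$ and $P_2+P_1\xrightarrow{\alpha}_r P_1'$; if $\alpha\notin A$ and $P_1\xrightarrow{\alpha}_r P_1'$ then $P_1\|_A P_2\xrightarrow{\alpha}_r P_1'\|_A P_2$ and $P_2\|_A P_1\xrightarrow{\alpha}_r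 P_2\|_A P_1'$; if $\alpha\in A$, $P_1\xrightarrow{\alpha}_r P_1'$, $P_2\xrightarrow{\alpha}_r P_2'$ then $P_1\|_A P_2\xrightarrow{\alpha}_r P_1'\|_A P_2'$; if $P\xrightarrow{\alpha}_r P'$ then $P[\Phi]\xrightarrow{\Phi(\alpha)}_r P'[\Phi]$; if $P\{\mu x.P/x\}\xrightarrow{\alpha}_r P'$ then $\mu x.P\xrightarrow{\alpha}_r P'$; $\mathbf 0\xrightarrow{X}_r\mathbf 0$; $\alpha.P\xrightarrow{X}_r\underline{\alpha}.P$; if $\alpha\notin X\cup\{\tau\}$ then $\underline{\alpha}.P\xrightarrow{X}_r\underline{\alpha}.P$; if $P_i\xrightarrow{X_i}_r P_i'$ ($i=1,2$) and $X\subseteq (A\cap(X_1\cup X_2))\cup((X_1\cap X_2)\setminus A)$ then $P_1\|_A P_2\xrightarrow{X}_r P_1'\|_A P_2'$; if $P_i\xrightarrow{X}_r P_i'$ ($i=1,2$) then $P_1+P_2\xrightarrow{X}_r P_1'+P_2'$; if $P\xrightarrow{\Phi^{ -1}(X\cup\{\tau\})\setminus\{\tau\}}_r P'$ then $P[\Phi]\xrightarrow{X}_r P'[\Phi]$; if $P\{\mu x.P/x\}\xrightarrow{X}_r P'$ then $\mu x.P\xrightarrow{X}_r P'\{\mu x.P/x\}$. A full time step $P\xrightarrow{1}P'$ is $P\xrightarrow{\mathcal{A}}_r P'$. For $w\in(\mathcal{A}_\tau\cup\{1\})^*$, $P\xrightarrow{w}P'$ is the corresponding sequence of action transitions and full time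 steps; the discrete traces are $DL(P)=\{w/\tau : P\xrightarrow{w}P' \text{ for some } P'\}$ where $w/\tau$ deletes all $\tau$'s; $\zeta(v)$ is the number of $1$'s in $v$. Users: $U_1\equiv\underline{in}.\underline{out}.\underline{\omega}$, $U_n\equiv U_{n-1}\|_{\{\omega\}}\underline{in}.\underline{out}.\underline{\omega}$ for $n>1$. Response performance: $rp_P(n)=\sup\{\zeta(v) : v\in DL(P\|U_n),\ v \text{ does not contain }\omega\}\in\mathbb{N}_0\cup\{\infty\}$. "$P$ is more efficient than $Q$" (quantitatively) is read as $rp_P(n)\le rp_Q(n)$. -}

module Defs where

open import Data.Nat using (ℕ; zero; suc; _+_; _∸_; _≤_; _<ᵇ_; _≤ᵇ_; _≡ᵇ_; NonZero)
open import Data.Nat.DivMod using (_%_)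
open import Data.Bool using (Bool; true; false; if_then_else_; _∧_; T)
open import Data.List using (List; []; _∷_)
open import Data.List.Membership.Propositional using (_∈_)
open import Data.Product using (Σ; _×_; _,_)
open import Data.Sum using (_⊎_)
open import Data.Empty using (⊥)
open import Data.Unit using (⊤)
open import Relation.Nullary using (¬_)
open import Relation.Binary.PropositionalEquality using (_≡_)

-- Actions.  𝒜 is instantiated by a concrete infinite set containing
-- ω, in, out and pairwise distinct families δ_j, w_j, ρ_j (plus
-- infinitely many further actions 'other k').

data Act : Set where
  ω inA outA : Act
  δ w ρ      : ℕ → Act
  other      : ℕ → Act

data ActT : Set where
  vis : Act → ActT
  τ   : ActT

-- A general relabelling Φ : 𝒜_τ → 𝒜_τ with Φ(τ) = τ is given by its
-- restriction to 𝒜.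
Relabel : Set
Relabel = Act → ActT

extend : Relabel → ActT → ActT
extend Φ (vis a) = Φ a
extend Φ τ       = τ

ASet : Set₁
ASet = Act → Set

_∈A_ : ActT → ASet → Set
vis a ∈A A = A a
τ     ∈A A = ⊥

-- Φ⁻¹(X ∪ {τ}) \ {τ}
preim : Relabel → ASet → ASet
preim Φ X a with Φ a
... | vis b = X b
... | τ     = ⊤

-- Process terms.  Recursion is given by process constants of an index
-- type K together with defining equations  body : K → Proc K.

data Proc (K : Set) : Set₁ where
  nil  : Proc K
  pre  : ActT → Proc K → Proc K
  upre : ActT → Proc K → Proc K
  _⊕_  : Proc K → Proc K → Proc K
  par  : Proc K → ASet → Proc K → Proc K
  rel  : Proc K → Relabel → Proc K
  con  : K → Proc K

record System : Set₁ where
  field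
    K     : Set
    body  : K → Proc K
    start : Proc K
open System public

data Lab : Set where
  act  : ActT → Lab
  tick : Lab

module Semantics {K : Set} (body : K → Proc K) where

  data _─⟨_⟩→_ : Proc K → ActT → Proc K → Set₁ where
    preA  : ∀ {α P} → pre α P ─⟨ α ⟩→ P
    upreA : ∀ {α P} → upre α P ─⟨ α ⟩→ P
    sumL  : ∀ {α P₁ P₁' P₂} → P₁ ─⟨ α ⟩→ P₁' → (P₁ ⊕ P₂) ─⟨ α ⟩→ P₁'
    sumR  : ∀ {α P₁ P₁' P₂} → P₁ ─⟨ α ⟩→ P₁' → (P₂ ⊕ P₁) ─⟨ α ⟩→ P₁'
    parL  : ∀ {α A P₁ P₁' P₂} → ¬ (α ∈A A) → P₁ ─⟨ α ⟩→ P₁' →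
            par P₁ A P₂ ─⟨ α ⟩→ par P₁' A P₂
    parR  : ∀ {α A P₁ P₁' P₂} → ¬ (α ∈A A) → P₁ ─⟨ α ⟩→ P₁' →
            par P₂ A P₁ ─⟨ α ⟩→ par P₂ A P₁'
    sync  : ∀ {a A P₁ P₁' P₂ P₂'} → A a →
            P₁ ─⟨ vis a ⟩→ P₁' → P₂ ─⟨ vis a ⟩→ P₂' →
            par P₁ A P₂ ─⟨ vis a ⟩→ par P₁' A P₂'
    relA  : ∀ {α Φ P P'} → P ─⟨ α ⟩→ P' → rel P Φ ─⟨ extend Φ α ⟩→ rel P' Φ
    conA  : ∀ {α k P'} → body k ─⟨ α ⟩→ P' → con k ─⟨ α ⟩→ P'

  data _─[_]→_ : Proc K → ASet → Proc K → Set₁ where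
    nilR  : ∀ {X} → nil ─[ X ]→ nil
    preR  : ∀ {X α P} → pre α P ─[ X ]→ upre α P
    upreR : ∀ {X a P} → ¬ X a → upre (vis a) P ─[ X ]→ upre (vis a) P
    parR  : ∀ {X X₁ X₂ A P₁ P₁' P₂ P₂'} →
            P₁ ─[ X₁ ]→ P₁' → P₂ ─[ X₂ ]→ P₂' →
            (∀ a → X a → (A a × (X₁ a ⊎ X₂ a)) ⊎ ((X₁ a × X₂ a) × ¬ A a)) →
            par P₁ A P₂ ─[ X ]→ par P₁' A P₂'
    sumR  : ∀ {X P₁ P₁' P₂ P₂'} → P₁ ─[ X ]→ P₁' → P₂ ─[ X ]→ P₂' →
            (P₁ ⊕ P₂) ─[ X ]→ (P₁' ⊕ P₂')
    relR  : ∀ {X Φ P P'} → P ─[ preim Φ X ]→ P' → rel P Φ ─[ X ]→ rel P' Φ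
    conR  : ∀ {X k P'} → body k ─[ X ]→ P' → con k ─[ X ]→ P'

  _─1→_ : Proc K → Proc K → Set₁
  P ─1→ P' = P ─[ (λ _ → ⊤) ]→ P'

  data Steps : Proc K → List Lab → Proc K → Set₁ where
    done  : ∀ {P} → Steps P [] P
    stepA : ∀ {P P' P'' α ws} → P ─⟨ α ⟩→ P' → Steps P' ws P'' → Steps P (act α ∷ ws) P''
    stepT : ∀ {P P' P'' ws} → P ─1→ P' → Steps P' ws P'' → Steps P (tick ∷ ws) P''

data VLab : Set where
  act  : Act → VLab
  tick : VLab

eraseτ : List Lab → List VLab
eraseτ []                = []
eraseτ (act (vis a) ∷ ws) = act a ∷ eraseτ ws
eraseτ (act τ ∷ ws)       = eraseτ ws
eraseτ (tick ∷ ws)        = tick ∷ eraseτ ws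

DL : {K : Set} (body : K → Proc K) → Proc K → List VLab → Set₁
DL {K} body P v = Σ (List Lab) λ ws → Σ (Proc K) λ P' → Steps P ws P' × eraseτ ws ≡ v
  where open Semantics body

ζ : List VLab → ℕ
ζ []           = 0
ζ (tick ∷ v)   = suc (ζ v)
ζ (act _ ∷ v)  = ζ v

_∥_ : {K : Set} → Proc K → Proc K → Proc K
P ∥ Q = par P (λ a → ¬ (a ≡ ω)) Q

user : {K : Set} → Proc K
user = upre (vis inA) (upre (vis outA) (upre (vis ω) nil))

-- U_n for n ≥ 1 (U 0 is an unused dummy)
U : {K : Set} → ℕ → Proc K
U zero          = nil
U (suc zero)    = user
U (suc (suc n)) = par (U (suc n)) (λ a → a ≡ ω) user

-- "rp_P(n) ≥ k": some v ∈ DL(P ∥ U_n) without ω has ζ(v) ≥ k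
RPAtLeast : System → ℕ → ℕ → Set₁
RPAtLeast S n k =
  Σ (List VLab) λ v → DL (body S) (start S ∥ U n) v × ¬ (act ω ∈ v) × k ≤ ζ v

-- rp_P(n) ≤ rp_Q(n) in ℕ₀ ∪ {∞}, where rp is the supremum
RP≤ : System → System → ℕ → Set₁
RP≤ P Q n = ∀ k → RPAtLeast P n k → RPAtLeast Q n k

fifoBody : ℕ → ℕ → Proc ℕ
fifoBody N zero    = pre (vis inA) (con 1)
fifoBody N (suc j) =
  if suc j <ᵇ N + 2
  then (pre (vis inA) (con (suc (suc j))) ⊕ pre (vis outA) (con j))
  else (if suc j ≡ᵇ N + 2 then pre (vis outA) (con (N + 1)) else nil)

Fifo : ℕ → System
Fifo N = record { K = ℕ ; body = fifoBody N ; start = con 0 }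

-- the one-place cell: C (true) and C' (false)
cellBody : Bool → Proc Bool
cellBody true  = pre (vis inA) (con false)
cellBody false = pre (vis outA) (con true)

Φpipe : ℕ → ℕ → Relabel
Φpipe N i inA  = if i ≤ᵇ N then vis (δ i) else vis inA
Φpipe N i outA = if 1 ≤ᵇ i then vis (δ (i ∸ 1)) else vis outA
Φpipe N i a    = vis a

Cpipe : ℕ → ℕ → Proc Bool
Cpipe N i = rel (con true) (Φpipe N i)

pipeChain : ℕ → ℕ → Proc Bool
pipeChain N zero    = Cpipe N 0
pipeChain N (suc i) = par (pipeChain N i) (λ a → a ≡ δ i) (Cpipe N (suc i))

hide : (Act → Bool) → Relabel
hide S a = if S a then τ else vis a

isδ : ℕ → Act → Bool
isδ N (δ j) = j ≤ᵇ N + 1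
isδ N _     = false

Pipe : ℕ → System
Pipe N = record { K = Bool ; body = cellBody
                ; start = rel (pipeChain N (N + 1)) (hide (isδ N)) }

-- constants for Buff: the cell C / C' and BC(x, y, i, m),
-- with x, y ∈ {⊥, □} encoded as false = ⊥, true = □
data BK : Set where
  cell : Bool → BK
  bc   : Bool → Bool → ℕ → ℕ → BK

module _ (N : ℕ) .{{_ : NonZero N}} where

  _⊞_ : ℕ → ℕ → ℕ
  a ⊞ b = (a + b) % N

  bcRule : Bool → Bool → ℕ → ℕ → Proc BK
  bcRule false false i zero    = pre (vis inA) (con (bc true false i 0))
  bcRule false false i (suc k) =
    pre (vis inA) (con (bc true false i (suc k)))
      ⊕ pre (vis (ρ i)) (con (bc false true (i ⊞ 1) k))
  bcRule true false i zero     = pre (vis (w i)) (con (bc false false i 1))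
  bcRule true false i (suc k)  =
    if suc k <ᵇ N
    then (pre (vis (w (i ⊞ suc k))) (con (bc false false i (suc (suc k))))
           ⊕ pre (vis (ρ i)) (con (bc true true (i ⊞ 1) k)))
    else pre (vis (ρ i)) (con (bc true true (i ⊞ 1) (N ∸ 1)))
  bcRule false true i m        =
    pre (vis inA) (con (bc true true i m)) ⊕ pre (vis outA) (con (bc false false i m))
  bcRule true true i m         =
    if m <ᵇ N
    then (pre (vis (w (i ⊞ m))) (con (bc false true i (suc m)))
           ⊕ pre (vis outA) (con (bc true false i m)))
    else pre (vis outA) (con (bc true false i N))

  -- equations only for 0 ≤ i ≤ N-1, 0 ≤ m ≤ N (other constants are unused)
  buffBody : BK → Proc BK
  buffBody (cell true)  = pre (vis inA) (con (cell false))
  buffBody (cell false) = pre (vis outA) (con (cell true))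
  buffBody (bc x y i m) = if (i <ᵇ N) ∧ (m ≤ᵇ N) then bcRule x y i m else nil

  Φmem : ℕ → Relabel
  Φmem i inA  = vis (w i)
  Φmem i outA = vis (ρ i)
  Φmem i a    = vis a

  Bcell : ℕ → Proc BK
  Bcell i = rel (con (cell true)) (Φmem i)

  memChain : ℕ → Proc BK
  memChain zero    = Bcell 0
  memChain (suc i) = par (memChain i) (λ _ → ⊥) (Bcell (suc i))

  Mem : Proc BK
  Mem = memChain (N ∸ 1)

  isB : Act → Bool
  isB (w j) = j <ᵇ N
  isB (ρ j) = j <ᵇ N
  isB _     = false

  Buff : System
  Buff = record { K = BK ; body = buffBody
                ; start = rel (par Mem (λ a → T (isB a)) (con (bc false false 0 0))) (hide isB) }

module Submission where

-- Upper bounds come from maximal progress: after a time step every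
-- enabled action is urgent, so consecutive time steps must be separated by progress
-- of some pending user, and a budget invariant preserved by every transition gives
-- rp_Fifo(n) ≤ 2n, rp_Buff(n) ≤ 4n and rp_Pipe(n) ≤ 2n + N + 1.  The last two are
-- attained by explicit runs: Buff serves each user in four time steps (in, w, ρ and
-- out each follow their own time step), Pipe serves a user every two time steps
-- except the last, whose item crosses the pipe one cell per time step.  Comparing
-- 2n, 4n and 2n + N + 1 (4n ≤ 2n + N + 1 iff n ≤ ⌊(N + 1)/2⌋) gives the theorem.

open import Defs
open import Data.Nat using (ℕ; _+_; _≤_; NonZero)
open import Data.Nat.DivMod using (_/_)
open import Data.Product using (_×_)
open import Function.Bundles using (_⇔_)

module BoolCmp where

  open import Data.Nat using (ℕ; suc; _≤_; _<_; z≤n; s≤s; _<ᵇ_; _≤ᵇ_; _≡ᵇ_)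
  open import Data.Nat.Properties
  open import Data.Bool using (Bool; true; false; T)
  open import Data.Empty using (⊥-elim)
  open import Data.Sum using ([_,_])
  open import Data.Unit using (tt)
  open import Relation.Nullary using (¬_)
  open import Relation.Binary.PropositionalEquality using (_≡_; _≢_; refl; sym; subst)

  <ᵇ≡true⇒< : ∀ m n → (m <ᵇ n) ≡ true → m < n
  <ᵇ≡true⇒< m n e = <ᵇ⇒< m n (subst T (sym e) tt)

  <ᵇ≡false⇒≮ : ∀ m n → (m <ᵇ n) ≡ false → ¬ (m < n)
  <ᵇ≡false⇒≮ m n e m<n = subst T e (<⇒<ᵇ m<n)

  ≤ᵇ≡true⇒≤ : ∀ m n → (m ≤ᵇ n) ≡ true → m ≤ n
  ≤ᵇ≡true⇒≤ m n e = ≤ᵇ⇒≤ m n (subst T (sym e) tt)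

  ≡ᵇ≡true⇒≡ : ∀ m n → (m ≡ᵇ n) ≡ true → m ≡ n
  ≡ᵇ≡true⇒≡ m n e = ≡ᵇ⇒≡ m n (subst T (sym e) tt)

  ≡ᵇ≡false⇒≢ : ∀ m n → (m ≡ᵇ n) ≡ false → m ≢ n
  ≡ᵇ≡false⇒≢ m n e m≡n = subst T e (≡⇒≡ᵇ m n m≡n)

  <⇒<ᵇ≡true : ∀ {m n} → m < n → (m <ᵇ n) ≡ true
  <⇒<ᵇ≡true {m} {n} m<n with m <ᵇ n in e
  ... | true  = refl
  ... | false = ⊥-elim (<ᵇ≡false⇒≮ m n e m<n)

  ≮⇒<ᵇ≡false : ∀ {m n} → ¬ (m < n) → (m <ᵇ n) ≡ false
  ≮⇒<ᵇ≡false {m} {n} m≮n with m <ᵇ n in e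
  ... | true  = ⊥-elim (m≮n (<ᵇ≡true⇒< m n e))
  ... | false = refl

  ≤⇒≤ᵇ≡true : ∀ {m n} → m ≤ n → (m ≤ᵇ n) ≡ true
  ≤⇒≤ᵇ≡true {m} {n} m≤n with m ≤ᵇ n in e
  ... | true  = refl
  ... | false = ⊥-elim (subst T e (≤⇒≤ᵇ m≤n))

  ≰⇒≤ᵇ≡false : ∀ {m n} → ¬ (m ≤ n) → (m ≤ᵇ n) ≡ false
  ≰⇒≤ᵇ≡false {m} {n} m≰n with m ≤ᵇ n in e
  ... | true  = ⊥-elim (m≰n (≤ᵇ≡true⇒≤ m n e))
  ... | false = refl

  ≡⇒≡ᵇ≡true : ∀ {m n} → m ≡ n → (m ≡ᵇ n) ≡ true
  ≡⇒≡ᵇ≡true {m} {n} m≡n with m ≡ᵇ n in e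
  ... | true  = refl
  ... | false = ⊥-elim (≡ᵇ≡false⇒≢ m n e m≡n)

  ≢⇒≡ᵇ≡false : ∀ {m n} → m ≢ n → (m ≡ᵇ n) ≡ false
  ≢⇒≡ᵇ≡false {m} {n} m≢n with m ≡ᵇ n in e
  ... | true  = ⊥-elim (m≢n (≡ᵇ≡true⇒≡ m n e))
  ... | false = refl

  <ᵇ-suc : ∀ a m → a ≢ m → (a <ᵇ m) ≡ (a <ᵇ suc m)
  <ᵇ-suc a m a≢m with a <ᵇ m in e
  ... | true  = sym (<⇒<ᵇ≡true (m≤n⇒m≤1+n (<ᵇ≡true⇒< a m e)))
  ... | false = sym (≮⇒<ᵇ≡false λ a<1+m → [ <ᵇ≡false⇒≮ a m e , a≢m ] (m≤n⇒m<n∨m≡n (≤-pred a<1+m)))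

  bit : Bool → ℕ
  bit true  = 1
  bit false = 0

  bit≤1 : ∀ b → bit b ≤ 1
  bit≤1 true  = s≤s z≤n
  bit≤1 false = z≤n

  false≢true : false ≢ true
  false≢true ()

  bool-cases : {A : Set} (b : Bool) → (b ≡ false → A) → (b ≡ true → A) → A
  bool-cases false f _ = f refl
  bool-cases true  _ t = t refl

module FunUpdate where

  open BoolCmp
  open import Data.Nat using (ℕ; _≡ᵇ_)
  open import Data.Bool using (if_then_else_)
  open import Relation.Binary.PropositionalEquality using (_≡_; _≢_; refl)

  update : {A : Set} → (ℕ → A) → ℕ → A → ℕ → A
  update f i x j = if j ≡ᵇ i then x else f j

  update-same : {A : Set} (f : ℕ → A) (i : ℕ) (x : A) → update f i x i ≡ x
  update-same f i x rewrite ≡⇒≡ᵇ≡true {i} {i} refl = refl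

  update-other : {A : Set} (f : ℕ → A) (i : ℕ) (x : A) (j : ℕ) → j ≢ i → update f i x j ≡ f j
  update-other f i x j j≢i rewrite ≢⇒≡ᵇ≡false j≢i = refl

module Timed where

  open import Defs
  open import Data.Product using (Σ; _,_)
  open import Data.Sum using (inj₁; inj₂)
  open import Data.Empty using (⊥)
  open import Data.Unit using (⊤; tt)
  open import Relation.Nullary using (¬_)
  open import Relation.Binary.PropositionalEquality using (_≡_; refl; cong; cong₂)

  vis-injective : ∀ {a b} → vis a ≡ vis b → a ≡ b
  vis-injective refl = refl

  δ-injective : ∀ {i j} → δ i ≡ δ j → i ≡ j
  δ-injective refl = refl

  -- τ is never offered to the environment, so every time step counts as refusing it.
  Refused : ActT → ASet → Set
  Refused τ       Y = ⊤
  Refused (vis a) Y = Y a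

  refused-preim : ∀ (Φ : Relabel) a (Y : ASet) → Refused (Φ a) Y → preim Φ Y a
  refused-preim Φ a Y r with Φ a
  ... | vis b = r
  ... | τ     = tt

  preim-mono : ∀ (Φ : Relabel) (X Y : ASet) → (∀ a → Y a → X a) → ∀ a → preim Φ Y a → preim Φ X a
  preim-mono Φ X Y Y⊆X a p with Φ a
  ... | vis b = Y⊆X b p
  ... | τ     = tt

  module TimeSteps {K : Set} (body : K → Proc K) where
    open Semantics body

    -- every recursive body of the three buffers has this shape
    data PrefixSum : Proc K → Set₁ where
      nil-ps : PrefixSum nil
      pre-ps : ∀ {α P} → PrefixSum (pre α P)
      sum-ps : ∀ {P Q} → PrefixSum P → PrefixSum Q → PrefixSum (P ⊕ Q)
      con-ps : ∀ {k} → PrefixSum (body k) → PrefixSum (con k)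

    step-after-tick : ∀ {P Q R X α} → PrefixSum P → P ─[ X ]→ Q → P ─⟨ α ⟩→ R → Q ─⟨ α ⟩→ R
    step-after-tick pre-ps       preR          preA     = upreA
    step-after-tick (sum-ps s _) (sumR d _)    (sumL e) = sumL (step-after-tick s d e)
    step-after-tick (sum-ps _ s) (sumR _ d)    (sumR e) = sumR (step-after-tick s d e)
    step-after-tick (con-ps s)   (conR d)      (conA e) = step-after-tick s d e

    step-before-tick : ∀ {P Q R X α} → PrefixSum P → P ─[ X ]→ Q → Q ─⟨ α ⟩→ R → P ─⟨ α ⟩→ R
    step-before-tick pre-ps       preR       upreA    = preA
    step-before-tick (sum-ps s _) (sumR d _) (sumL e) = sumL (step-before-tick s d e)
    step-before-tick (sum-ps _ s) (sumR _ d) (sumR e) = sumR (step-before-tick s d e)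
    step-before-tick (con-ps s)   (conR d)   e        = conA (step-before-tick s d e)

    prefixSum-tick : ∀ {P} → PrefixSum P → ∀ X → Σ (Proc K) λ Q → P ─[ X ]→ Q
    prefixSum-tick nil-ps X = nil , nilR
    prefixSum-tick pre-ps X = _ , preR
    prefixSum-tick (sum-ps s t) X with prefixSum-tick s X | prefixSum-tick t X
    ... | _ , d | _ , e = _ , sumR d e
    prefixSum-tick (con-ps s) X with prefixSum-tick s X
    ... | Q , d = Q , conR d

    tick-idempotent : ∀ {P Q R X Y} → P ─[ X ]→ Q → Q ─[ Y ]→ R → Q ≡ R
    tick-idempotent nilR           nilR           = refl
    tick-idempotent preR           (upreR _)      = refl
    tick-idempotent (upreR _)      (upreR _)      = refl
    tick-idempotent (parR d₁ d₂ _) (parR e₁ e₂ _) =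
      cong₂ (λ x y → par x _ y) (tick-idempotent d₁ e₁) (tick-idempotent d₂ e₂)
    tick-idempotent (sumR d₁ d₂)   (sumR e₁ e₂)   = cong₂ _⊕_ (tick-idempotent d₁ e₁) (tick-idempotent d₂ e₂)
    tick-idempotent (relR d)       (relR e)       = cong (λ x → rel x _) (tick-idempotent d e)
    tick-idempotent (conR d)       e              = tick-idempotent d e

    tick-antitone : ∀ {P Q X Y} → P ─[ X ]→ Q → (∀ a → Y a → X a) → P ─[ Y ]→ Q
    tick-antitone nilR           Y⊆X = nilR
    tick-antitone preR           Y⊆X = preR
    tick-antitone (upreR ¬X)     Y⊆X = upreR (λ y → ¬X (Y⊆X _ y))
    tick-antitone (parR d₁ d₂ c) Y⊆X = parR d₁ d₂ (λ a y → c a (Y⊆X a y))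
    tick-antitone (sumR d₁ d₂)   Y⊆X = sumR (tick-antitone d₁ Y⊆X) (tick-antitone d₂ Y⊆X)
    tick-antitone {X = X} {Y} (relR {Φ = Φ} d) Y⊆X = relR (tick-antitone d (preim-mono Φ X Y Y⊆X))
    tick-antitone (conR d)       Y⊆X = conR (tick-antitone d Y⊆X)

    Urgent : Proc K → ActT → Set₁
    Urgent Q α = ∀ {Y S} → Q ─[ Y ]→ S → Refused α Y → ⊥

    -- Time passing turns every enabled action urgent; this is the maximal-progress
    -- principle on which all the upper bounds rest.
    ticked⇒urgent : ∀ {P Q R X α} → P ─[ X ]→ Q → Q ─⟨ α ⟩→ R → Urgent Q α
    ticked⇒urgent preR      upreA (upreR ¬Y) r = ¬Y r
    ticked⇒urgent (upreR _) upreA (upreR ¬Y) r = ¬Y r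
    ticked⇒urgent (parR d₁ _ _) (parL {α = τ} _ e) (parR g₁ _ _) _ = ticked⇒urgent d₁ e g₁ tt
    ticked⇒urgent (parR d₁ _ _) (parL {α = vis a} a∉A e) (parR g₁ _ c) r with c a r
    ... | inj₁ (a∈A , _)       = a∉A a∈A
    ... | inj₂ ((r₁ , _) , _)  = ticked⇒urgent d₁ e g₁ r₁
    ticked⇒urgent (parR _ d₂ _) (parR {α = τ} _ e) (parR _ g₂ _) _ = ticked⇒urgent d₂ e g₂ tt
    ticked⇒urgent (parR _ d₂ _) (parR {α = vis a} a∉A e) (parR _ g₂ c) r with c a r
    ... | inj₁ (a∈A , _)       = a∉A a∈A
    ... | inj₂ ((_ , r₂) , _)  = ticked⇒urgent d₂ e g₂ r₂
    ticked⇒urgent (parR d₁ d₂ _) (sync {a = a} a∈A e₁ e₂) (parR g₁ g₂ c) r with c a r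
    ... | inj₁ (_ , inj₁ r₁) = ticked⇒urgent d₁ e₁ g₁ r₁
    ... | inj₁ (_ , inj₂ r₂) = ticked⇒urgent d₂ e₂ g₂ r₂
    ... | inj₂ (_ , a∉A)     = a∉A a∈A
    ticked⇒urgent (sumR d₁ _) (sumL e) (sumR g₁ _) r = ticked⇒urgent d₁ e g₁ r
    ticked⇒urgent (sumR _ d₂) (sumR e) (sumR _ g₂) r = ticked⇒urgent d₂ e g₂ r
    ticked⇒urgent (relR d) (relA {α = τ} e) (relR g) _ = ticked⇒urgent d e g tt
    ticked⇒urgent (relR d) (relA {α = vis a} {Φ = Φ} e) (relR {X = Y} g) r =
      ticked⇒urgent d e g (refused-preim Φ a Y r)
    ticked⇒urgent (conR d) e g r = ticked⇒urgent d e g r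

    urgent-upre : ∀ {a P} → Urgent (upre (vis a) P) (vis a)
    urgent-upre (upreR ¬Y) r = ¬Y r

    urgent-parˡ : ∀ {P Q A α} → ¬ (α ∈A A) → Urgent P α → Urgent (par P A Q) α
    urgent-parˡ {α = τ}     α∉A u (parR g₁ _ _) _ = u g₁ tt
    urgent-parˡ {α = vis a} α∉A u (parR g₁ _ c) r with c a r
    ... | inj₁ (a∈A , _)      = α∉A a∈A
    ... | inj₂ ((r₁ , _) , _) = u g₁ r₁

    urgent-parʳ : ∀ {P Q A α} → ¬ (α ∈A A) → Urgent Q α → Urgent (par P A Q) α
    urgent-parʳ {α = τ}     α∉A u (parR _ g₂ _) _ = u g₂ tt
    urgent-parʳ {α = vis a} α∉A u (parR _ g₂ c) r with c a r
    ... | inj₁ (a∈A , _)      = α∉A a∈A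
    ... | inj₂ ((_ , r₂) , _) = u g₂ r₂

    urgent-sync : ∀ {P Q A a} → A a → Urgent P (vis a) → Urgent Q (vis a) → Urgent (par P A Q) (vis a)
    urgent-sync {a = a} a∈A u v (parR g₁ g₂ c) r with c a r
    ... | inj₁ (_ , inj₁ r₁) = u g₁ r₁
    ... | inj₁ (_ , inj₂ r₂) = v g₂ r₂
    ... | inj₂ (_ , a∉A)     = a∉A a∈A

    urgent-rel : ∀ {P Φ b} → Urgent P (vis b) → Urgent (rel P Φ) (Φ b)
    urgent-rel {Φ = Φ} {b} u {Y = Y} (relR g) r = u g (refused-preim Φ b Y r)

module Users where

  open import Defs
  open BoolCmp
  open FunUpdate
  open Timed
  open import Data.Nat using (ℕ; zero; suc; _+_; _≤_; _<_; z≤n; s≤s; _<ᵇ_; _≟_)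
  open import Data.Bool using (if_then_else_)
  open import Data.Nat.Properties using (+-comm; +-suc; +-identityʳ; ≤-trans; ≤-reflexive; m≤m+n; m≤n+m;
      1+n≢0; n≮n; n<1+n; +-commutativeSemigroup)
  open import Data.Product using (Σ; _×_; _,_; proj₂)
  open import Data.Sum using (_⊎_; inj₁; inj₂)
  open import Data.Empty using (⊥; ⊥-elim)
  open import Relation.Nullary using (¬_; Dec; yes; no)
  open import Relation.Binary.PropositionalEquality using (_≡_; _≢_; refl; cong; cong₂; sym; trans; subst; module ≡-Reasoning)
  open import Algebra.Properties.CommutativeSemigroup +-commutativeSemigroup using (xy∙z≈xz∙y)

  data Phase : Set where
    wantsIn wantsOut wantsω : Phase

  wantsIn≢wantsω : wantsIn ≢ wantsω
  wantsIn≢wantsω ()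

  wantsOut≢wantsω : wantsOut ≢ wantsω
  wantsOut≢wantsω ()

  _≟ω : (a : Act) → Dec (a ≡ ω)
  ω         ≟ω = yes refl
  inA       ≟ω = no λ ()
  outA      ≟ω = no λ ()
  δ _       ≟ω = no λ ()
  w _       ≟ω = no λ ()
  ρ _       ≟ω = no λ ()
  other _   ≟ω = no λ ()

  indicator : Phase → Phase → ℕ
  indicator wantsIn  wantsIn  = 1
  indicator wantsOut wantsOut = 1
  indicator wantsω   wantsω   = 1
  indicator _        _        = 0

  indicator-refl : ∀ p → indicator p p ≡ 1
  indicator-refl wantsIn  = refl
  indicator-refl wantsOut = refl
  indicator-refl wantsω   = refl

  indicator-pos : ∀ q p {k} → indicator q p ≡ suc k → q ≡ p
  indicator-pos wantsIn  wantsIn  _ = refl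
  indicator-pos wantsOut wantsOut _ = refl
  indicator-pos wantsω   wantsω   _ = refl
  indicator-pos wantsIn  wantsOut ()
  indicator-pos wantsIn  wantsω   ()
  indicator-pos wantsOut wantsIn  ()
  indicator-pos wantsOut wantsω   ()
  indicator-pos wantsω   wantsIn  ()
  indicator-pos wantsω   wantsOut ()

  -- the number of users among 0 … n (inclusive) in phase p
  count : Phase → ℕ → (ℕ → Phase) → ℕ
  count p zero    g = indicator (g 0) p
  count p (suc n) g = count p n (λ i → g (suc i)) + indicator (g 0) p

  count-update : ∀ p n g i q → i ≤ n →
                 count p n (update g i q) + indicator (g i) p ≡ count p n g + indicator q p
  count-update p zero    g zero    q z≤n = +-comm (indicator q p) (indicator (g 0) p)
  count-update p (suc n) g zero    q z≤n = xy∙z≈xz∙y _ (indicator q p) (indicator (g 0) p)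
  count-update p (suc n) g (suc i) q (s≤s i≤n) = begin
    count p n (update g′ i q) + indicator (g 0) p + indicator (g′ i) p
      ≡⟨ xy∙z≈xz∙y _ (indicator (g 0) p) (indicator (g′ i) p) ⟩
    count p n (update g′ i q) + indicator (g′ i) p + indicator (g 0) p
      ≡⟨ cong (_+ indicator (g 0) p) (count-update p n g′ i q i≤n) ⟩
    count p n g′ + indicator q p + indicator (g 0) p
      ≡⟨ xy∙z≈xz∙y _ (indicator q p) (indicator (g 0) p) ⟩
    count p n g′ + indicator (g 0) p + indicator q p ∎
    where
    open ≡-Reasoning
    g′ = λ j → g (suc j)

  count-after-in : ∀ n g i → i ≤ n → g i ≡ wantsIn →
                   count wantsIn n g ≡ suc (count wantsIn n (update g i wantsOut))
                   × count wantsOut n (update g i wantsOut) ≡ suc (count wantsOut n g)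
  count-after-in n g i i≤n gi =
    trans (sym (+-identityʳ _)) (trans (sym (moved wantsIn)) (+-comm _ 1)) ,
    trans (sym (+-identityʳ _)) (trans (moved wantsOut) (+-comm _ 1))
    where
    moved : ∀ p → count p n (update g i wantsOut) + indicator wantsIn p ≡ count p n g + indicator wantsOut p
    moved p = subst (λ q → count p n (update g i wantsOut) + indicator q p ≡ count p n g + indicator wantsOut p) gi
        (count-update p n g i wantsOut i≤n)

  count-after-out : ∀ n g i → i ≤ n → g i ≡ wantsOut →
                    count wantsIn n (update g i wantsω) ≡ count wantsIn n g
                    × count wantsOut n g ≡ suc (count wantsOut n (update g i wantsω))
  count-after-out n g i i≤n gi =
    trans (sym (+-identityʳ _)) (trans (moved wantsIn) (+-identityʳ _)) ,
    trans (sym (+-identityʳ _)) (trans (sym (moved wantsOut)) (+-comm _ 1))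
    where
    moved : ∀ p → count p n (update g i wantsω) + indicator wantsOut p ≡ count p n g + indicator wantsω p
    moved p = subst (λ q → count p n (update g i wantsω) + indicator q p ≡ count p n g + indicator wantsω p) gi
        (count-update p n g i wantsω i≤n)

  count-pos⇒∃ : ∀ p n g → 1 ≤ count p n g → Σ ℕ λ i → i ≤ n × g i ≡ p
  count-pos⇒∃ p zero g pos with indicator (g 0) p in e
  ... | suc _ = 0 , z≤n , indicator-pos (g 0) p e
  count-pos⇒∃ p (suc n) g pos with indicator (g 0) p in e
  ... | suc _ = 0 , z≤n , indicator-pos (g 0) p e
  ... | zero with count-pos⇒∃ p n (λ i → g (suc i)) (subst (1 ≤_) (+-identityʳ _) pos)
  ...   | i , i≤n , gi = suc i , s≤s i≤n , gi

  ∃⇒count-pos : ∀ p n g i → i ≤ n → g i ≡ p → 1 ≤ count p n g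
  ∃⇒count-pos p zero    g zero    z≤n refl = ≤-reflexive (sym (indicator-refl (g 0)))
  ∃⇒count-pos p (suc n) g zero    z≤n refl =
    ≤-trans (≤-reflexive (sym (indicator-refl (g 0)))) (m≤n+m _ _)
  ∃⇒count-pos p (suc n) g (suc i) (s≤s i≤n) gi = ≤-trans (∃⇒count-pos p n _ i i≤n gi) (m≤m+n _ _)

  nothing-pending⇒all-wantsω : ∀ n g → count wantsIn n g + count wantsOut n g ≡ 0 →
                               ∀ i → i ≤ n → g i ≡ wantsω
  nothing-pending⇒all-wantsω n g none i i≤n with g i in gi
  ... | wantsω   = refl
  ... | wantsIn  with count wantsIn n g | ∃⇒count-pos wantsIn n g i i≤n gi
  ...   | suc _ | _ = ⊥-elim (1+n≢0 none)
  nothing-pending⇒all-wantsω n g none i i≤n | wantsOut with count wantsOut n g | ∃⇒count-pos wantsOut n g i i≤n gi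
  ... | suc c | _ = ⊥-elim (1+n≢0 (trans (sym (+-suc _ c)) none))

  count-wantsIn-initially : ∀ n → count wantsIn n (λ _ → wantsIn) ≡ suc n
  count-wantsIn-initially zero    = refl
  count-wantsIn-initially (suc n) = trans (+-comm _ 1) (cong suc (count-wantsIn-initially n))

  count-wantsOut-initially : ∀ n → count wantsOut n (λ _ → wantsIn) ≡ 0
  count-wantsOut-initially zero    = refl
  count-wantsOut-initially (suc n) = trans (+-identityʳ _) (count-wantsOut-initially n)

  servedBelow : ℕ → ℕ → Phase
  servedBelow u j = if j <ᵇ u then wantsω else wantsIn

  servedBelow-self : ∀ u → servedBelow u u ≡ wantsIn
  servedBelow-self u rewrite ≮⇒<ᵇ≡false (n≮n u) = refl

  servedBelow-below : ∀ u j → j < u → servedBelow u j ≡ wantsω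
  servedBelow-below u j j<u rewrite <⇒<ᵇ≡true j<u = refl

  serve-next : ∀ u j → update (update (servedBelow u) u wantsOut) u wantsω j ≡ servedBelow (suc u) j
  serve-next u j with j ≟ u
  ... | yes refl rewrite ≡⇒≡ᵇ≡true {j} {j} refl | <⇒<ᵇ≡true (n<1+n j) = refl
  ... | no j≢u   rewrite ≢⇒≡ᵇ≡false j≢u | <ᵇ-suc j u j≢u = refl

  module UserProcesses {K : Set} (body : K → Proc K) where
    open Semantics body
    open TimeSteps body

    userAt : Phase → Proc K
    userAt wantsIn  = upre (vis inA) (upre (vis outA) (upre (vis ω) nil))
    userAt wantsOut = upre (vis outA) (upre (vis ω) nil)
    userAt wantsω   = upre (vis ω) nil

    -- users 0 … n, user i being in phase g i (user 0 is the rightmost one)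
    Users : ℕ → (ℕ → Phase) → Proc K
    Users zero    g = userAt (g 0)
    Users (suc n) g = par (Users n (λ i → g (suc i))) (λ a → a ≡ ω) (userAt (g 0))

    U≡Users : ∀ n → U (suc n) ≡ Users n (λ _ → wantsIn)
    U≡Users zero    = refl
    U≡Users (suc n) = cong (λ x → par x (λ a → a ≡ ω) (userAt wantsIn)) (U≡Users n)

    Users-cong : ∀ n g g′ → (∀ i → i ≤ n → g i ≡ g′ i) → Users n g ≡ Users n g′
    Users-cong zero    g g′ g≗g′ = cong userAt (g≗g′ 0 z≤n)
    Users-cong (suc n) g g′ g≗g′ = cong₂ (λ x y → par x (λ a → a ≡ ω) (userAt y))
      (Users-cong n _ _ (λ i i≤n → g≗g′ (suc i) (s≤s i≤n))) (g≗g′ 0 z≤n)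

    data UserStep : Phase → ActT → Proc K → Set₁ where
      user-in  : UserStep wantsIn  (vis inA)  (userAt wantsOut)
      user-out : UserStep wantsOut (vis outA) (userAt wantsω)

    user-step-inv : ∀ p {α R} → userAt p ─⟨ α ⟩→ R → α ≢ vis ω → UserStep p α R
    user-step-inv wantsIn  upreA _  = user-in
    user-step-inv wantsOut upreA _  = user-out
    user-step-inv wantsω   upreA ¬ω = ⊥-elim (¬ω refl)

    data UsersStep (n : ℕ) (g : ℕ → Phase) : ActT → Proc K → Set₁ where
      users-in  : ∀ i → i ≤ n → g i ≡ wantsIn  → UsersStep n g (vis inA)  (Users n (update g i wantsOut))
      users-out : ∀ i → i ≤ n → g i ≡ wantsOut → UsersStep n g (vis outA) (Users n (update g i wantsω))

    users-step-inv : ∀ n g {α R} → Users n g ─⟨ α ⟩→ R → α ≢ vis ω → UsersStep n g α R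
    users-step-inv zero g d ¬ω with g 0 in g0 | user-step-inv (g 0) d ¬ω
    ... | wantsIn  | user-in  = users-in  0 z≤n g0
    ... | wantsOut | user-out = users-out 0 z≤n g0
    users-step-inv (suc n) g (parL _ d) ¬ω with users-step-inv n (λ i → g (suc i)) d ¬ω
    ... | users-in  i i≤n gi = users-in  (suc i) (s≤s i≤n) gi
    ... | users-out i i≤n gi = users-out (suc i) (s≤s i≤n) gi
    users-step-inv (suc n) g (parR _ d) ¬ω with g 0 in g0 | user-step-inv (g 0) d ¬ω
    ... | wantsIn  | user-in  = users-in  0 z≤n g0
    ... | wantsOut | user-out = users-out 0 z≤n g0
    users-step-inv (suc n) g (sync refl _ _) ¬ω = ⊥-elim (¬ω refl)

    users-in-step : ∀ n g i → i ≤ n → g i ≡ wantsIn → Users n g ─⟨ vis inA ⟩→ Users n (update g i wantsOut)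
    users-in-step zero    g zero    z≤n gi rewrite gi = upreA
    users-in-step (suc n) g zero    z≤n gi rewrite gi = parR (λ ()) upreA
    users-in-step (suc n) g (suc i) (s≤s i≤n) gi = parL (λ ()) (users-in-step n (λ j → g (suc j)) i i≤n gi)

    users-out-step : ∀ n g i → i ≤ n → g i ≡ wantsOut → Users n g ─⟨ vis outA ⟩→ Users n (update g i wantsω)
    users-out-step zero    g zero    z≤n gi rewrite gi = upreA
    users-out-step (suc n) g zero    z≤n gi rewrite gi = parR (λ ()) upreA
    users-out-step (suc n) g (suc i) (s≤s i≤n) gi = parL (λ ()) (users-out-step n (λ j → g (suc j)) i i≤n gi)

    users-ω-step : ∀ n g → (∀ i → i ≤ n → g i ≡ wantsω) → Σ (Proc K) λ R → Users n g ─⟨ vis ω ⟩→ R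
    users-ω-step zero    g all rewrite all 0 z≤n = _ , upreA
    users-ω-step (suc n) g all with users-ω-step n (λ j → g (suc j)) (λ i i≤n → all (suc i) (s≤s i≤n))
    ... | R , d rewrite all 0 z≤n = _ , sync refl d upreA

    -- all prefixes of a user are urgent, so time steps leave users unchanged
    userAt-tick : ∀ p → userAt p ─[ (λ _ → ⊥) ]→ userAt p
    userAt-tick wantsIn  = upreR λ ()
    userAt-tick wantsOut = upreR λ ()
    userAt-tick wantsω   = upreR λ ()

    users-tick : ∀ n g → Users n g ─[ (λ _ → ⊥) ]→ Users n g
    users-tick zero    g = userAt-tick (g 0)
    users-tick (suc n) g = parR {X₁ = λ _ → ⊥} {X₂ = λ _ → ⊥} (users-tick n _) (userAt-tick (g 0)) (λ _ ())

    users-tick-inert : ∀ n g {X R} → Users n g ─[ X ]→ R → R ≡ Users n g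
    users-tick-inert n g d = sym (tick-idempotent (users-tick n g) d)

    users-urgent-in : ∀ n g i → i ≤ n → g i ≡ wantsIn → Urgent (Users n g) (vis inA)
    users-urgent-in n g i i≤n gi = ticked⇒urgent (users-tick n g) (users-in-step n g i i≤n gi)

    users-urgent-out : ∀ n g i → i ≤ n → g i ≡ wantsOut → Urgent (Users n g) (vis outA)
    users-urgent-out n g i i≤n gi = ticked⇒urgent (users-tick n g) (users-out-step n g i i≤n gi)

    users-urgent-ω : ∀ n g → (∀ i → i ≤ n → g i ≡ wantsω) → Urgent (Users n g) (vis ω)
    users-urgent-ω n g all = ticked⇒urgent (users-tick n g) (proj₂ (users-ω-step n g all))

    -- the largest refusal set of a time step of the users
    UsersRefusal : ℕ → (ℕ → Phase) → ASet
    UsersRefusal n g a = (a ≡ inA → ∀ i → i ≤ n → g i ≢ wantsIn)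
                       × (a ≡ outA → ∀ i → i ≤ n → g i ≢ wantsOut)
                       × (a ≡ ω → Σ ℕ λ i → i ≤ n × g i ≢ wantsω)

    userAt-tick-refusing : ∀ g → userAt (g 0) ─[ UsersRefusal zero g ]→ userAt (g 0)
    userAt-tick-refusing g with g 0 in g0
    ... | wantsIn  = upreR λ (r , _) → r refl 0 z≤n g0
    ... | wantsOut = upreR λ (_ , r , _) → r refl 0 z≤n g0
    ... | wantsω   = upreR λ (_ , _ , r) → lemma (r refl)
      where
      lemma : (Σ ℕ λ i → i ≤ 0 × g i ≢ wantsω) → ⊥
      lemma (zero , z≤n , ≢) = ≢ g0

    users-tick-refusing : ∀ n g → Users n g ─[ UsersRefusal n g ]→ Users n g
    users-tick-refusing zero g = userAt-tick-refusing g
    users-tick-refusing (suc n) g = parR (users-tick-refusing n g′) (userAt-tick-refusing (λ _ → g 0)) split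
      where
      g′ = λ j → g (suc j)
      split : ∀ a → UsersRefusal (suc n) g a →
              ((a ≡ ω) × (UsersRefusal n g′ a ⊎ UsersRefusal zero (λ _ → g 0) a))
              ⊎ ((UsersRefusal n g′ a × UsersRefusal zero (λ _ → g 0) a) × ¬ (a ≡ ω))
      split a (r-in , r-out , r-ω) with a ≟ω
      ... | yes refl with r-ω refl
      ...   | zero  , _        , ≢ = inj₁ (refl , inj₂ ((λ ()) , (λ ()) , λ _ → 0 , z≤n , ≢))
      ...   | suc i , s≤s i≤n , ≢ = inj₁ (refl , inj₁ ((λ ()) , (λ ()) , λ _ → i , i≤n , ≢))
      split a (r-in , r-out , r-ω) | no a≢ω =
        inj₂ (( ((λ e i i≤n → r-in e (suc i) (s≤s i≤n)) , (λ e i i≤n → r-out e (suc i) (s≤s i≤n)) , (λ e → ⊥-elim (a≢ω e)))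
              , ((λ e _ _ → r-in e 0 z≤n) , (λ e _ _ → r-out e 0 z≤n) , (λ e → ⊥-elim (a≢ω e))) ) , a≢ω)

module Budget where

  open import Defs
  open Timed
  open FunUpdate
  open Users
  open import Data.Nat using (ℕ; zero; suc; _+_; _≤_; z≤n; s≤s)
  open import Data.Nat.Properties using (≤-refl)
  open import Data.Product using (Σ; _×_; _,_; proj₁; proj₂)
  open import Data.Sum using (_⊎_; inj₁; inj₂)
  open import Data.Empty using (⊥-elim)
  open import Data.Unit using (⊤; tt)
  open import Data.List using (List; []; _∷_; _++_)
  open import Data.List.Membership.Propositional using (_∈_)
  open import Data.List.Membership.Propositional.Properties using (∈-++⁻)
  open import Data.List.Relation.Unary.Any using (here; there)
  open import Relation.Nullary using (¬_; yes; no)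
  open import Relation.Binary.PropositionalEquality using (_≡_; _≢_; refl; cong; cong₂; sym; trans; subst)

  eraseτ-++ : ∀ ws vs → eraseτ (ws ++ vs) ≡ eraseτ ws ++ eraseτ vs
  eraseτ-++ []                 vs = refl
  eraseτ-++ (act (vis a) ∷ ws) vs = cong (act a ∷_) (eraseτ-++ ws vs)
  eraseτ-++ (act τ ∷ ws)       vs = eraseτ-++ ws vs
  eraseτ-++ (tick ∷ ws)        vs = cong (tick ∷_) (eraseτ-++ ws vs)

  ζ-++ : ∀ v u → ζ (v ++ u) ≡ ζ v + ζ u
  ζ-++ []          u = refl
  ζ-++ (tick ∷ v)  u = cong suc (ζ-++ v u)
  ζ-++ (act _ ∷ v) u = ζ-++ v u

  module ClosedSystem {K : Set} (body : K → Proc K) where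
    open Semantics body
    open TimeSteps body
    open UserProcesses body

    withUsers : Proc K → ℕ → (ℕ → Phase) → Proc K
    withUsers P n g = P ∥ Users n g

    -- In a time step of P ∥ Users with some user still to serve, the urgency of
    -- the users forces P to refuse every action a waiting user offers.
    module _ {P P′ S n g X₁ X₂} (d : P ─[ X₁ ]→ P′) (e : Users n g ─[ X₂ ]→ S)
             (c : ∀ a → ⊤ → ((¬ a ≡ ω) × (X₁ a ⊎ X₂ a)) ⊎ ((X₁ a × X₂ a) × ¬ ¬ a ≡ ω)) where

      tick-refuses-in : 1 ≤ count wantsIn n g → X₁ inA
      tick-refuses-in pos with count-pos⇒∃ wantsIn n g pos
      ... | i , i≤n , gi with c inA tt
      ...   | inj₁ (_ , inj₁ r₁) = r₁
      ...   | inj₁ (_ , inj₂ r₂) = ⊥-elim (users-urgent-in n g i i≤n gi e r₂)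
      ...   | inj₂ (_ , ¬¬ω)     = ⊥-elim (¬¬ω λ ())

      tick-refuses-out : 1 ≤ count wantsOut n g → X₁ outA
      tick-refuses-out pos with count-pos⇒∃ wantsOut n g pos
      ... | i , i≤n , gi with c outA tt
      ...   | inj₁ (_ , inj₁ r₁) = r₁
      ...   | inj₁ (_ , inj₂ r₂) = ⊥-elim (users-urgent-out n g i i≤n gi e r₂)
      ...   | inj₂ (_ , ¬¬ω)     = ⊥-elim (¬¬ω λ ())

      tick-pending : 1 ≤ count wantsIn n g + count wantsOut n g
      tick-pending with count wantsIn n g + count wantsOut n g in none
      ... | suc _ = s≤s z≤n
      ... | zero with c ω tt
      ...   | inj₁ (ω≢ω , _)     = ⊥-elim (ω≢ω refl)
      ...   | inj₂ ((_ , r₂) , _) = ⊥-elim (users-urgent-ω n g (nothing-pending⇒all-wantsω n g none) e r₂)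

    -- Inv P c₀ c₁ b: P, facing c₀ users wanting in and c₁ wanting out, can let at
    -- most b more time steps pass before some user is finished.
    module BudgetArgument
      (Inv : Proc K → ℕ → ℕ → ℕ → Set₁)
      (inv-τ : ∀ {P P′ c₀ c₁ b} → Inv P c₀ c₁ b → P ─⟨ τ ⟩→ P′ → Inv P′ c₀ c₁ b)
      (inv-in : ∀ {P P′ c₀ c₁ b} → Inv P (suc c₀) c₁ b → P ─⟨ vis inA ⟩→ P′ → Inv P′ c₀ (suc c₁) b)
      (inv-out : ∀ {P P′ c₀ c₁ b} → Inv P c₀ (suc c₁) b → P ─⟨ vis outA ⟩→ P′ → Inv P′ c₀ c₁ b)
      (inv-tick : ∀ {P P′ X c₀ c₁ b} → Inv P c₀ c₁ b → P ─[ X ]→ P′ → (1 ≤ c₀ → X inA) →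
                  (1 ≤ c₁ → X outA) → 1 ≤ c₀ + c₁ → Σ ℕ λ b′ → b ≡ suc b′ × Inv P′ c₀ c₁ b′)
      where

      Inv′ : Proc K → ℕ → (ℕ → Phase) → ℕ → Set₁
      Inv′ P n g b = Inv P (count wantsIn n g) (count wantsOut n g) b

      inv-user-in : ∀ {P P′ n g b} i → i ≤ n → g i ≡ wantsIn → Inv′ P n g b →
                    P ─⟨ vis inA ⟩→ P′ → Inv′ P′ n (update g i wantsOut) b
      inv-user-in {P} {P′} {n} {g} {b} i i≤n gi I d =
        subst (λ c → Inv P′ (count wantsIn n (update g i wantsOut)) c b) (sym c₁≡)
          (inv-in (subst (λ c → Inv P c (count wantsOut n g) b) c₀≡ I) d)
        where
        c₀≡ = proj₁ (count-after-in n g i i≤n gi)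
        c₁≡ = proj₂ (count-after-in n g i i≤n gi)

      inv-user-out : ∀ {P P′ n g b} i → i ≤ n → g i ≡ wantsOut → Inv′ P n g b →
                     P ─⟨ vis outA ⟩→ P′ → Inv′ P′ n (update g i wantsω) b
      inv-user-out {P} {P′} {n} {g} {b} i i≤n gi I d =
        subst (λ c → Inv P′ c (count wantsOut n (update g i wantsω)) b) (sym c₀≡)
          (inv-out (subst (λ c → Inv P (count wantsIn n g) c b) c₁≡ I) d)
        where
        c₀≡ = proj₁ (count-after-out n g i i≤n gi)
        c₁≡ = proj₂ (count-after-out n g i i≤n gi)

      ticks≤budget : ∀ n {ws g P R b} → Steps (withUsers P n g) ws R → ¬ (act ω ∈ eraseτ ws) →
                     Inv′ P n g b → ζ (eraseτ ws) ≤ b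
      ticks≤budget n done _ I = z≤n
      ticks≤budget n (stepA (parL {α = τ} _ e) rest) ¬ω I = ticks≤budget n rest ¬ω (inv-τ I e)
      ticks≤budget n (stepA (parL {α = vis a} a∉ _) _) ¬ω I = ⊥-elim (a∉ λ a≡ω → ¬ω (here (cong act (sym a≡ω))))
      ticks≤budget n {g = g} (stepA (parR {α = τ} _ e) _) ¬ω I with users-step-inv n g e (λ ())
      ... | ()
      ticks≤budget n {g = g} (stepA (parR {α = vis a} a∉ e) _) ¬ω I
        with users-step-inv n g e (λ eq → ¬ω (here (cong act (sym (vis-injective eq)))))
      ... | users-in  _ _ _ = ⊥-elim (a∉ λ ())
      ... | users-out _ _ _ = ⊥-elim (a∉ λ ())
      ticks≤budget n {g = g} (stepA (sync a≢ω d e) rest) ¬ω I with users-step-inv n g e (λ eq → a≢ω (vis-injective eq))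
      ... | users-in  i i≤n gi = ticks≤budget n rest (λ m → ¬ω (there m)) (inv-user-in  i i≤n gi I d)
      ... | users-out i i≤n gi = ticks≤budget n rest (λ m → ¬ω (there m)) (inv-user-out i i≤n gi I d)
      ticks≤budget n {g = g} (stepT (parR d e c) rest) ¬ω I
        with inv-tick I d (tick-refuses-in {n = n} {g} d e c) (tick-refuses-out {n = n} {g} d e c)
                         (tick-pending {n = n} {g} d e c)
      ... | b′ , refl , I′ =
        s≤s (ticks≤budget n (subst (λ S → Steps (par _ _ S) _ _) (users-tick-inert n g e) rest) (λ m → ¬ω (there m)) I′)

      ticks≤budget-initially : ∀ n {P ws R b} → Steps (P ∥ U (suc n)) ws R → ¬ (act ω ∈ eraseτ ws) →
                               Inv P (suc n) 0 b → ζ (eraseτ ws) ≤ b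
      ticks≤budget-initially n {P} {b = b} steps ¬ω I =
        ticks≤budget n (subst (λ u → Steps (P ∥ u) _ _) (U≡Users n) steps) ¬ω
          (subst (λ c → Inv P c (count wantsOut n (λ _ → wantsIn)) b) (sym (count-wantsIn-initially n))
            (subst (λ c → Inv P (suc n) c b) (sym (count-wantsOut-initially n)) I))

    record Run (P Q : Proc K) (k : ℕ) : Set₁ where
      constructor run
      field
        labels : List Lab
        steps  : Steps P labels Q
        ω-free : ¬ (act ω ∈ eraseτ labels)
        ticks  : ζ (eraseτ labels) ≡ k

    Steps-++ : ∀ {P Q R ws vs} → Steps P ws Q → Steps Q vs R → Steps P (ws ++ vs) R
    Steps-++ done        s = s
    Steps-++ (stepA d r) s = stepA d (Steps-++ r s)
    Steps-++ (stepT d r) s = stepT d (Steps-++ r s)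

    run-refl : ∀ {P} → Run P P 0
    run-refl = run [] done (λ ()) refl

    infixr 5 _▸_
    _▸_ : ∀ {P Q R k l} → Run P Q k → Run Q R l → Run P R (k + l)
    run ws s ¬ω₁ k ▸ run vs t ¬ω₂ l = run (ws ++ vs) (Steps-++ s t) ¬ω
      (trans (cong ζ (eraseτ-++ ws vs)) (trans (ζ-++ (eraseτ ws) (eraseτ vs)) (cong₂ _+_ k l)))
      where
      ¬ω : ¬ (act ω ∈ eraseτ (ws ++ vs))
      ¬ω m with ∈-++⁻ (eraseτ ws) (subst (act ω ∈_) (eraseτ-++ ws vs) m)
      ... | inj₁ m₁ = ¬ω₁ m₁
      ... | inj₂ m₂ = ¬ω₂ m₂

    run-τ : ∀ {P P′ n g} → P ─⟨ τ ⟩→ P′ → Run (withUsers P n g) (withUsers P′ n g) 0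
    run-τ d = run (act τ ∷ []) (stepA (parL (λ ()) d) done) (λ ()) refl

    run-in : ∀ {P P′ n g} i → i ≤ n → g i ≡ wantsIn → P ─⟨ vis inA ⟩→ P′ →
             Run (withUsers P n g) (withUsers P′ n (update g i wantsOut)) 0
    run-in {n = n} {g} i i≤n gi d =
      run (act (vis inA) ∷ []) (stepA (sync (λ ()) d (users-in-step n g i i≤n gi)) done) (λ { (here ()) ; (there ()) }) refl

    run-out : ∀ {P P′ n g} i → i ≤ n → g i ≡ wantsOut → P ─⟨ vis outA ⟩→ P′ →
              Run (withUsers P n g) (withUsers P′ n (update g i wantsω)) 0
    run-out {n = n} {g} i i≤n gi d =
      run (act (vis outA) ∷ []) (stepA (sync (λ ()) d (users-out-step n g i i≤n gi)) done) (λ { (here ()) ; (there ()) }) refl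

    run-tick : ∀ {P P′ n g X} → P ─[ X ]→ P′ → (∀ a → a ≢ ω → X a ⊎ UsersRefusal n g a) → X ω →
               (Σ ℕ λ i → i ≤ n × g i ≢ wantsω) → Run (withUsers P n g) (withUsers P′ n g) 1
    run-tick {n = n} {g} {X} d cover Xω unfinished =
      run (tick ∷ []) (stepT (parR d (users-tick-refusing n g) split) done) (λ { (here ()) ; (there ()) }) refl
      where
      split : ∀ a → ⊤ → ((¬ a ≡ ω) × (X a ⊎ UsersRefusal n g a)) ⊎ ((X a × UsersRefusal n g a) × ¬ ¬ a ≡ ω)
      split a _ with a ≟ω
      ... | yes refl = inj₂ ((Xω , (λ ()) , (λ ()) , (λ _ → unfinished)) , λ ω≢ω → ω≢ω refl)
      ... | no a≢ω   = inj₁ (a≢ω , cover a a≢ω)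

    Run-subst : ∀ {P P′ Q Q′ k k′} → P ≡ P′ → Q ≡ Q′ → k ≡ k′ → Run P Q k → Run P′ Q′ k′
    Run-subst refl refl refl r = r

    run⇒RPAtLeast : ∀ {st n Q k} → Run (st ∥ U n) Q k → RPAtLeast (record { K = K ; body = body ; start = st }) n k
    run⇒RPAtLeast (run ws steps ¬ω refl) = eraseτ ws , (ws , _ , steps , refl) , ¬ω , ≤-refl

module Cells where

  open FunUpdate
  open import Data.Nat using (ℕ; suc)
  open import Data.Nat.Properties using (1+n≢n)
  open import Data.Bool using (Bool; true; false)
  open import Relation.Binary.PropositionalEquality using (_≡_; _≢_; refl; trans)

  -- State of a one-place cell C; the superscript u marks a cell that has let
  -- time pass, whose next action is therefore urgent.
  data CellState : Set where
    E Eᵘ F Fᵘ : CellState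

  isFull : CellState → Bool
  isFull E  = false
  isFull Eᵘ = false
  isFull F  = true
  isFull Fᵘ = true

  isTicked : CellState → Bool
  isTicked E  = false
  isTicked Eᵘ = true
  isTicked F  = false
  isTicked Fᵘ = true

  tickCell : CellState → CellState
  tickCell E  = Eᵘ
  tickCell Eᵘ = Eᵘ
  tickCell F  = Fᵘ
  tickCell Fᵘ = Fᵘ

  isFull-tickCell : ∀ c → isFull (tickCell c) ≡ isFull c
  isFull-tickCell E  = refl
  isFull-tickCell Eᵘ = refl
  isFull-tickCell F  = refl
  isFull-tickCell Fᵘ = refl

  isTicked-tickCell : ∀ c → isTicked (tickCell c) ≡ true
  isTicked-tickCell E  = refl
  isTicked-tickCell Eᵘ = refl
  isTicked-tickCell F  = refl
  isTicked-tickCell Fᵘ = refl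

  tickAll : (ℕ → CellState) → ℕ → CellState
  tickAll f k = tickCell (f k)

  move : (ℕ → CellState) → ℕ → ℕ → CellState
  move f j = update (update f (suc j) E) j F

  move-at : ∀ f j → move f j j ≡ F
  move-at f j = update-same (update f (suc j) E) j F

  move-above : ∀ f j → move f j (suc j) ≡ E
  move-above f j = trans (update-other (update f (suc j) E) j F (suc j) 1+n≢n) (update-same f (suc j) E)

  move-other : ∀ f j k → k ≢ j → k ≢ suc j → move f j k ≡ f k
  move-other f j k k≢j k≢1+j = trans (update-other (update f (suc j) E) j F k k≢j) (update-other f (suc j) E k k≢1+j)

module FifoBound where

  open import Defs
  open BoolCmp
  open Timed
  open Budget
  open import Data.Nat using (ℕ; zero; suc; _+_; _*_; _≤_; z≤n; s≤s; _<ᵇ_; _≡ᵇ_)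
  open import Data.Nat.Properties
  open import Data.Nat.Tactic.RingSolver using (solve-∀)
  open import Data.Bool using (true; false)
  open import Data.Product using (Σ; _×_; _,_)
  open import Data.Sum using (_⊎_; inj₁; inj₂)
  open import Data.Empty using (⊥-elim)
  open import Data.List.Membership.Propositional using (_∈_)
  open import Relation.Nullary using (¬_)
  open import Relation.Binary.PropositionalEquality using (_≡_; refl; sym; trans; subst; subst₂)

  module _ (N : ℕ) where
    open Semantics (fifoBody N)
    open TimeSteps (fifoBody N)
    open ClosedSystem (fifoBody N)

    fifo-prefixSum : ∀ j → PrefixSum (fifoBody N j)
    fifo-prefixSum zero = pre-ps
    fifo-prefixSum (suc j) with suc j <ᵇ N + 2
    ... | true = sum-ps pre-ps pre-ps
    ... | false with suc j ≡ᵇ N + 2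
    ...   | true  = pre-ps
    ...   | false = nil-ps

    data FifoStep (j : ℕ) : ActT → Proc ℕ → Set₁ where
      fifo-in  : suc j ≤ N + 2 → FifoStep j (vis inA) (con (suc j))
      fifo-out : ∀ j′ → j ≡ suc j′ → FifoStep j (vis outA) (con j′)

    pre⊕pre-step-inv : ∀ {a b P Q α R} → (pre a P ⊕ pre b Q) ─⟨ α ⟩→ R → (α ≡ a × R ≡ P) ⊎ (α ≡ b × R ≡ Q)
    pre⊕pre-step-inv (sumL preA) = inj₁ (refl , refl)
    pre⊕pre-step-inv (sumR preA) = inj₂ (refl , refl)

    fifo-step-inv : ∀ j {α R} → con j ─⟨ α ⟩→ R → FifoStep j α R
    fifo-step-inv zero (conA preA) = fifo-in (subst (1 ≤_) (+-comm 2 N) (s≤s z≤n))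
    fifo-step-inv (suc j) (conA d) with suc j <ᵇ N + 2 in lt
    ... | true with pre⊕pre-step-inv d
    ...   | inj₁ (refl , refl) = fifo-in (<ᵇ≡true⇒< _ _ lt)
    ...   | inj₂ (refl , refl) = fifo-out j refl
    fifo-step-inv (suc j) (conA d) | false with suc j ≡ᵇ N + 2 in eq
    fifo-step-inv (suc j) (conA preA) | false | true =
      fifo-out (N + 1) (trans (≡ᵇ≡true⇒≡ (suc j) (N + 2) eq) (+-suc N 1))
    fifo-step-inv (suc j) (conA ()) | false | false

    fifoBody-inner : ∀ j → (suc j <ᵇ N + 2) ≡ true →
                     fifoBody N (suc j) ≡ (pre (vis inA) (con (suc (suc j))) ⊕ pre (vis outA) (con j))
    fifoBody-inner j lt rewrite lt = refl

    fifoBody-full : ∀ j → (suc j <ᵇ N + 2) ≡ false → (suc j ≡ᵇ N + 2) ≡ true →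
                    fifoBody N (suc j) ≡ pre (vis outA) (con (N + 1))
    fifoBody-full j lt eq rewrite lt | eq = refl

    fifo-out-step : ∀ j → suc j ≤ N + 2 → con (suc j) ─⟨ vis outA ⟩→ con j
    fifo-out-step j j<N+2 with suc j <ᵇ N + 2 in lt
    ... | true = conA (subst (_─⟨ vis outA ⟩→ con j) (sym (fifoBody-inner j lt)) (sumR preA))
    ... | false with suc j ≡ᵇ N + 2 in eq
    ...   | true  = conA (subst₂ (λ P i → P ─⟨ vis outA ⟩→ con i) (sym (fifoBody-full j lt eq)) N+1≡j preA)
      where
      N+1≡j : N + 1 ≡ j
      N+1≡j = suc-injective (trans (sym (+-suc N 1)) (sym (≡ᵇ≡true⇒≡ (suc j) (N + 2) eq)))
    ...   | false = ⊥-elim (<ᵇ≡false⇒≮ _ _ lt (≤∧≢⇒< j<N+2 (≡ᵇ≡false⇒≢ _ _ eq)))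

    -- Fifo(c₁) holds the c₁ items of the users wanting out; every remaining time
    -- step serves one of the c₀ + c₀ + c₁ pending in/out actions.  A fresh state
    -- has not yet let time pass; a ticked one has, and then its next action is urgent.
    data FifoInv (P : Proc ℕ) (c₀ c₁ b : ℕ) : Set₁ where
      fresh  : c₁ ≤ N + 2 → P ≡ con c₁ → c₀ + c₀ + c₁ ≤ b → FifoInv P c₀ c₁ b
      ticked : ∀ {X} → c₁ ≤ N + 2 → con c₁ ─[ X ]→ P → c₀ + c₀ + c₁ ≤ suc b → FifoInv P c₀ c₁ b

    capacity : ∀ {P c₀ c₁ b} → FifoInv P c₀ c₁ b → c₁ ≤ N + 2
    capacity (fresh  c₁≤ _ _) = c₁≤
    capacity (ticked c₁≤ _ _) = c₁≤

    potential : ∀ {P c₀ c₁ b} → FifoInv P c₀ c₁ b → c₀ + c₀ + c₁ ≤ suc b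
    potential (fresh  _ _ p) = m≤n⇒m≤1+n p
    potential (ticked _ _ p) = p

    step-of-con : ∀ {P c₀ c₁ b α R} → FifoInv P c₀ c₁ b → P ─⟨ α ⟩→ R → con c₁ ─⟨ α ⟩→ R
    step-of-con (fresh _ refl _) d = d
    step-of-con {c₁ = c₁} (ticked _ t _) d = step-before-tick (con-ps (fifo-prefixSum c₁)) t d

    inv-τ : ∀ {P P′ c₀ c₁ b} → FifoInv P c₀ c₁ b → P ─⟨ τ ⟩→ P′ → FifoInv P′ c₀ c₁ b
    inv-τ I d with fifo-step-inv _ (step-of-con I d)
    ... | ()

    inv-in : ∀ {P P′ c₀ c₁ b} → FifoInv P (suc c₀) c₁ b → P ─⟨ vis inA ⟩→ P′ → FifoInv P′ c₀ (suc c₁) b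
    inv-in {c₀ = c₀} {c₁} {b} I d with fifo-step-inv _ (step-of-con I d)
    ... | fifo-in c₁<N+2 = fresh c₁<N+2 refl (≤-pred (subst (_≤ suc b) (shift c₀ c₁) (potential I)))
      where
      shift : ∀ x y → suc x + suc x + y ≡ suc (x + x + suc y)
      shift = solve-∀

    inv-out : ∀ {P P′ c₀ c₁ b} → FifoInv P c₀ (suc c₁) b → P ─⟨ vis outA ⟩→ P′ → FifoInv P′ c₀ c₁ b
    inv-out {c₀ = c₀} {c₁} {b} I d with fifo-step-inv _ (step-of-con I d)
    ... | fifo-out _ refl =
      fresh (≤-trans (n≤1+n _) (capacity I)) refl (≤-pred (subst (_≤ suc b) (+-suc (c₀ + c₀) c₁) (potential I)))

    inv-tick : ∀ {P P′ X c₀ c₁ b} → FifoInv P c₀ c₁ b → P ─[ X ]→ P′ → (1 ≤ c₀ → X inA) →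
               (1 ≤ c₁ → X outA) → 1 ≤ c₀ + c₁ → Σ ℕ λ b′ → b ≡ suc b′ × FifoInv P′ c₀ c₁ b′
    inv-tick {c₀ = zero}  {zero}   _ _ _ _ ()
    inv-tick {c₀ = suc _} {b = zero} (fresh _ _ ()) _ _ _ _
    inv-tick {c₀ = zero}  {suc _} {b = zero} (fresh _ _ ()) _ _ _ _
    inv-tick {b = suc b} (fresh c₁≤ refl p) d _ _ _ = b , refl , ticked c₁≤ d p
    inv-tick {c₁ = suc c₁} (ticked c₁≤ t _) d _ refuse-out _ =
      ⊥-elim (ticked⇒urgent t (step-after-tick (con-ps (fifo-prefixSum (suc c₁))) t (fifo-out-step c₁ c₁≤))
                            d (refuse-out (s≤s z≤n)))
    inv-tick {c₀ = suc _} {zero} (ticked _ t _) d refuse-in _ _ =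
      ⊥-elim (ticked⇒urgent t (step-after-tick (con-ps (fifo-prefixSum 0)) t (conA preA)) d (refuse-in (s≤s z≤n)))

    open BudgetArgument FifoInv inv-τ inv-in inv-out inv-tick

    fifo-ticks≤ : ∀ n {ws R} → Steps (start (Fifo N) ∥ U (suc n)) ws R → ¬ (act ω ∈ eraseτ ws) →
                  ζ (eraseτ ws) ≤ 2 * suc n
    fifo-ticks≤ n steps ¬ω = ticks≤budget-initially n steps ¬ω (fresh z≤n refl (≤-reflexive (twice (suc n))))
      where
      twice : ∀ m → m + m + 0 ≡ 2 * m
      twice = solve-∀

module Modular (N : ℕ) .{{_ : NonZero N}} where

  open import Defs using (_⊞_)
  open import Data.Nat using (ℕ; suc; _+_; _∸_; _<_; z≤n; s≤s; NonZero)
  open import Data.Nat.Properties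
  open import Data.Nat.DivMod
  open import Relation.Binary.PropositionalEquality using (_≡_; cong; sym; trans; subst; module ≡-Reasoning)

  open ≡-Reasoning

  _⊞′_ : ℕ → ℕ → ℕ
  a ⊞′ b = _⊞_ N a b

  _⊟_ : ℕ → ℕ → ℕ
  j ⊟ i = (j + (N ∸ i)) % N

  ⊞<N : ∀ a b → a ⊞′ b < N
  ⊞<N a b = m%n<n (a + b) N

  ⊟<N : ∀ j i → j ⊟ i < N
  ⊟<N j i = m%n<n (j + (N ∸ i)) N

  ⊞-identityʳ : ∀ i → i < N → i ⊞′ 0 ≡ i
  ⊞-identityʳ i i<N = trans (cong (_% N) (+-identityʳ i)) (m<n⇒m%n≡m i<N)

  ⊞-N : ∀ i → i < N → i ⊞′ N ≡ i
  ⊞-N i i<N = trans ([m+n]%n≡m%n i N) (m<n⇒m%n≡m i<N)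

  [m%N+n]%N≡[m+n]%N : ∀ m n → ((m % N) + n) % N ≡ (m + n) % N
  [m%N+n]%N≡[m+n]%N m n = begin
    ((m % N) + n) % N            ≡⟨ %-distribˡ-+ (m % N) n N ⟩
    ((m % N % N) + (n % N)) % N  ≡⟨ cong (λ x → (x + (n % N)) % N) (m%n%n≡m%n m N) ⟩
    ((m % N) + (n % N)) % N      ≡⟨ sym (%-distribˡ-+ m n N) ⟩
    (m + n) % N                  ∎

  ⊞-assoc : ∀ i s t → (i ⊞′ s) ⊞′ t ≡ i ⊞′ (s + t)
  ⊞-assoc i s t = trans ([m%N+n]%N≡[m+n]%N (i + s) t) (cong (_% N) (+-assoc i s t))

  ⊞-⊟-cancel : ∀ i t → i < N → t < N → (i ⊞′ t) ⊟ i ≡ t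
  ⊞-⊟-cancel i t i<N t<N = begin
    (((i + t) % N) + (N ∸ i)) % N  ≡⟨ [m%N+n]%N≡[m+n]%N (i + t) (N ∸ i) ⟩
    ((i + t) + (N ∸ i)) % N        ≡⟨ cong (_% N) (i+t+[N∸i]≡t+N) ⟩
    (t + N) % N                    ≡⟨ [m+n]%n≡m%n t N ⟩
    t % N                          ≡⟨ m<n⇒m%n≡m t<N ⟩
    t                              ∎
    where
    i+t+[N∸i]≡t+N : (i + t) + (N ∸ i) ≡ t + N
    i+t+[N∸i]≡t+N = begin
      (i + t) + (N ∸ i) ≡⟨ cong (_+ (N ∸ i)) (+-comm i t) ⟩
      (t + i) + (N ∸ i) ≡⟨ +-assoc t i (N ∸ i) ⟩
      t + (i + (N ∸ i)) ≡⟨ cong (t +_) (m+[n∸m]≡n (<⇒≤ i<N)) ⟩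
      t + N             ∎

  ⊟-⊞-cancel : ∀ i j → i < N → j < N → i ⊞′ (j ⊟ i) ≡ j
  ⊟-⊞-cancel i j i<N j<N = begin
    (i + ((j + (N ∸ i)) % N)) % N  ≡⟨ cong (_% N) (+-comm i _) ⟩
    (((j + (N ∸ i)) % N) + i) % N  ≡⟨ [m%N+n]%N≡[m+n]%N (j + (N ∸ i)) i ⟩
    ((j + (N ∸ i)) + i) % N        ≡⟨ cong (_% N) (trans (+-assoc j (N ∸ i) i) (cong (j +_) (m∸n+n≡m (<⇒≤ i<N)))) ⟩
    (j + N) % N                    ≡⟨ [m+n]%n≡m%n j N ⟩
    j % N                          ≡⟨ m<n⇒m%n≡m j<N ⟩
    j                              ∎

  ⊟-self : ∀ i → i < N → i ⊟ i ≡ 0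
  ⊟-self i i<N = trans (cong (_⊟ i) (sym (⊞-identityʳ i i<N))) (⊞-⊟-cancel i 0 i<N (≤-trans (s≤s z≤n) i<N))

  ⊟-suc : ∀ i j t → i < N → j < N → j ⊟ i ≡ suc t → j ⊟ (i ⊞′ 1) ≡ t
  ⊟-suc i j t i<N j<N j⊟i≡1+t = begin
    j ⊟ (i ⊞′ 1)                 ≡⟨ cong (_⊟ (i ⊞′ 1)) (sym j≡) ⟩
    ((i ⊞′ 1) ⊞′ t) ⊟ (i ⊞′ 1)   ≡⟨ ⊞-⊟-cancel (i ⊞′ 1) t (⊞<N i 1) t<N ⟩
    t                            ∎
    where
    t<N : t < N
    t<N = <-trans (n<1+n t) (subst (_< N) j⊟i≡1+t (⊟<N j i))
    j≡ : (i ⊞′ 1) ⊞′ t ≡ j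
    j≡ = trans (⊞-assoc i 1 t) (trans (cong (i ⊞′_) (sym j⊟i≡1+t)) (⊟-⊞-cancel i j i<N j<N))

  ⊟-pred : ∀ i → i < N → suc (i ⊟ (i ⊞′ 1)) ≡ N
  ⊟-pred i i<N = begin
    suc (i ⊟ (i ⊞′ 1))                         ≡⟨ cong (λ x → suc (x ⊟ (i ⊞′ 1))) (sym i≡) ⟩
    suc (((i ⊞′ 1) ⊞′ (N ∸ 1)) ⊟ (i ⊞′ 1))     ≡⟨ cong suc (⊞-⊟-cancel (i ⊞′ 1) (N ∸ 1) (⊞<N i 1) N∸1<N) ⟩
    suc (N ∸ 1)                                ≡⟨ suc-pred N ⟩
    N                                          ∎
    where
    N∸1<N : N ∸ 1 < N
    N∸1<N = ≤-reflexive (suc-pred N)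
    i≡ : (i ⊞′ 1) ⊞′ (N ∸ 1) ≡ i
    i≡ = trans (⊞-assoc i 1 (N ∸ 1)) (trans (cong (i ⊞′_) (suc-pred N)) (⊞-N i i<N))

module Memory (N : ℕ) .{{_ : NonZero N}} where

  open import Defs
  open BoolCmp
  open FunUpdate
  open Cells
  open Timed
  open import Data.Nat using (ℕ; zero; suc; _∸_; _≤_; _<_; z≤n; s≤s; NonZero)
  open import Data.Nat.Properties
  open import Data.Product using (_,_)
  open import Data.Sum using (inj₁; inj₂)
  open import Data.Empty using (⊥)
  open import Data.Unit using (tt)
  open import Data.Bool using (Bool; true; false; T)
  open import Relation.Nullary using (¬_)
  open import Relation.Binary.PropositionalEquality using (_≡_; refl; cong; cong₂; sym; subst)

  open Semantics (buffBody N)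
  open TimeSteps (buffBody N)

  B : ASet
  B a = T (isB N a)

  B-w : ∀ j → j < N → B (w j)
  B-w j j<N = subst T (sym (<⇒<ᵇ≡true j<N)) tt

  B-ρ : ∀ j → j < N → B (ρ j)
  B-ρ j j<N = subst T (sym (<⇒<ᵇ≡true j<N)) tt

  hide-w : ∀ j → j < N → extend (hide (isB N)) (vis (w j)) ≡ τ
  hide-w j j<N rewrite <⇒<ᵇ≡true j<N = refl

  hide-ρ : ∀ j → j < N → extend (hide (isB N)) (vis (ρ j)) ≡ τ
  hide-ρ j j<N rewrite <⇒<ᵇ≡true j<N = refl

  ≤N∸1⇒<N : ∀ {j} → j ≤ N ∸ 1 → j < N
  ≤N∸1⇒<N j≤ = ≤-trans (s≤s j≤) (≤-reflexive (suc-pred N))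

  <N⇒≤N∸1 : ∀ {j} → j < N → j ≤ N ∸ 1
  <N⇒≤N∸1 j<N = ≤-pred (≤-trans j<N (≤-reflexive (sym (suc-pred N))))

  memCell : ℕ → CellState → Proc BK
  memCell j E  = rel (con (cell true)) (Φmem N j)
  memCell j Eᵘ = rel (upre (vis inA) (con (cell false))) (Φmem N j)
  memCell j F  = rel (con (cell false)) (Φmem N j)
  memCell j Fᵘ = rel (upre (vis outA) (con (cell true))) (Φmem N j)

  memory : (ℕ → CellState) → ℕ → Proc BK
  memory f zero    = memCell 0 (f 0)
  memory f (suc i) = par (memory f i) (λ _ → ⊥) (memCell (suc i) (f (suc i)))

  memChain≡memory : ∀ i → memChain N i ≡ memory (λ _ → E) i
  memChain≡memory zero    = refl
  memChain≡memory (suc i) = cong (λ x → par x (λ _ → ⊥) (memCell (suc i) E)) (memChain≡memory i)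

  memory-cong : ∀ f g i → (∀ k → k ≤ i → f k ≡ g k) → memory f i ≡ memory g i
  memory-cong f g zero    f≗g = cong (memCell 0) (f≗g 0 z≤n)
  memory-cong f g (suc i) f≗g = cong₂ (λ x y → par x (λ _ → ⊥) (memCell (suc i) y))
    (memory-cong f g i (λ k k≤i → f≗g k (m≤n⇒m≤1+n k≤i))) (f≗g (suc i) ≤-refl)

  memory-update-below : ∀ f j c i → j ≤ i →
    par (memory (update f j c) i) (λ _ → ⊥) (memCell (suc i) (f (suc i))) ≡ memory (update f j c) (suc i)
  memory-update-below f j c i j≤i = cong (λ x → par (memory (update f j c) i) (λ _ → ⊥) (memCell (suc i) x))
    (sym (update-other f j c (suc i) λ { refl → 1+n≰n j≤i }))

  memory-update-top : ∀ f c i →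
    par (memory f i) (λ _ → ⊥) (memCell (suc i) c) ≡ memory (update f (suc i) c) (suc i)
  memory-update-top f c i = cong₂ (λ x y → par x (λ _ → ⊥) (memCell (suc i) y))
    (memory-cong f (update f (suc i) c) i (λ k k≤i → sym (update-other f (suc i) c k λ { refl → 1+n≰n k≤i })))
    (sym (update-same f (suc i) c))

  data MemCellStep (j : ℕ) (c : CellState) : ActT → Proc BK → Set₁ where
    cell-w : isFull c ≡ false → MemCellStep j c (vis (w j)) (memCell j F)
    cell-ρ : isFull c ≡ true  → MemCellStep j c (vis (ρ j)) (memCell j E)

  memCell-step-inv : ∀ j c {α R} → memCell j c ─⟨ α ⟩→ R → MemCellStep j c α R
  memCell-step-inv j E  (relA (conA preA)) = cell-w refl
  memCell-step-inv j Eᵘ (relA upreA)       = cell-w refl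
  memCell-step-inv j F  (relA (conA preA)) = cell-ρ refl
  memCell-step-inv j Fᵘ (relA upreA)       = cell-ρ refl

  data MemoryStep (f : ℕ → CellState) (i : ℕ) : ActT → Proc BK → Set₁ where
    memory-w : ∀ j → j ≤ i → isFull (f j) ≡ false → MemoryStep f i (vis (w j)) (memory (update f j F) i)
    memory-ρ : ∀ j → j ≤ i → isFull (f j) ≡ true  → MemoryStep f i (vis (ρ j)) (memory (update f j E) i)

  memory-step-inv : ∀ f i {α R} → memory f i ─⟨ α ⟩→ R → MemoryStep f i α R
  memory-step-inv f zero d with memCell-step-inv 0 (f 0) d
  ... | cell-w e = subst (MemoryStep f zero _) (cong (memCell 0) (update-same f 0 F)) (memory-w 0 z≤n e)
  ... | cell-ρ e = subst (MemoryStep f zero _) (cong (memCell 0) (update-same f 0 E)) (memory-ρ 0 z≤n e)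
  memory-step-inv f (suc i) (parL _ d) with memory-step-inv f i d
  ... | memory-w j j≤i e = subst (MemoryStep f (suc i) _) (sym (memory-update-below f j F i j≤i))
      (memory-w j (m≤n⇒m≤1+n j≤i) e)
  ... | memory-ρ j j≤i e = subst (MemoryStep f (suc i) _) (sym (memory-update-below f j E i j≤i))
      (memory-ρ j (m≤n⇒m≤1+n j≤i) e)
  memory-step-inv f (suc i) (parR _ d) with memCell-step-inv (suc i) (f (suc i)) d
  ... | cell-w e = subst (MemoryStep f (suc i) _) (sym (memory-update-top f F i)) (memory-w (suc i) ≤-refl e)
  ... | cell-ρ e = subst (MemoryStep f (suc i) _) (sym (memory-update-top f E i)) (memory-ρ (suc i) ≤-refl e)
  memory-step-inv f (suc i) (sync () _ _)

  memCell-w-step : ∀ j c → isFull c ≡ false → memCell j c ─⟨ vis (w j) ⟩→ memCell j F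
  memCell-w-step j E  _ = relA (conA preA)
  memCell-w-step j Eᵘ _ = relA upreA

  memCell-ρ-step : ∀ j c → isFull c ≡ true → memCell j c ─⟨ vis (ρ j) ⟩→ memCell j E
  memCell-ρ-step j F  _ = relA (conA preA)
  memCell-ρ-step j Fᵘ _ = relA upreA

  memory-w-step : ∀ f i j → j ≤ i → isFull (f j) ≡ false → memory f i ─⟨ vis (w j) ⟩→ memory (update f j F) i
  memory-w-step f zero zero z≤n e =
    subst (λ c → memCell 0 (f 0) ─⟨ vis (w 0) ⟩→ memCell 0 c) (sym (update-same f 0 F)) (memCell-w-step 0 (f 0) e)
  memory-w-step f (suc i) j j≤ e with m≤n⇒m<n∨m≡n j≤
  ... | inj₁ j<1+i = subst (memory f (suc i) ─⟨ vis (w j) ⟩→_) (memory-update-below f j F i (≤-pred j<1+i))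
                       (parL (λ ()) (memory-w-step f i j (≤-pred j<1+i) e))
  ... | inj₂ refl  = subst (memory f (suc i) ─⟨ vis (w (suc i)) ⟩→_) (memory-update-top f F i)
                       (parR (λ ()) (memCell-w-step (suc i) (f (suc i)) e))

  memory-ρ-step : ∀ f i j → j ≤ i → isFull (f j) ≡ true → memory f i ─⟨ vis (ρ j) ⟩→ memory (update f j E) i
  memory-ρ-step f zero zero z≤n e =
    subst (λ c → memCell 0 (f 0) ─⟨ vis (ρ 0) ⟩→ memCell 0 c) (sym (update-same f 0 E)) (memCell-ρ-step 0 (f 0) e)
  memory-ρ-step f (suc i) j j≤ e with m≤n⇒m<n∨m≡n j≤
  ... | inj₁ j<1+i = subst (memory f (suc i) ─⟨ vis (ρ j) ⟩→_) (memory-update-below f j E i (≤-pred j<1+i))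
                       (parL (λ ()) (memory-ρ-step f i j (≤-pred j<1+i) e))
  ... | inj₂ refl  = subst (memory f (suc i) ─⟨ vis (ρ (suc i)) ⟩→_) (memory-update-top f E i)
                       (parR (λ ()) (memCell-ρ-step (suc i) (f (suc i)) e))

  memCell-tick-inv : ∀ j c {X R} → memCell j c ─[ X ]→ R → R ≡ memCell j (tickCell c)
  memCell-tick-inv j E  (relR (conR preR)) = refl
  memCell-tick-inv j Eᵘ (relR (upreR _))   = refl
  memCell-tick-inv j F  (relR (conR preR)) = refl
  memCell-tick-inv j Fᵘ (relR (upreR _))   = refl

  memory-tick-inv : ∀ f i {X R} → memory f i ─[ X ]→ R → R ≡ memory (tickAll f) i
  memory-tick-inv f zero    d = memCell-tick-inv 0 (f 0) d
  memory-tick-inv f (suc i) (parR d₁ d₂ _) =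
    cong₂ (λ x y → par x (λ _ → ⊥) y) (memory-tick-inv f i d₁) (memCell-tick-inv (suc i) (f (suc i)) d₂)

  memCell-tick : ∀ j c → j < N → memCell j c ─[ (λ a → ¬ B a) ]→ memCell j (tickCell c)
  memCell-tick j E  _   = relR (conR preR)
  memCell-tick j Eᵘ j<N = relR (upreR λ ¬B → ¬B (B-w j j<N))
  memCell-tick j F  _   = relR (conR preR)
  memCell-tick j Fᵘ j<N = relR (upreR λ ¬B → ¬B (B-ρ j j<N))

  memory-tick : ∀ f i → i < N → memory f i ─[ (λ a → ¬ B a) ]→ memory (tickAll f) i
  memory-tick f zero    0<N   = memCell-tick 0 (f 0) 0<N
  memory-tick f (suc i) 1+i<N = parR (memory-tick f i (≤-trans (n≤1+n _) 1+i<N)) (memCell-tick (suc i) (f (suc i)) 1+i<N)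
    (λ a ¬B → inj₂ ((¬B , ¬B) , λ ()))

  memory-urgent-w : ∀ f i j → j ≤ i → f j ≡ Eᵘ → Urgent (memory f i) (vis (w j))
  memory-urgent-w f zero zero z≤n e rewrite e = urgent-rel urgent-upre
  memory-urgent-w f (suc i) j j≤ e with m≤n⇒m<n∨m≡n j≤
  ... | inj₁ j<1+i = urgent-parˡ (λ ()) (memory-urgent-w f i j (≤-pred j<1+i) e)
  ... | inj₂ refl rewrite e = urgent-parʳ (λ ()) (urgent-rel urgent-upre)

  memory-urgent-ρ : ∀ f i j → j ≤ i → f j ≡ Fᵘ → Urgent (memory f i) (vis (ρ j))
  memory-urgent-ρ f zero zero z≤n e rewrite e = urgent-rel urgent-upre
  memory-urgent-ρ f (suc i) j j≤ e with m≤n⇒m<n∨m≡n j≤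
  ... | inj₁ j<1+i = urgent-parˡ (λ ()) (memory-urgent-ρ f i j (≤-pred j<1+i) e)
  ... | inj₂ refl rewrite e = urgent-parʳ (λ ()) (urgent-rel urgent-upre)

module Controller (N : ℕ) .{{_ : NonZero N}} where

  open import Defs
  open BoolCmp
  open Timed
  open Modular N
  open import Data.Nat using (zero; suc; _∸_; _≤_; _<_; _<ᵇ_; _≤ᵇ_; >-nonZero⁻¹)
  open import Data.Nat.Properties
  open import Data.Bool using (Bool; true; false; _∧_)
  open import Data.Empty using (⊥-elim)
  open import Data.Sum using (inj₁; inj₂)
  open import Relation.Nullary using (¬_)
  open import Relation.Binary.PropositionalEquality using (_≡_; refl; cong; sym; subst)

  open Semantics (buffBody N)
  open TimeSteps (buffBody N)

  0<N : 0 < N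
  0<N = >-nonZero⁻¹ N

  buffBody-bc : ∀ x y i m → i < N → m ≤ N → buffBody N (bc x y i m) ≡ bcRule N x y i m
  buffBody-bc x y i m i<N m≤N rewrite <⇒<ᵇ≡true i<N | ≤⇒≤ᵇ≡true m≤N = refl

  suc≤N≮N⇒N∸1≡ : ∀ k → suc k ≤ N → ¬ (suc k < N) → N ∸ 1 ≡ k
  suc≤N≮N⇒N∸1≡ k k<N k≮ = cong (_∸ 1) (sym (≤∧≮⇒≡ k<N k≮))

  ≤N≮N⇒≡N : ∀ {m} → m ≤ N → ¬ (m < N) → m ≡ N
  ≤N≮N⇒≡N m≤N m≮N with m≤n⇒m<n∨m≡n m≤N
  ... | inj₁ m<N = ⊥-elim (m≮N m<N)
  ... | inj₂ m≡N = m≡N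

  -- BC(x, y, i, m): x = "an item has been read in", y = "an item is ready to go
  -- out", i the slot of the oldest stored item, m the number of stored items.
  data ControllerStep (x y : Bool) (i m : ℕ) : ActT → Proc BK → Set₁ where
    ctl-in  : x ≡ false → ControllerStep x y i m (vis inA)  (con (bc true y i m))
    ctl-out : y ≡ true  → ControllerStep x y i m (vis outA) (con (bc x false i m))
    ctl-w   : x ≡ true → m < N → ControllerStep x y i m (vis (w (i ⊞′ m))) (con (bc false y i (suc m)))
    ctl-ρ   : y ≡ false → ∀ k → m ≡ suc k → ControllerStep x y i m (vis (ρ i)) (con (bc x true (i ⊞′ 1) k))

  bcRule-step-inv : ∀ x y i m {α R} → i < N → m ≤ N → bcRule N x y i m ─⟨ α ⟩→ R → ControllerStep x y i m α R
  bcRule-step-inv false false i zero    _ _ preA        = ctl-in refl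
  bcRule-step-inv false false i (suc k) _ _ (sumL preA) = ctl-in refl
  bcRule-step-inv false false i (suc k) _ _ (sumR preA) = ctl-ρ refl k refl
  bcRule-step-inv true  false i zero    i<N _ preA =
    subst (λ j → ControllerStep true false i zero (vis (w j)) (con (bc false false i 1))) (⊞-identityʳ i i<N) (ctl-w refl 0<N)
  bcRule-step-inv true false i (suc k) _ _ d with suc k <ᵇ N in lt
  bcRule-step-inv true false i (suc k) _ _ (sumL preA) | true = ctl-w refl (<ᵇ≡true⇒< _ _ lt)
  bcRule-step-inv true false i (suc k) _ _ (sumR preA) | true = ctl-ρ refl k refl
  bcRule-step-inv true false i (suc k) _ k<N preA | false =
    subst (λ j → ControllerStep true false i (suc k) (vis (ρ i)) (con (bc true true (i ⊞′ 1) j)))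
          (sym (suc≤N≮N⇒N∸1≡ k k<N (<ᵇ≡false⇒≮ _ _ lt))) (ctl-ρ refl k refl)
  bcRule-step-inv false true i m _ _ (sumL preA) = ctl-in refl
  bcRule-step-inv false true i m _ _ (sumR preA) = ctl-out refl
  bcRule-step-inv true true i m _ _ d with m <ᵇ N in lt
  bcRule-step-inv true true i m _ _ (sumL preA) | true = ctl-w refl (<ᵇ≡true⇒< _ _ lt)
  bcRule-step-inv true true i m _ _ (sumR preA) | true = ctl-out refl
  bcRule-step-inv true true i m _ m≤N preA | false =
    subst (λ j → ControllerStep true true i m (vis outA) (con (bc true false i j))) (≤N≮N⇒≡N m≤N (<ᵇ≡false⇒≮ _ _ lt))
        (ctl-out refl)

  controller-step-inv : ∀ x y i m {α R} → i < N → m ≤ N → con (bc x y i m) ─⟨ α ⟩→ R → ControllerStep x y i m α R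
  controller-step-inv x y i m i<N m≤N (conA d) =
    bcRule-step-inv x y i m i<N m≤N (subst (_─⟨ _ ⟩→ _) (buffBody-bc x y i m i<N m≤N) d)

  bcRule-prefixSum : ∀ x y i m → PrefixSum (bcRule N x y i m)
  bcRule-prefixSum false false i zero    = pre-ps
  bcRule-prefixSum false false i (suc k) = sum-ps pre-ps pre-ps
  bcRule-prefixSum true  false i zero    = pre-ps
  bcRule-prefixSum true  false i (suc k) with suc k <ᵇ N
  ... | true  = sum-ps pre-ps pre-ps
  ... | false = pre-ps
  bcRule-prefixSum false true i m = sum-ps pre-ps pre-ps
  bcRule-prefixSum true  true i m with m <ᵇ N
  ... | true  = sum-ps pre-ps pre-ps
  ... | false = pre-ps

  buffBody-prefixSum : ∀ k → PrefixSum (buffBody N k)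
  buffBody-prefixSum (cell true)  = pre-ps
  buffBody-prefixSum (cell false) = pre-ps
  buffBody-prefixSum (bc x y i m) with (i <ᵇ N) ∧ (m ≤ᵇ N)
  ... | true  = bcRule-prefixSum x y i m
  ... | false = nil-ps

  con-prefixSum : ∀ k → PrefixSum (con k)
  con-prefixSum k = con-ps (buffBody-prefixSum k)

  bcRule⇒con-step : ∀ x y i m {α R} → i < N → m ≤ N → bcRule N x y i m ─⟨ α ⟩→ R → con (bc x y i m) ─⟨ α ⟩→ R
  bcRule⇒con-step x y i m i<N m≤N d = conA (subst (_─⟨ _ ⟩→ _) (sym (buffBody-bc x y i m i<N m≤N)) d)

  controller-in : ∀ y i m → i < N → m ≤ N → con (bc false y i m) ─⟨ vis inA ⟩→ con (bc true y i m)
  controller-in false i zero    i<N m≤N = bcRule⇒con-step false false i zero i<N m≤N preA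
  controller-in false i (suc k) i<N m≤N = bcRule⇒con-step false false i (suc k) i<N m≤N (sumL preA)
  controller-in true  i m       i<N m≤N = bcRule⇒con-step false true i m i<N m≤N (sumL preA)

  controller-out : ∀ x i m → i < N → m ≤ N → con (bc x true i m) ─⟨ vis outA ⟩→ con (bc x false i m)
  controller-out false i m i<N m≤N = bcRule⇒con-step false true i m i<N m≤N (sumR preA)
  controller-out true  i m i<N m≤N = bcRule⇒con-step true true i m i<N m≤N out
    where
    out : bcRule N true true i m ─⟨ vis outA ⟩→ con (bc true false i m)
    out with m <ᵇ N in lt
    ... | true  = sumR preA
    ... | false = subst (λ j → pre (vis outA) (con (bc true false i N)) ─⟨ vis outA ⟩→ con (bc true false i j))
                        (sym (≤N≮N⇒≡N m≤N (<ᵇ≡false⇒≮ _ _ lt))) preA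

  controller-w : ∀ y i m → i < N → m < N → con (bc true y i m) ─⟨ vis (w (i ⊞′ m)) ⟩→ con (bc false y i (suc m))
  controller-w y i m i<N m<N = bcRule⇒con-step true y i m i<N (<⇒≤ m<N) (write y m m<N)
    where
    write : ∀ y m → m < N → bcRule N true y i m ─⟨ vis (w (i ⊞′ m)) ⟩→ con (bc false y i (suc m))
    write false zero _ = subst (λ j → pre (vis (w i)) (con (bc false false i 1)) ─⟨ vis (w j) ⟩→ con (bc false false i 1))
                               (sym (⊞-identityʳ i i<N)) preA
    write false (suc k) m<N rewrite <⇒<ᵇ≡true m<N = sumL preA
    write true  m       m<N rewrite <⇒<ᵇ≡true m<N = sumL preA

  controller-ρ : ∀ x i k → i < N → suc k ≤ N → con (bc x false i (suc k)) ─⟨ vis (ρ i) ⟩→ con (bc x true (i ⊞′ 1) k)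
  controller-ρ x i k i<N k<N = bcRule⇒con-step x false i (suc k) i<N k<N (read x)
    where
    read : ∀ x → bcRule N x false i (suc k) ─⟨ vis (ρ i) ⟩→ con (bc x true (i ⊞′ 1) k)
    read false = sumR preA
    read true with suc k <ᵇ N in lt
    ... | true  = sumR preA
    ... | false = subst (λ j → pre (vis (ρ i)) (con (bc true true (i ⊞′ 1) (N ∸ 1))) ─⟨ vis (ρ i) ⟩→ con
        (bc true true (i ⊞′ 1) j))
                        (suc≤N≮N⇒N∸1≡ k k<N (<ᵇ≡false⇒≮ _ _ lt)) preA

module BuffProcess (N : ℕ) .{{_ : NonZero N}} where

  open import Defs
  open FunUpdate
  open Cells
  open Timed
  open Modular N
  open Memory N
  open Controller N
  open import Data.Nat using (suc; _∸_; _≤_; _<_)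
  open import Data.Nat.Properties using (≤-refl)
  open import Data.Product using (Σ; _×_; _,_)
  open import Data.Sum using (_⊎_; inj₁; inj₂)
  open import Data.Empty using (⊥-elim)
  open import Data.Unit using (⊤; tt)
  open import Data.Bool using (Bool; true; false)
  open import Relation.Nullary using (¬_)
  open import Relation.Binary.PropositionalEquality using (_≡_; cong; subst)

  open Semantics (buffBody N)
  open TimeSteps (buffBody N)

  N∸1<N : N ∸ 1 < N
  N∸1<N = ≤N∸1⇒<N ≤-refl

  buffAt : (ℕ → CellState) → Proc BK → Proc BK
  buffAt f Q = rel (par (memory f (N ∸ 1)) B Q) (hide (isB N))

  start≡buffAt : start (Buff N) ≡ buffAt (λ _ → E) (con (bc false false 0 0))
  start≡buffAt = cong (λ M → rel (par M B (con (bc false false 0 0))) (hide (isB N))) (memChain≡memory (N ∸ 1))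

  data BuffStep (f : ℕ → CellState) (x y : Bool) (i m : ℕ) : ActT → Proc BK → Set₁ where
    buff-in  : x ≡ false → BuffStep f x y i m (vis inA) (buffAt f (con (bc true y i m)))
    buff-out : y ≡ true → BuffStep f x y i m (vis outA) (buffAt f (con (bc x false i m)))
    buff-w   : x ≡ true → m < N → isFull (f (i ⊞′ m)) ≡ false →
               BuffStep f x y i m τ (buffAt (update f (i ⊞′ m) F) (con (bc false y i (suc m))))
    buff-ρ   : y ≡ false → ∀ k → m ≡ suc k → isFull (f i) ≡ true →
               BuffStep f x y i m τ (buffAt (update f i E) (con (bc x true (i ⊞′ 1) k)))

  -- Q stands for the controller constant or any state it reached by time steps.
  buff-step-inv : ∀ f x y i m Q {α R} → i < N → m ≤ N →
                  (∀ {β R′} → Q ─⟨ β ⟩→ R′ → con (bc x y i m) ─⟨ β ⟩→ R′) →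
                  buffAt f Q ─⟨ α ⟩→ R → BuffStep f x y i m α R
  buff-step-inv f x y i m Q i<N m≤N back (relA (parL ∉B e)) with memory-step-inv f (N ∸ 1) e
  ... | memory-w j j≤ _ = ⊥-elim (∉B (B-w j (≤N∸1⇒<N j≤)))
  ... | memory-ρ j j≤ _ = ⊥-elim (∉B (B-ρ j (≤N∸1⇒<N j≤)))
  buff-step-inv f x y i m Q i<N m≤N back (relA (parR ∉B e)) with controller-step-inv x y i m i<N m≤N (back e)
  ... | ctl-in  x≡ = buff-in x≡
  ... | ctl-out y≡ = buff-out y≡
  ... | ctl-w _ _   = ⊥-elim (∉B (B-w (i ⊞′ m) (⊞<N i m)))
  ... | ctl-ρ _ _ _ = ⊥-elim (∉B (B-ρ i i<N))
  buff-step-inv f x y i m Q i<N m≤N back (relA (sync _ e₁ e₂))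
    with memory-step-inv f (N ∸ 1) e₁ | controller-step-inv x y i m i<N m≤N (back e₂)
  ... | memory-w _ _ free | ctl-w x≡ m<N rewrite hide-w (i ⊞′ m) (⊞<N i m) = buff-w x≡ m<N free
  ... | memory-ρ _ _ full | ctl-ρ y≡ k m≡ rewrite hide-ρ i i<N = buff-ρ y≡ k m≡ full

  buff-tick-inv : ∀ f Q {X R} → buffAt f Q ─[ X ]→ R →
                  Σ (Proc BK) λ Q′ → Σ ASet λ X₂ → Q ─[ X₂ ]→ Q′ × R ≡ buffAt (tickAll f) Q′
  buff-tick-inv f Q (relR (parR {X₂ = X₂} dₘ d _)) =
    _ , X₂ , d , cong (λ M → rel (par M B _) (hide (isB N))) (memory-tick-inv f (N ∸ 1) dₘ)

  buff-in-step : ∀ f {Q Q′} → Q ─⟨ vis inA ⟩→ Q′ → buffAt f Q ─⟨ vis inA ⟩→ buffAt f Q′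
  buff-in-step f d = relA (parR (λ ()) d)

  buff-out-step : ∀ f {Q Q′} → Q ─⟨ vis outA ⟩→ Q′ → buffAt f Q ─⟨ vis outA ⟩→ buffAt f Q′
  buff-out-step f d = relA (parR (λ ()) d)

  buff-w-step : ∀ f j {Q Q′} → j < N → isFull (f j) ≡ false → Q ─⟨ vis (w j) ⟩→ Q′ →
                buffAt f Q ─⟨ τ ⟩→ buffAt (update f j F) Q′
  buff-w-step f j {Q} {Q′} j<N free d = subst (λ α → buffAt f Q ─⟨ α ⟩→ buffAt (update f j F) Q′) (hide-w j j<N)
    (relA (sync (B-w j j<N) (memory-w-step f (N ∸ 1) j (<N⇒≤N∸1 j<N) free) d))

  buff-ρ-step : ∀ f j {Q Q′} → j < N → isFull (f j) ≡ true → Q ─⟨ vis (ρ j) ⟩→ Q′ →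
                buffAt f Q ─⟨ τ ⟩→ buffAt (update f j E) Q′
  buff-ρ-step f j {Q} {Q′} j<N full d = subst (λ α → buffAt f Q ─⟨ α ⟩→ buffAt (update f j E) Q′) (hide-ρ j j<N)
    (relA (sync (B-ρ j j<N) (memory-ρ-step f (N ∸ 1) j (<N⇒≤N∸1 j<N) full) d))

  buff-tick : ∀ f k → Σ (Proc BK) λ Q′ → con k ─[ (λ _ → ⊤) ]→ Q′ × buffAt f (con k) ─[ (λ _ → ⊤) ]→ buffAt (tickAll f) Q′
  buff-tick f k with prefixSum-tick (con-prefixSum k) (λ _ → ⊤)
  ... | Q′ , d = Q′ , d , relR (tick-antitone (parR (memory-tick f (N ∸ 1) N∸1<N) d split) (λ _ _ → tt))
    where
    split : ∀ a → ⊤ → (B a × ((¬ B a) ⊎ ⊤)) ⊎ (((¬ B a) × ⊤) × ¬ B a)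
    split a _ with isB N a
    ... | true  = inj₁ (tt , inj₂ tt)
    ... | false = inj₂ (((λ ()) , tt) , λ ())

  buff-urgent-in : ∀ f Q → Urgent Q (vis inA) → Urgent (buffAt f Q) (vis inA)
  buff-urgent-in f Q u = urgent-rel (urgent-parʳ (λ ()) u)

  buff-urgent-out : ∀ f Q → Urgent Q (vis outA) → Urgent (buffAt f Q) (vis outA)
  buff-urgent-out f Q u = urgent-rel (urgent-parʳ (λ ()) u)

  buff-urgent-w : ∀ f Q j → j < N → f j ≡ Eᵘ → Urgent Q (vis (w j)) → Urgent (buffAt f Q) τ
  buff-urgent-w f Q j j<N fj u = subst (Urgent (buffAt f Q)) (hide-w j j<N)
    (urgent-rel (urgent-sync (B-w j j<N) (memory-urgent-w f (N ∸ 1) j (<N⇒≤N∸1 j<N) fj) u))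

  buff-urgent-ρ : ∀ f Q j → j < N → f j ≡ Fᵘ → Urgent Q (vis (ρ j)) → Urgent (buffAt f Q) τ
  buff-urgent-ρ f Q j j<N fj u = subst (Urgent (buffAt f Q)) (hide-ρ j j<N)
    (urgent-rel (urgent-sync (B-ρ j j<N) (memory-urgent-ρ f (N ∸ 1) j (<N⇒≤N∸1 j<N) fj) u))

module BuffBound (N : ℕ) .{{_ : NonZero N}} where

  open import Defs
  open BoolCmp
  open FunUpdate
  open Cells
  open Timed
  open Budget
  open Modular N
  open Memory N
  open Controller N
  open BuffProcess N
  open import Data.Nat using (zero; suc; _+_; _*_; _≤_; _<_; z≤n; s≤s; _<ᵇ_; _≟_)
  open import Data.Nat.Properties
  open import Data.Nat.Tactic.RingSolver using (solve-∀)
  open import Data.Product using (Σ; _×_; _,_)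
  open import Data.Empty using (⊥; ⊥-elim)
  open import Data.Unit using (tt)
  open import Data.Bool using (Bool; true; false)
  open import Data.List.Membership.Propositional using (_∈_)
  open import Relation.Nullary using (¬_; yes; no)
  open import Relation.Binary.PropositionalEquality using (_≡_; refl; cong; sym; trans; subst)

  open Semantics (buffBody N)
  open TimeSteps (buffBody N)

  data ControllerAt (k : BK) (Q : Proc BK) : Bool → Set₁ where
    fresh  : Q ≡ con k → ControllerAt k Q false
    ticked : ∀ {X} → con k ─[ X ]→ Q → ControllerAt k Q true

  step-of-con : ∀ {k Q t α R} → ControllerAt k Q t → Q ─⟨ α ⟩→ R → con k ─⟨ α ⟩→ R
  step-of-con (fresh refl) d = d
  step-of-con {k} (ticked t) d = step-before-tick (con-prefixSum k) t d

  -- Every action lowers the potential 4 c₀ + 3 x + 2 m + y by one (a waiting user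
  -- still needs in, w, ρ and out), and between two time steps there is an action;
  -- ticked records whether the current state has already consumed its time step.
  record BuffInv (P : Proc BK) (c₀ c₁ b : ℕ) : Set₁ where
    field
      cells      : ℕ → CellState
      ctl        : Proc BK
      x y        : Bool
      i m        : ℕ
      t          : Bool
      is-buffAt  : P ≡ buffAt cells ctl
      controller : ControllerAt (bc x y i m) ctl t
      i<N        : i < N
      m≤N        : m ≤ N
      c₁≡        : c₁ ≡ bit x + m + bit y
      occupied   : ∀ j → j < N → isFull (cells j) ≡ (j ⊟ i <ᵇ m)
      all-ticked : t ≡ true → ∀ j → j < N → isTicked (cells j) ≡ true
      potential  : 4 * c₀ + 3 * bit x + 2 * m + bit y ≤ b + bit t

  potential-drop : ∀ A b t → suc A ≤ b + bit t → A ≤ b + bit false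
  potential-drop A b false p = ≤-trans (n≤1+n A) p
  potential-drop A b true  p = ≤-trans (≤-pred (≤-trans p (≤-reflexive (+-comm b 1)))) (m≤m+n b 0)

  after-action : ∀ {c₀ c₁ b} f x y i m → i < N → m ≤ N → c₁ ≡ bit x + m + bit y →
                 (∀ j → j < N → isFull (f j) ≡ (j ⊟ i <ᵇ m)) →
                 4 * c₀ + 3 * bit x + 2 * m + bit y ≤ b + bit false →
                 BuffInv (buffAt f (con (bc x y i m))) c₀ c₁ b
  after-action f x y i m i<N m≤N c₁≡ occ pot = record
    { cells = f ; ctl = con (bc x y i m) ; x = x ; y = y ; i = i ; m = m ; t = false ; is-buffAt = refl
    ; controller = fresh refl ; i<N = i<N ; m≤N = m≤N ; c₁≡ = c₁≡ ; occupied = occ ; all-ticked = λ ()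
    ; potential = pot }

  occupied-after-w : ∀ f i m → i < N → m < N → (∀ j → j < N → isFull (f j) ≡ (j ⊟ i <ᵇ m)) →
                     ∀ j → j < N → isFull (update f (i ⊞′ m) F j) ≡ (j ⊟ i <ᵇ suc m)
  occupied-after-w f i m i<N m<N occ j j<N with j ≟ i ⊞′ m
  ... | yes refl = trans (cong isFull (update-same f (i ⊞′ m) F))
                     (sym (trans (cong (_<ᵇ suc m) (⊞-⊟-cancel i m i<N m<N)) (<⇒<ᵇ≡true (n<1+n m))))
  ... | no j≢ = trans (cong isFull (update-other f (i ⊞′ m) F j j≢))
                  (trans (occ j j<N) (<ᵇ-suc (j ⊟ i) m λ eq → j≢ (trans (sym (⊟-⊞-cancel i j i<N j<N)) (cong (i ⊞′_) eq))))

  occupied-after-ρ : ∀ f i k → i < N → suc k ≤ N → (∀ j → j < N → isFull (f j) ≡ (j ⊟ i <ᵇ suc k)) →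
                     ∀ j → j < N → isFull (update f i E j) ≡ (j ⊟ (i ⊞′ 1) <ᵇ k)
  occupied-after-ρ f i k i<N k<N occ j j<N with j ≟ i
  ... | yes refl = trans (cong isFull (update-same f j E)) (sym (≮⇒<ᵇ≡false too-far))
    where
    too-far : ¬ (j ⊟ (j ⊞′ 1) < k)
    too-far lt = 1+n≰n (≤-trans k<N (≤-trans (≤-reflexive (sym (⊟-pred j i<N))) lt))
  ... | no j≢i with j ⊟ i in off
  ...   | zero  = ⊥-elim (j≢i (trans (sym (⊟-⊞-cancel i j i<N j<N)) (trans (cong (i ⊞′_) off) (⊞-identityʳ i i<N))))
  ...   | suc s = trans (cong isFull (update-other f i E j j≢i))
                    (trans (occ j j<N) (trans (cong (_<ᵇ suc k) off) (cong (_<ᵇ k) (sym (⊟-suc i j s i<N j<N off)))))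

  inv-τ : ∀ {P P′ c₀ c₁ b} → BuffInv P c₀ c₁ b → P ─⟨ τ ⟩→ P′ → BuffInv P′ c₀ c₁ b
  inv-τ {c₀ = c₀} {b = b} I@record { is-buffAt = refl } d
    with buff-step-inv _ _ _ _ _ _ (BuffInv.i<N I) (BuffInv.m≤N I) (step-of-con (BuffInv.controller I)) d
  ... | buff-w refl m<N _ =
    after-action _ false y i (suc m) i<N m<N (trans c₁≡ (shift-w m (bit y))) (occupied-after-w cells i m i<N m<N occupied)
      (potential-drop _ b t (subst (_≤ b + bit t) (drop-w c₀ m (bit y)) potential))
    where
    open BuffInv I
    shift-w : ∀ m y → 1 + m + y ≡ 0 + suc m + y
    shift-w = solve-∀
    drop-w : ∀ c m y → 4 * c + 3 * 1 + 2 * m + y ≡ suc (4 * c + 3 * 0 + 2 * suc m + y)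
    drop-w = solve-∀
  ... | buff-ρ refl k refl _ =
    after-action _ x true (i ⊞′ 1) k (⊞<N i 1) (≤-trans (n≤1+n k) m≤N) (trans c₁≡ (shift-ρ (bit x) k))
      (occupied-after-ρ cells i k i<N m≤N occupied)
      (potential-drop _ b t (subst (_≤ b + bit t) (drop-ρ c₀ (bit x) k) potential))
    where
    open BuffInv I
    shift-ρ : ∀ x k → x + suc k + 0 ≡ x + k + 1
    shift-ρ = solve-∀
    drop-ρ : ∀ c x k → 4 * c + 3 * x + 2 * suc k + 0 ≡ suc (4 * c + 3 * x + 2 * k + 1)
    drop-ρ = solve-∀

  inv-in : ∀ {P P′ c₀ c₁ b} → BuffInv P (suc c₀) c₁ b → P ─⟨ vis inA ⟩→ P′ → BuffInv P′ c₀ (suc c₁) b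
  inv-in {c₀ = c₀} {b = b} I@record { is-buffAt = refl } d
    with buff-step-inv _ _ _ _ _ _ (BuffInv.i<N I) (BuffInv.m≤N I) (step-of-con (BuffInv.controller I)) d
  ... | buff-in refl =
    after-action _ true y i m i<N m≤N (cong suc c₁≡) occupied
      (potential-drop _ b t (subst (_≤ b + bit t) (drop-in c₀ m (bit y)) potential))
    where
    open BuffInv I
    drop-in : ∀ c m y → 4 * suc c + 3 * 0 + 2 * m + y ≡ suc (4 * c + 3 * 1 + 2 * m + y)
    drop-in = solve-∀

  inv-out : ∀ {P P′ c₀ c₁ b} → BuffInv P c₀ (suc c₁) b → P ─⟨ vis outA ⟩→ P′ → BuffInv P′ c₀ c₁ b
  inv-out {c₀ = c₀} {b = b} I@record { is-buffAt = refl } d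
    with buff-step-inv _ _ _ _ _ _ (BuffInv.i<N I) (BuffInv.m≤N I) (step-of-con (BuffInv.controller I)) d
  ... | buff-out refl =
    after-action _ x false i m i<N m≤N (suc-injective (trans c₁≡ (+-suc (bit x + m) 0))) occupied
      (potential-drop _ b t (subst (_≤ b + bit t) (drop-out c₀ (bit x) m) potential))
    where
    open BuffInv I
    drop-out : ∀ c x m → 4 * c + 3 * x + 2 * m + 1 ≡ suc (4 * c + 3 * x + 2 * m + 0)
    drop-out = solve-∀

  full-ticked⇒Fᵘ : ∀ c → isFull c ≡ true → isTicked c ≡ true → c ≡ Fᵘ
  full-ticked⇒Fᵘ Fᵘ _ _  = refl
  full-ticked⇒Fᵘ E  () _
  full-ticked⇒Fᵘ Eᵘ () _
  full-ticked⇒Fᵘ F  _ ()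

  empty-ticked⇒Eᵘ : ∀ c → isFull c ≡ false → isTicked c ≡ true → c ≡ Eᵘ
  empty-ticked⇒Eᵘ Eᵘ _ _  = refl
  empty-ticked⇒Eᵘ E  _ ()
  empty-ticked⇒Eᵘ F  () _
  empty-ticked⇒Eᵘ Fᵘ () _

  -- After a time step some action of Buff is urgent while a user is pending, so a
  -- second time step in a row is impossible.
  ticked-blocks-tick : ∀ {X R X′ c₀ c₁} f Q x y i m → i < N → m ≤ N → con (bc x y i m) ─[ X′ ]→ Q →
                       c₁ ≡ bit x + m + bit y → (∀ j → j < N → isFull (f j) ≡ (j ⊟ i <ᵇ m)) →
                       (∀ j → j < N → isTicked (f j) ≡ true) →
                       buffAt f Q ─[ X ]→ R → (1 ≤ c₀ → X inA) → (1 ≤ c₁ → X outA) → 1 ≤ c₀ + c₁ → ⊥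
  ticked-blocks-tick f Q x true i m i<N m≤N t c₁≡ _ _ d _ refuse-out _ =
    buff-urgent-out f Q (ticked⇒urgent t (step-after-tick (con-prefixSum _) t (controller-out x i m i<N m≤N))) d
      (refuse-out (subst (1 ≤_) (sym c₁≡) (≤-trans (s≤s z≤n) (≤-reflexive (+-comm 1 (bit x + m))))))
  ticked-blocks-tick {c₀ = c₀} f Q false false i zero i<N m≤N t c₁≡ _ _ d refuse-in _ pending =
    buff-urgent-in f Q (ticked⇒urgent t (step-after-tick (con-prefixSum _) t (controller-in false i 0 i<N m≤N))) d
      (refuse-in (subst (1 ≤_) (trans (cong (c₀ +_) c₁≡) (+-identityʳ c₀)) pending))
  ticked-blocks-tick f Q false false i (suc k) i<N m≤N t _ occ tck d _ _ _ =
    buff-urgent-ρ f Q i i<N fᵢ (ticked⇒urgent t (step-after-tick (con-prefixSum _) t (controller-ρ false i k i<N m≤N))) d tt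
    where
    fᵢ : f i ≡ Fᵘ
    fᵢ = full-ticked⇒Fᵘ (f i) (trans (occ i i<N) (cong (_<ᵇ suc k) (⊟-self i i<N))) (tck i i<N)
  ticked-blocks-tick f Q true false i m i<N m≤N t _ occ tck d _ _ _ with m <ᵇ N in lt
  ... | true = buff-urgent-w f Q (i ⊞′ m) (⊞<N i m) fⱼ
                 (ticked⇒urgent t (step-after-tick (con-prefixSum _) t (controller-w false i m i<N m<N))) d tt
    where
    m<N = <ᵇ≡true⇒< _ _ lt
    fⱼ : f (i ⊞′ m) ≡ Eᵘ
    fⱼ = empty-ticked⇒Eᵘ (f (i ⊞′ m))
           (trans (occ (i ⊞′ m) (⊞<N i m)) (trans (cong (_<ᵇ m) (⊞-⊟-cancel i m i<N m<N)) (≮⇒<ᵇ≡false (n≮n m))))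
           (tck (i ⊞′ m) (⊞<N i m))
  ... | false with m
  ...   | zero  = <ᵇ≡false⇒≮ _ _ lt 0<N
  ...   | suc k = buff-urgent-ρ f Q i i<N fᵢ
                    (ticked⇒urgent t (step-after-tick (con-prefixSum _) t (controller-ρ true i k i<N m≤N))) d tt
    where
    fᵢ : f i ≡ Fᵘ
    fᵢ = full-ticked⇒Fᵘ (f i) (trans (occ i i<N) (cong (_<ᵇ suc k) (⊟-self i i<N))) (tck i i<N)

  pending⇒potential-pos : ∀ c₀ x m y → 1 ≤ c₀ + (bit x + m + bit y) → 1 ≤ 4 * c₀ + 3 * bit x + 2 * m + bit y
  pending⇒potential-pos (suc c₀) x     m       y     _  = s≤s z≤n
  pending⇒potential-pos zero     true  m       y     _  = s≤s z≤n
  pending⇒potential-pos zero     false (suc m) y     _  = s≤s z≤n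
  pending⇒potential-pos zero     false zero    true  _  = s≤s z≤n
  pending⇒potential-pos zero     false zero    false ()

  inv-tick : ∀ {P P′ X c₀ c₁ b} → BuffInv P c₀ c₁ b → P ─[ X ]→ P′ → (1 ≤ c₀ → X inA) →
             (1 ≤ c₁ → X outA) → 1 ≤ c₀ + c₁ → Σ ℕ λ b′ → b ≡ suc b′ × BuffInv P′ c₀ c₁ b′
  inv-tick {c₀ = c₀} {b = zero} I@record { is-buffAt = refl ; t = false ; controller = fresh refl } _ _ _ pending =
    ⊥-elim (1+n≰n (≤-trans (pending⇒potential-pos c₀ x m y (subst (λ c → 1 ≤ c₀ + c) c₁≡ pending)) potential))
    where open BuffInv I
  inv-tick {b = suc b} I@record { is-buffAt = refl ; t = false ; controller = fresh refl } d _ _ _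
    with buff-tick-inv _ _ d
  ... | Q′ , _ , d′ , refl = b , refl , record
    { cells = tickAll cells ; ctl = Q′ ; x = x ; y = y ; i = i ; m = m ; t = true ; is-buffAt = refl
    ; controller = ticked d′ ; i<N = i<N ; m≤N = m≤N ; c₁≡ = c₁≡
    ; occupied = λ j j<N → trans (isFull-tickCell (cells j)) (occupied j j<N)
    ; all-ticked = λ _ j _ → isTicked-tickCell (cells j)
    ; potential = ≤-trans potential (≤-reflexive (trans (+-identityʳ (suc b)) (+-comm 1 b))) }
    where open BuffInv I
  inv-tick I@record { is-buffAt = refl ; t = true ; controller = ticked step } d refuse-in refuse-out pending =
    ⊥-elim (ticked-blocks-tick cells ctl x y i m i<N m≤N step c₁≡ occupied (all-ticked refl) d refuse-in refuse-out pending)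
    where open BuffInv I

  open Budget.ClosedSystem.BudgetArgument (buffBody N) BuffInv inv-τ inv-in inv-out inv-tick

  buff-ticks≤ : ∀ n {ws R} → Steps (start (Buff N) ∥ U (suc n)) ws R → ¬ (act ω ∈ eraseτ ws) → ζ (eraseτ ws) ≤ 4 * suc n
  buff-ticks≤ n steps ¬ω = ticks≤budget-initially n steps ¬ω (subst (λ P → BuffInv P (suc n) 0 (4 * suc n)) (sym start≡buffAt)
    (after-action (λ _ → E) false false 0 0 0<N z≤n refl (λ _ _ → refl) (≤-reflexive (initial (suc n)))))
    where
    initial : ∀ n → 4 * n + 3 * 0 + 2 * 0 + 0 ≡ 4 * n + 0
    initial = solve-∀

module BuffRun (N : ℕ) .{{_ : NonZero N}} where

  open import Defs
  open FunUpdate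
  open Cells
  open Timed
  open Users
  open Budget
  open Modular N
  open Controller N
  open BuffProcess N
  open import Data.Nat using (zero; suc; _+_; _*_; _≤_; _<_; z≤n; _≟_)
  open import Data.Nat.Properties
  open import Data.Nat.Tactic.RingSolver using (solve-∀)
  open import Data.Product using (Σ; _×_; _,_)
  open import Data.Sum using (inj₁)
  open import Data.Unit using (⊤; tt)
  open import Data.Bool using (true; false)
  open import Relation.Nullary using (yes; no)
  open import Relation.Binary.PropositionalEquality using (_≡_; _≢_; refl; cong; cong₂; sym; trans; subst)

  open Semantics (buffBody N)
  open TimeSteps (buffBody N)
  open UserProcesses (buffBody N)
  open ClosedSystem (buffBody N)

  AllEmpty : (ℕ → CellState) → Set
  AllEmpty f = ∀ k → isFull (f k) ≡ false

  Unfinished : ℕ → (ℕ → Phase) → Set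
  Unfinished n g = Σ ℕ λ i → i ≤ n × g i ≢ wantsω

  buff-run-tick : ∀ {n g} f k → Unfinished n g →
                  Σ (Proc BK) λ Q′ → con k ─[ (λ _ → ⊤) ]→ Q′
                    × Run (withUsers (buffAt f (con k)) n g) (withUsers (buffAt (tickAll f) Q′) n g) 1
  buff-run-tick f k unfinished with buff-tick f k
  ... | Q′ , d , D = Q′ , d , run-tick D (λ _ _ → inj₁ tt) tt unfinished

  -- Each user costs four time steps, each followed by one urgent action: in, the
  -- write wᵢ, the read ρᵢ and out.
  serve-in : ∀ n g u → u ≤ n → g u ≡ wantsIn → ∀ f i → i < N → AllEmpty f →
             Run (withUsers (buffAt f (con (bc false false i 0))) n g)
                 (withUsers (buffAt (update (tickAll (tickAll f)) i F) (con (bc false false i 1))) n (update g u wantsOut)) 2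
  serve-in n g u u≤n gu f i i<N empty 
    with buff-run-tick f (bc false false i 0) (u , u≤n , λ e → wantsIn≢wantsω (trans (sym gu) e))
  ... | Q₁ , d₁ , tick₁
    with buff-run-tick (tickAll f) (bc true false i 0)
        (u , u≤n , λ e → wantsOut≢wantsω (trans (sym (update-same g u wantsOut)) e))
  ... | Q₂ , d₂ , tick₂ =
    tick₁ ▸ run-in u u≤n gu (buff-in-step (tickAll f) (step-after-tick (con-prefixSum _) d₁ (controller-in false i 0 i<N z≤n)))
          ▸ tick₂ ▸ run-τ {n = n} {update g u wantsOut} write
    where
    f′ = tickAll (tickAll f)
    write : buffAt f′ Q₂ ─⟨ τ ⟩→ buffAt (update f′ i F) (con (bc false false i 1))
    write = subst (λ j → buffAt f′ Q₂ ─⟨ τ ⟩→ buffAt (update f′ j F) (con (bc false false i 1))) (⊞-identityʳ i i<N)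
              (buff-w-step f′ (i ⊞′ 0) (⊞<N i 0) (trans (isFull-tickCell _) (trans (isFull-tickCell _) (empty _)))
                (step-after-tick (con-prefixSum _) d₂ (controller-w false i 0 i<N 0<N)))

  serve-out : ∀ n g u → u ≤ n → g u ≡ wantsOut → ∀ f i → i < N → AllEmpty f →
              Σ (ℕ → CellState) λ f′ → AllEmpty f′
                × Run (withUsers (buffAt (update f i F) (con (bc false false i 1))) n g)
                      (withUsers (buffAt f′ (con (bc false false (i ⊞′ 1) 0))) n (update g u wantsω)) 2
  serve-out n g u u≤n gu f i i<N empty
    with buff-run-tick (update f i F) (bc false false i 1) (u , u≤n , λ e → wantsOut≢wantsω (trans (sym gu) e))
  ... | Q₁ , d₁ , tick₁
    with buff-run-tick (update (tickAll (update f i F)) i E) (bc false true (i ⊞′ 1) 0)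
                       (u , u≤n , λ e → wantsOut≢wantsω (trans (sym gu) e))
  ... | Q₂ , d₂ , tick₂ = tickAll f₂ , empty′ ,
    (tick₁ ▸ run-τ {n = n} {g} read ▸ tick₂
           ▸ run-out u u≤n gu (buff-out-step (tickAll f₂) (step-after-tick (con-prefixSum _) d₂
                                                (controller-out false (i ⊞′ 1) 0 (⊞<N i 1) z≤n))))
    where
    f₁ = tickAll (update f i F)
    f₂ = update f₁ i E
    read : buffAt f₁ Q₁ ─⟨ τ ⟩→ buffAt f₂ (con (bc false true (i ⊞′ 1) 0))
    read = buff-ρ-step f₁ i i<N (trans (isFull-tickCell _) (cong isFull (update-same f i F)))
             (step-after-tick (con-prefixSum _) d₁ (controller-ρ false i 0 i<N 0<N))
    empty′ : AllEmpty (tickAll f₂)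
    empty′ k with k ≟ i
    ... | yes refl = trans (isFull-tickCell _) (cong isFull (update-same f₁ k E))
    ... | no k≢i   = trans (isFull-tickCell _) (trans (cong isFull (update-other f₁ i E k k≢i))
                       (trans (isFull-tickCell _) (trans (cong isFull (update-other f i F k k≢i)) (empty k))))

  serve : ∀ n g u → u ≤ n → g u ≡ wantsIn → ∀ f i → i < N → AllEmpty f →
          Σ (ℕ → CellState) λ f′ → AllEmpty f′
            × Run (withUsers (buffAt f (con (bc false false i 0))) n g)
                  (withUsers (buffAt f′ (con (bc false false (i ⊞′ 1) 0))) n (update (update g u wantsOut) u wantsω)) 4
  serve n g u u≤n gu f i i<N empty
    with serve-out n (update g u wantsOut) u u≤n (update-same g u wantsOut) (tickAll (tickAll f)) i i<N
                   (λ k → trans (isFull-tickCell _) (trans (isFull-tickCell _) (empty k)))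
  ... | f′ , empty′ , second = f′ , empty′ , serve-in n g u u≤n gu f i i<N empty ▸ second

  serve-from : ∀ n k u → k + u ≡ suc n → ∀ f i → i < N → AllEmpty f →
               Σ (Proc BK) λ P′ → Run (withUsers (buffAt f (con (bc false false i 0))) n (servedBelow u))
                                      (withUsers P′ n (servedBelow (suc n))) (4 * k)
  serve-from n zero    u refl f i i<N empty = _ , run-refl
  serve-from n (suc k) u k+u≡ f i i<N empty
    with serve n (servedBelow u) u (≤-trans (m≤n+m u k) (≤-reflexive (suc-injective k+u≡))) (servedBelow-self u) f i i<N empty
  ... | f′ , empty′ , first with serve-from n k (suc u) (trans (+-suc k u) k+u≡) f′ (i ⊞′ 1) (⊞<N i 1) empty′
  ... | P′ , rest = P′ , Run-subst refl refl (four+ k)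
        (Run-subst refl (cong (buffAt f′ (con (bc false false (i ⊞′ 1) 0)) ∥_) (Users-cong n _ _ λ j _ → serve-next u j))
            refl first ▸ rest)
    where
    four+ : ∀ k → 4 + 4 * k ≡ 4 * suc k
    four+ = solve-∀

  buff-reaches : ∀ n → RPAtLeast (Buff N) (suc n) (4 * suc n)
  buff-reaches n with serve-from n (suc n) 0 (+-identityʳ (suc n)) (λ _ → E) 0 0<N (λ _ → refl)
  ... | _ , r = run⇒RPAtLeast (Run-subst (cong₂ _∥_ (sym start≡buffAt) (sym (U≡Users n))) refl refl r)

module PipeProcess (N : ℕ) where

  open import Defs
  open BoolCmp
  open FunUpdate
  open Cells
  open Timed
  open import Data.Nat using (zero; suc; _+_; _≤_; _<_; z≤n; s≤s; _≤ᵇ_; _≟_; _≤?_)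
  open import Data.Nat.Properties
  open import Data.Product using (Σ; _×_; _,_; proj₁; proj₂)
  open import Data.Sum using (_⊎_; inj₁; inj₂)
  open import Data.Empty using (⊥-elim)
  open import Data.Bool using (Bool; true; false)
  open import Relation.Nullary using (¬_; Dec; yes; no)
  open import Relation.Binary.PropositionalEquality using (_≡_; _≢_; refl; cong; cong₂; sym; trans; subst)

  open Semantics cellBody
  open TimeSteps cellBody

  -- index of the input cell C_{N+1}
  L : ℕ
  L = suc N

  N+1≡L : N + 1 ≡ L
  N+1≡L = +-comm N 1

  inLabel : ℕ → ActT
  inLabel j = Φpipe N j inA

  outLabel : ℕ → ActT
  outLabel j = Φpipe N j outA

  inLabel-δ : ∀ j → j ≤ N → inLabel j ≡ vis (δ j)
  inLabel-δ j le rewrite ≤⇒≤ᵇ≡true le = refl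

  inLabel-L : inLabel L ≡ vis inA
  inLabel-L rewrite ≰⇒≤ᵇ≡false (1+n≰n {N}) = refl

  inLabel-cases : ∀ k → k ≤ L → ((k ≤ N) × (inLabel k ≡ vis (δ k))) ⊎ ((k ≡ L) × (inLabel k ≡ vis inA))
  inLabel-cases k le with m≤n⇒m<n∨m≡n le
  ... | inj₁ lt = inj₁ (≤-pred lt , inLabel-δ k (≤-pred lt))
  ... | inj₂ refl = inj₂ (refl , inLabel-L)

  inLabel≢out : ∀ j → j ≤ L → inLabel j ≢ vis outA
  inLabel≢out j j≤L e with inLabel-cases j j≤L
  ... | inj₁ (_ , e′) with trans (sym e′) e
  ...   | ()
  inLabel≢out j j≤L e | inj₂ (_ , e′) with trans (sym e′) e
  ... | ()

  inLabel≡δ : ∀ k m → k ≤ L → inLabel k ≡ vis (δ m) → k ≡ m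
  inLabel≡δ k m le e with inLabel-cases k le
  ... | inj₁ (_ , e') = δ-injective (vis-injective (trans (sym e') e))
  ... | inj₂ (_ , e') with trans (sym e') e
  ...   | ()

  inLabel≡in : ∀ k → k ≤ L → inLabel k ≡ vis inA → k ≡ L
  inLabel≡in k le e with inLabel-cases k le
  ... | inj₁ (_ , e') with trans (sym e') e
  ...   | ()
  inLabel≡in k le e | inj₂ (eq , _) = eq

  inLabel-vis : ∀ k a → k ≤ L → inLabel k ≡ vis a → (a ≡ inA) ⊎ (Σ ℕ λ m → a ≡ δ m)
  inLabel-vis k a le e with inLabel-cases k le
  ... | inj₁ (_ , e') = inj₂ (k , sym (vis-injective (trans (sym e') e)))
  ... | inj₂ (_ , e') = inj₁ (sym (vis-injective (trans (sym e') e)))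

  outLabel-cases : ∀ k a → outLabel k ≡ vis a → (a ≡ outA) ⊎ (Σ ℕ λ m → (a ≡ δ m) × (suc m ≡ k))
  outLabel-cases zero a refl = inj₁ refl
  outLabel-cases (suc k) a refl = inj₂ (k , refl , refl)

  pipeCell : ℕ → CellState → Proc Bool
  pipeCell j E = rel (con true) (Φpipe N j)
  pipeCell j Eᵘ = rel (upre (vis inA) (con false)) (Φpipe N j)
  pipeCell j F = rel (con false) (Φpipe N j)
  pipeCell j Fᵘ = rel (upre (vis outA) (con true)) (Φpipe N j)

  chain : (ℕ → CellState) → ℕ → Proc Bool
  chain f zero = pipeCell 0 (f 0)
  chain f (suc i) = par (chain f i) (λ a → a ≡ δ i) (pipeCell (suc i) (f (suc i)))

  pipeAt : (ℕ → CellState) → Proc Bool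
  pipeAt f = rel (chain f L) (hide (isδ N))

  pipeChain≡chain : ∀ i → pipeChain N i ≡ chain (λ _ → E) i
  pipeChain≡chain zero = refl
  pipeChain≡chain (suc i) = cong (λ x → par x (λ a → a ≡ δ i) (pipeCell (suc i) E)) (pipeChain≡chain i)

  start≡pipeAt : start (Pipe N) ≡ pipeAt (λ _ → E)
  start≡pipeAt = cong (λ C → rel C (hide (isδ N))) (trans (cong (pipeChain N) N+1≡L) (pipeChain≡chain L))

  chain-cong : ∀ f g i → (∀ k → k ≤ i → f k ≡ g k) → chain f i ≡ chain g i
  chain-cong f g zero h = cong (pipeCell 0) (h 0 z≤n)
  chain-cong f g (suc i) h = cong₂ (λ x y → par x (λ a → a ≡ δ i) (pipeCell (suc i) y))
    (chain-cong f g i (λ k le → h k (m≤n⇒m≤1+n le))) (h (suc i) ≤-refl)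

  pipeAt-cong : ∀ f g → (∀ k → k ≤ L → f k ≡ g k) → pipeAt f ≡ pipeAt g
  pipeAt-cong f g h = cong (λ x → rel x (hide (isδ N))) (chain-cong f g L h)

  data PipeCellStep (j : ℕ) (c : CellState) (α : ActT) (R : Proc Bool) : Set₁ where
    cell-in : isFull c ≡ false → α ≡ inLabel j → R ≡ pipeCell j F → PipeCellStep j c α R
    cell-out : isFull c ≡ true → α ≡ outLabel j → R ≡ pipeCell j E → PipeCellStep j c α R

  pipeCell-step-inv : ∀ j c {α R} → pipeCell j c ─⟨ α ⟩→ R → PipeCellStep j c α R
  pipeCell-step-inv j E (relA (conA preA)) = cell-in refl refl refl
  pipeCell-step-inv j Eᵘ (relA upreA) = cell-in refl refl refl
  pipeCell-step-inv j F (relA (conA preA)) = cell-out refl refl refl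
  pipeCell-step-inv j Fᵘ (relA upreA) = cell-out refl refl refl

  pipeCell-in-step : ∀ j c → isFull c ≡ false → pipeCell j c ─⟨ inLabel j ⟩→ pipeCell j F
  pipeCell-in-step j E _ = relA (conA preA)
  pipeCell-in-step j Eᵘ _ = relA upreA

  pipeCell-out-step : ∀ j c → isFull c ≡ true → pipeCell j c ─⟨ outLabel j ⟩→ pipeCell j E
  pipeCell-out-step j F _ = relA (conA preA)
  pipeCell-out-step j Fᵘ _ = relA upreA

  pipeCell-tick-inv : ∀ j c {X R} → pipeCell j c ─[ X ]→ R → R ≡ pipeCell j (tickCell c)
  pipeCell-tick-inv j E (relR (conR preR)) = refl
  pipeCell-tick-inv j Eᵘ (relR (upreR _)) = refl
  pipeCell-tick-inv j F (relR (conR preR)) = refl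
  pipeCell-tick-inv j Fᵘ (relR (upreR _)) = refl

  chain-tick-inv : ∀ f i {X R} → chain f i ─[ X ]→ R → R ≡ chain (tickAll f) i
  chain-tick-inv f zero d = pipeCell-tick-inv 0 (f 0) d
  chain-tick-inv f (suc i) (parR d1 d2 c) = cong₂ (λ x y → par x (λ a → a ≡ δ i) y) (chain-tick-inv f i d1)
      (pipeCell-tick-inv (suc i) (f (suc i)) d2)

  pipe-tick-inv : ∀ f {X R} → pipeAt f ─[ X ]→ R → R ≡ pipeAt (tickAll f)
  pipe-tick-inv f (relR d) = cong (λ x → rel x (hide (isδ N))) (chain-tick-inv f L d)

  data ChainStep (f : ℕ → CellState) (i : ℕ) (α : ActT) (R : Proc Bool) : Set₁ where
    chain-in : isFull (f i) ≡ false → α ≡ inLabel i → R ≡ chain (update f i F) i → ChainStep f i α R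
    chain-out : isFull (f 0) ≡ true → α ≡ vis outA → R ≡ chain (update f 0 E) i → ChainStep f i α R
    chain-move : ∀ j → j < i → isFull (f (suc j)) ≡ true → isFull (f j) ≡ false → α ≡ vis (δ j) →
           R ≡ chain (move f j) i → ChainStep f i α R

  chain-update-below : ∀ f j c i → j ≤ i → par (chain (update f j c) i) (λ a → a ≡ δ i) (pipeCell (suc i) (f (suc i)))
                                  ≡ chain (update f j c) (suc i)
  chain-update-below f j c i le = cong (λ x → par (chain (update f j c) i) (λ a → a ≡ δ i) (pipeCell (suc i) x))
                          (sym (update-other f j c (suc i) (>⇒≢ (s≤s le))))

  chain-update-top : ∀ f c i → par (chain f i) (λ a → a ≡ δ i) (pipeCell (suc i) c) ≡ chain (update f (suc i) c) (suc i)
  chain-update-top f c i = cong₂ (λ x y → par x (λ a → a ≡ δ i) (pipeCell (suc i) y))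
    (chain-cong f (update f (suc i) c) i (λ k le → sym (update-other f (suc i) c k (<⇒≢ (s≤s le)))))
    (sym (update-same f (suc i) c))

  chain-move-below : ∀ f j i → suc j ≤ i → par (chain (move f j) i) (λ a → a ≡ δ i) (pipeCell (suc i) (f (suc i)))
                                   ≡ chain (move f j) (suc i)
  chain-move-below f j i le = cong (λ x → par (chain (move f j) i) (λ a → a ≡ δ i) (pipeCell (suc i) x))
    (sym (trans (update-other (update f (suc j) E) j F (suc i) (>⇒≢ (s≤s (≤-trans (n≤1+n j) le))))
                (update-other f (suc j) E (suc i) (>⇒≢ (s≤s le)))))

  chain-move-top : ∀ f i → par (chain (update f i F) i) (λ a → a ≡ δ i) (pipeCell (suc i) E) ≡ chain (move f i) (suc i)
  chain-move-top f i = cong₂ (λ x y → par x (λ a → a ≡ δ i) (pipeCell (suc i) y))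
    (chain-cong (update f i F) (move f i) i h)
    (sym (trans (update-other (update f (suc i) E) i F (suc i) (λ ())) (update-same f (suc i) E)))
    where
    h : ∀ k → k ≤ i → update f i F k ≡ move f i k
    h k le with k ≟ i
    ... | yes refl = trans (update-same f k F) (sym (update-same (update f (suc k) E) k F))
    ... | no ne = trans (update-other f i F k ne)
                   (sym (trans (update-other (update f (suc i) E) i F k ne) (update-other f (suc i) E k (<⇒≢ (s≤s le)))))

  chain-step-inv : ∀ f i {α R} → i ≤ L → chain f i ─⟨ α ⟩→ R → ChainStep f i α R
  chain-step-inv f zero le d with pipeCell-step-inv 0 (f 0) d
  ... | cell-in e a r = chain-in e a (trans r (cong (pipeCell 0) (sym (update-same f 0 F))))
  ... | cell-out e a r = chain-out e a (trans r (cong (pipeCell 0) (sym (update-same f 0 E))))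
  chain-step-inv f (suc i) le (parL nA d) with chain-step-inv f i (≤-trans (n≤1+n i) le) d
  ... | chain-in e a r = ⊥-elim (nA (subst (λ z → z ∈A (λ b → b ≡ δ i)) (sym (trans a (inLabel-δ i (≤-pred le)))) refl))
  ... | chain-out e refl refl = chain-out e refl (chain-update-below f 0 E i z≤n)
  ... | chain-move j lt e1 e2 refl refl = chain-move j (≤-trans lt (n≤1+n i)) e1 e2 refl (chain-move-below f j i lt)
  chain-step-inv f (suc i) le (parR nA d) with pipeCell-step-inv (suc i) (f (suc i)) d
  ... | cell-in e a refl = chain-in e a (chain-update-top f F i)
  ... | cell-out e refl r = ⊥-elim (nA refl)
  chain-step-inv f (suc i) le (sync refl e1 e2) with chain-step-inv f i (≤-trans (n≤1+n i) le) e1 |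
      pipeCell-step-inv (suc i) (f (suc i)) e2
  ... | chain-in ei _ refl | cell-out eo _ refl = chain-move i ≤-refl eo ei refl (chain-move-top f i)
  ... | chain-out _ () _ | _
  ... | chain-move j lt _ _ x _ | _ = ⊥-elim (n≮n i (subst (_< i) (sym (δ-injective (vis-injective x))) lt))
  ... | chain-in _ _ _ | cell-in _ x _ = ⊥-elim (1+n≢n (inLabel≡δ (suc i) i le (sym x)))

  hide-δ : ∀ j → j ≤ L → extend (hide (isδ N)) (vis (δ j)) ≡ τ
  hide-δ j j≤L rewrite ≤⇒≤ᵇ≡true (subst (j ≤_) (sym N+1≡L) j≤L) = refl

  data PipeStep (f : ℕ → CellState) (α : ActT) (R : Proc Bool) : Set₁ where
    pipe-in : isFull (f L) ≡ false → α ≡ vis inA → R ≡ pipeAt (update f L F) → PipeStep f α R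
    pipe-out : isFull (f 0) ≡ true → α ≡ vis outA → R ≡ pipeAt (update f 0 E) → PipeStep f α R
    pipe-move : ∀ j → j ≤ N → isFull (f (suc j)) ≡ true → isFull (f j) ≡ false → α ≡ τ → R ≡ pipeAt (move f j) → PipeStep f α R

  pipe-step-inv : ∀ f {α R} → pipeAt f ─⟨ α ⟩→ R → PipeStep f α R
  pipe-step-inv f (relA e) with chain-step-inv f L ≤-refl e
  ... | chain-in e1 a refl = pipe-in e1 (cong (extend (hide (isδ N))) (trans a inLabel-L)) refl
  ... | chain-out e1 refl refl = pipe-out e1 refl refl
  ... | chain-move j lt e1 e2 refl refl = pipe-move j jN e1 e2 (hide-δ j (≤-trans jN (n≤1+n N))) refl
    where
    jN : j ≤ N
    jN = ≤-pred lt

  pipeCell-urgent-in : ∀ j → Urgent (pipeCell j Eᵘ) (inLabel j)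
  pipeCell-urgent-in j = urgent-rel urgent-upre

  pipeCell-urgent-out : ∀ j → Urgent (pipeCell j Fᵘ) (outLabel j)
  pipeCell-urgent-out j = urgent-rel urgent-upre

  chain-urgent-lift : ∀ f i k ℓ → k ≤ i → Urgent (chain f k) ℓ → (∀ m → k ≤ m → m < i → ¬ (ℓ ∈A (λ a → a ≡ δ m))) →
                      Urgent (chain f i) ℓ
  chain-urgent-lift f zero    zero ℓ z≤n u _ = u
  chain-urgent-lift f (suc i) k    ℓ k≤ u unsynced with m≤n⇒m<n∨m≡n k≤
  ... | inj₂ refl = u
  ... | inj₁ k<1+i = urgent-parˡ {α = ℓ} (unsynced i (≤-pred k<1+i) ≤-refl)
                       (chain-urgent-lift f i k ℓ (≤-pred k<1+i) u (λ m k≤m m<i → unsynced m k≤m (≤-trans m<i (n≤1+n i))))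

  pipe-urgent-in : ∀ f → f L ≡ Eᵘ → Urgent (pipeAt f) (vis inA)
  pipe-urgent-in f fL = urgent-rel {b = inA} (urgent-parʳ (λ ())
    (subst (λ c → Urgent (pipeCell L c) (vis inA)) (sym fL) (subst (Urgent _) inLabel-L (pipeCell-urgent-in L))))

  pipe-urgent-out : ∀ f → f 0 ≡ Fᵘ → Urgent (pipeAt f) (vis outA)
  pipe-urgent-out f f0 = urgent-rel {b = outA} (chain-urgent-lift f L 0 (vis outA) z≤n
    (subst (λ c → Urgent (pipeCell 0 c) (vis outA)) (sym f0) (pipeCell-urgent-out 0)) (λ _ _ _ ()))

  pipe-urgent-move : ∀ f j → j ≤ N → f (suc j) ≡ Fᵘ → f j ≡ Eᵘ → Urgent (pipeAt f) τ
  pipe-urgent-move f j j≤N f1+j fj = subst (Urgent (pipeAt f)) (hide-δ j (≤-trans j≤N (n≤1+n N)))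
    (urgent-rel {b = δ j} (chain-urgent-lift f L (suc j) (vis (δ j)) (s≤s j≤N) handover
      (λ m 1+j≤m _ eq → 1+n≰n (≤-trans 1+j≤m (≤-reflexive (sym (δ-injective eq)))))))
    where
    receiver : Urgent (pipeCell j (f j)) (vis (δ j))
    receiver = subst (λ c → Urgent (pipeCell j c) (vis (δ j))) (sym fj)
        (subst (Urgent _) (inLabel-δ j j≤N) (pipeCell-urgent-in j))
    lift : ∀ j → Urgent (pipeCell j (f j)) (vis (δ j)) → Urgent (chain f j) (vis (δ j))
    lift zero    u = u
    lift (suc j) u = urgent-parʳ (λ eq → 1+n≢n (δ-injective eq)) u
    handover : Urgent (chain f (suc j)) (vis (δ j))
    handover = urgent-sync refl (lift j receiver) (subst (λ c → Urgent (pipeCell (suc j) c) (vis (δ j)))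
        (sym f1+j) (pipeCell-urgent-out (suc j)))

  _≟ᶜ_ : (c d : CellState) → Dec (c ≡ d)
  _≟ᶜ_ E E = yes refl
  _≟ᶜ_ E Eᵘ = no (λ ())
  _≟ᶜ_ E F = no (λ ())
  _≟ᶜ_ E Fᵘ = no (λ ())
  _≟ᶜ_ Eᵘ E = no (λ ())
  _≟ᶜ_ Eᵘ Eᵘ = yes refl
  _≟ᶜ_ Eᵘ F = no (λ ())
  _≟ᶜ_ Eᵘ Fᵘ = no (λ ())
  _≟ᶜ_ F E = no (λ ())
  _≟ᶜ_ F Eᵘ = no (λ ())
  _≟ᶜ_ F F = yes refl
  _≟ᶜ_ F Fᵘ = no (λ ())
  _≟ᶜ_ Fᵘ E = no (λ ())
  _≟ᶜ_ Fᵘ Eᵘ = no (λ ())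
  _≟ᶜ_ Fᵘ F = no (λ ())
  _≟ᶜ_ Fᵘ Fᵘ = yes refl

  _≟δ_ : (a : Act) (i : ℕ) → Dec (a ≡ δ i)
  _≟δ_ (δ j) i with j ≟ i
  ... | yes refl = yes refl
  ... | no ne = no (λ e → ne (δ-injective e))
  _≟δ_ ω i = no (λ ())
  _≟δ_ inA i = no (λ ())
  _≟δ_ outA i = no (λ ())
  _≟δ_ (w x) i = no (λ ())
  _≟δ_ (ρ x) i = no (λ ())
  _≟δ_ (other x) i = no (λ ())

  CellRefusal : ℕ → CellState → Act → Set
  CellRefusal j c a = (c ≡ Eᵘ → inLabel j ≢ vis a) × (c ≡ Fᵘ → outLabel j ≢ vis a)

  ChainRefusal : (ℕ → CellState) → ℕ → Act → Set
  ChainRefusal f zero a = CellRefusal 0 (f 0) a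
  ChainRefusal f (suc i) a = ((a ≡ δ i) × (ChainRefusal f i a ⊎ CellRefusal (suc i) (f (suc i)) a))
                    ⊎ ((ChainRefusal f i a × CellRefusal (suc i) (f (suc i)) a) × ¬ (a ≡ δ i))

  ¬preim : ∀ (Φ : Relabel) a (X : ASet) → Φ a ≢ τ → (∀ b → Φ a ≡ vis b → ¬ X b) → ¬ preim Φ X a
  ¬preim Φ a X nt h p with Φ a in e
  ... | vis b = h b refl p
  ... | τ = nt refl

  Φpipe≢τ : ∀ j a → Φpipe N j a ≢ τ
  Φpipe≢τ j inA e with j ≤ᵇ N
  Φpipe≢τ j inA () | true
  Φpipe≢τ j inA () | false
  Φpipe≢τ j outA e with 1 ≤ᵇ j
  Φpipe≢τ j outA () | true
  Φpipe≢τ j outA () | false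
  Φpipe≢τ j ω ()
  Φpipe≢τ j (δ x) ()
  Φpipe≢τ j (w x) ()
  Φpipe≢τ j (ρ x) ()
  Φpipe≢τ j (other x) ()

  pipeCell-tick : ∀ j c → pipeCell j c ─[ CellRefusal j c ]→ pipeCell j (tickCell c)
  pipeCell-tick j E = relR (conR preR)
  pipeCell-tick j Eᵘ = relR (upreR (¬preim (Φpipe N j) inA (CellRefusal j Eᵘ) (Φpipe≢τ j inA) (λ b e r → proj₁ r refl e)))
  pipeCell-tick j F = relR (conR preR)
  pipeCell-tick j Fᵘ = relR (upreR (¬preim (Φpipe N j) outA (CellRefusal j Fᵘ) (Φpipe≢τ j outA) (λ b e r → proj₂ r refl e)))

  chain-tick : ∀ f i → chain f i ─[ ChainRefusal f i ]→ chain (tickAll f) i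
  chain-tick f zero = pipeCell-tick 0 (f 0)
  chain-tick f (suc i) = parR (chain-tick f i) (pipeCell-tick (suc i) (f (suc i))) (λ a r → r)

  pipe-tick : ∀ f → (∀ j → ChainRefusal f L (δ j)) → pipeAt f ─[ ChainRefusal f L ]→ pipeAt (tickAll f)
  pipe-tick f h = relR (tick-antitone (chain-tick f L) g)
    where
    g : ∀ a → preim (hide (isδ N)) (ChainRefusal f L) a → ChainRefusal f L a
    g (δ j) p = h j
    g ω p = p
    g inA p = p
    g outA p = p
    g (w x) p = p
    g (ρ x) p = p
    g (other x) p = p

  chainRefusal-all : ∀ f i a → (∀ k → k ≤ i → CellRefusal k (f k) a) → ChainRefusal f i a
  chainRefusal-all f zero a h = h 0 z≤n
  chainRefusal-all f (suc i) a h with _≟δ_ a i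
  ... | yes e = inj₁ (e , inj₁ (chainRefusal-all f i a (λ k le → h k (m≤n⇒m≤1+n le))))
  ... | no ne = inj₂ ((chainRefusal-all f i a (λ k le → h k (m≤n⇒m≤1+n le)) , h (suc i) ≤-refl) , ne)

  chainRefusal-lift : ∀ f i k a → k ≤ i → ChainRefusal f k a → (∀ m → k ≤ m → m < i → (a ≢ δ m) × CellRefusal
      (suc m) (f (suc m)) a) → ChainRefusal f i a
  chainRefusal-lift f zero zero a z≤n r h = r
  chainRefusal-lift f (suc i) k a le r h with m≤n⇒m<n∨m≡n le
  ... | inj₂ refl = r
  ... | inj₁ lt = inj₂ ((chainRefusal-lift f i k a (≤-pred lt) r (λ m km mi → h m km (≤-trans mi (n≤1+n i))) ,
                         proj₂ (h i (≤-pred lt) ≤-refl)) , proj₁ (h i (≤-pred lt) ≤-refl))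

  refuses-in : ∀ f → f L ≢ Eᵘ → ChainRefusal f L inA
  refuses-in f ne = chainRefusal-all f L inA (λ k le → (λ ceu e → ne (subst (λ z → f z ≡ Eᵘ) (inLabel≡in k le e) ceu)) ,
      (λ _ e → lem k e))
    where
    lem : ∀ k → outLabel k ≢ vis inA
    lem zero ()
    lem (suc k) ()

  refuses-out : ∀ f → f 0 ≢ Fᵘ → ChainRefusal f L outA
  refuses-out f ne = chainRefusal-all f L outA (λ k le → (λ _ e → inLabel≢out k le e) , (λ cfu e → lem k cfu e))
    where
    lem : ∀ k → f k ≡ Fᵘ → outLabel k ≢ vis outA
    lem zero cfu _ = ne cfu
    lem (suc k) cfu ()

  refuses-other : ∀ f a → (∀ m → a ≢ δ m) → a ≢ inA → a ≢ outA → ChainRefusal f L a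
  refuses-other f a ¬δ ¬in ¬out = chainRefusal-all f L a (λ k k≤L → (λ _ e → not-in k k≤L e) , (λ _ e → not-out k e))
    where
    not-in : ∀ k → k ≤ L → inLabel k ≢ vis a
    not-in k k≤L e with inLabel-vis k a k≤L e
    ... | inj₁ a≡in      = ¬in a≡in
    ... | inj₂ (m , a≡δ) = ¬δ m a≡δ
    not-out : ∀ k → outLabel k ≢ vis a
    not-out k e with outLabel-cases k a e
    ... | inj₁ a≡out         = ¬out a≡out
    ... | inj₂ (m , a≡δ , _) = ¬δ m a≡δ

  refuses-δ-unused : ∀ f j → L ≤ j → ChainRefusal f L (δ j)
  refuses-δ-unused f j L≤j = chainRefusal-all f L (δ j) (λ k k≤L → (λ _ e → not-in k k≤L e) , (λ _ e → not-out k k≤L e))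
    where
    not-in : ∀ k → k ≤ L → inLabel k ≢ vis (δ j)
    not-in k k≤L e with inLabel-cases k k≤L
    ... | inj₁ (k≤N , e′) = 1+n≰n (≤-trans L≤j (subst (_≤ N) (δ-injective (vis-injective (trans (sym e′) e))) k≤N))
    ... | inj₂ (_ , e′) with trans (sym e′) e
    ...   | ()
    not-out : ∀ k → k ≤ L → outLabel k ≢ vis (δ j)
    not-out k k≤L e with outLabel-cases k (δ j) e
    ... | inj₁ ()
    ... | inj₂ (m , δj≡δm , refl) = 1+n≰n (≤-trans (s≤s (≤-trans L≤j (≤-reflexive (δ-injective δj≡δm)))) k≤L)

  refuses-δ-top : ∀ f j → j ≤ N → ¬ (f (suc j) ≡ Fᵘ × f j ≡ Eᵘ) → ChainRefusal f (suc j) (δ j)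
  refuses-δ-top f j j≤N no-handover with f (suc j) ≟ᶜ Fᵘ
  ... | yes f1+j = inj₁ (refl , inj₁ (chainRefusal-all f j (δ j) λ k k≤j →
        (λ fk e → no-handover (f1+j , subst (λ z → f z ≡ Eᵘ) (inLabel≡δ k j (≤-trans k≤j (≤-trans j≤N (n≤1+n N))) e) fk)) ,
        (λ _ e → not-out k k≤j e)))
    where
    not-out : ∀ k → k ≤ j → outLabel k ≢ vis (δ j)
    not-out k k≤j e with outLabel-cases k (δ j) e
    ... | inj₁ ()
    ... | inj₂ (m , δj≡δm , refl) = 1+n≰n (subst (λ z → suc z ≤ j) (sym (δ-injective δj≡δm)) k≤j)
  ... | no f1+j≢ = inj₁ (refl , inj₂ ((λ _ e → 1+n≢n (inLabel≡δ (suc j) j (s≤s j≤N) e)) , (λ f1+j _ → f1+j≢ f1+j)))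

  refuses-δ : ∀ f j → (∀ j′ → j′ ≤ N → ¬ (f (suc j′) ≡ Fᵘ × f j′ ≡ Eᵘ)) → ChainRefusal f L (δ j)
  refuses-δ f j no-handover with j ≤? N
  ... | no j≰N = refuses-δ-unused f j (≰⇒> j≰N)
  ... | yes j≤N = chainRefusal-lift f L (suc j) (δ j) (s≤s j≤N) (refuses-δ-top f j j≤N (no-handover j j≤N)) above
    where
    above : ∀ m → suc j ≤ m → m < L → (δ j ≢ δ m) × CellRefusal (suc m) (f (suc m)) (δ j)
    above m 1+j≤m m<L = (λ e → 1+n≰n (subst (suc j ≤_) (sym (δ-injective e)) 1+j≤m)) ,
                        (λ _ e → 1+n≰n (≤-trans (s≤s (≤-trans (n≤1+n j) 1+j≤m)) (≤-reflexive (inLabel≡δ (suc m) j m<L e)))) ,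
                        (λ _ e → 1+n≰n (subst (suc j ≤_) (δ-injective (vis-injective e)) 1+j≤m))

module PipeBound (N : ℕ) where

  open import Defs
  open BoolCmp
  open FunUpdate
  open Cells
  open Timed
  open Budget
  open PipeProcess N
  open import Data.Nat using (zero; suc; _+_; _*_; _≤_; _<_; z≤n; s≤s; _≟_; _≤?_)
  open import Data.Nat.Properties
  open import Data.Nat.Tactic.RingSolver using (solve-∀)
  open import Data.Product using (Σ; _×_; _,_)
  open import Data.Sum using (inj₁; inj₂)
  open import Data.Empty using (⊥-elim)
  open import Data.Bool using (Bool; true; false; _∧_)
  open import Data.Unit using (tt)
  open import Data.List.Membership.Propositional using (_∈_)
  open import Relation.Nullary using (¬_; yes; no)
  open import Relation.Binary.PropositionalEquality using
      (_≡_; _≢_; refl; cong; cong₂; sym; trans; subst; subst₂; module ≡-Reasoning)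
  open import Algebra.Properties.CommutativeSemigroup +-commutativeSemigroup using (xy∙z≈xz∙y)

  open Semantics cellBody
  open TimeSteps cellBody

  isEᵘ : CellState → Bool
  isEᵘ Eᵘ = true
  isEᵘ _ = false

  itemsBelow : (ℕ → CellState) → ℕ → ℕ
  itemsBelow f zero = 0
  itemsBelow f (suc p) = itemsBelow f p + bit (isFull (f p))

  ready : (ℕ → CellState) → ℕ → Bool
  ready f zero = isTicked (f 0)
  ready f (suc p) = isTicked (f (suc p)) ∧ isEᵘ (f p)

  BudgetCovers : ℕ → ℕ → ℕ → Bool → ℕ → Set
  BudgetCovers b k p r s = p + 2 * k ≤ b + 1 + bit r + 2 * s

  itemsBelow-ext : ∀ f g p → (∀ k → k < p → isFull (f k) ≡ isFull (g k)) → itemsBelow f p ≡ itemsBelow g p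
  itemsBelow-ext f g zero h = refl
  itemsBelow-ext f g (suc p) h = cong₂ _+_ (itemsBelow-ext f g p (λ k lt → h k (≤-trans lt (n≤1+n p)))) (cong bit (h p ≤-refl))

  itemsBelow-update-above : ∀ f j c p → p ≤ j → itemsBelow (update f j c) p ≡ itemsBelow f p
  itemsBelow-update-above f j c p le = itemsBelow-ext _ _ p
      (λ k lt → cong isFull (update-other f j c k (λ e → 1+n≰n (≤-trans (subst (λ z → suc z ≤ p) e lt) le))))

  itemsBelow-update : ∀ f j c p → j < p →
                      itemsBelow (update f j c) p + bit (isFull (f j)) ≡ itemsBelow f p + bit (isFull c)
  itemsBelow-update f j c (suc p) j<1+p with m≤n⇒m<n∨m≡n (≤-pred j<1+p)
  ... | inj₁ j<p = begin
    itemsBelow f′ p + bit (isFull (f′ p)) + bit (isFull (f j))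
      ≡⟨ cong (λ x → itemsBelow f′ p + bit (isFull x) + bit (isFull (f j))) (update-other f j c p (>⇒≢ j<p)) ⟩
    itemsBelow f′ p + bit (isFull (f p)) + bit (isFull (f j))
      ≡⟨ xy∙z≈xz∙y (itemsBelow f′ p) _ _ ⟩
    itemsBelow f′ p + bit (isFull (f j)) + bit (isFull (f p))
      ≡⟨ cong (_+ bit (isFull (f p))) (itemsBelow-update f j c p j<p) ⟩
    itemsBelow f p + bit (isFull c) + bit (isFull (f p))
      ≡⟨ xy∙z≈xz∙y (itemsBelow f p) _ _ ⟩
    itemsBelow f p + bit (isFull (f p)) + bit (isFull c) ∎
    where
    open ≡-Reasoning
    f′ = update f j c
  ... | inj₂ refl rewrite update-same f j c | itemsBelow-update-above f j c j ≤-refl = xy∙z≈xz∙y (itemsBelow f j)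
      (bit (isFull c)) _

  itemsBelow-move : ∀ f j p → isFull (f (suc j)) ≡ true → isFull (f j) ≡ false → p ≢ suc j →
                    itemsBelow (move f j) p ≡ itemsBelow f p
  itemsBelow-move f j p full empty p≢1+j with p ≤? j
  ... | yes p≤j = trans (itemsBelow-update-above (update f (suc j) E) j F p p≤j)
                        (itemsBelow-update-above f (suc j) E p (≤-trans p≤j (n≤1+n j)))
  ... | no p≰j = +-cancelʳ-≡ 0 _ _ (begin
    itemsBelow (move f j) p + 0                        ≡⟨ cong (λ x → itemsBelow (move f j) p + bit x) (sym empty′) ⟩
    itemsBelow (move f j) p + bit (isFull (f′ j))      ≡⟨ itemsBelow-update f′ j F p (≤-trans (n≤1+n _) 1+j<p) ⟩
    itemsBelow f′ p + 1                                ≡⟨ cong (λ x → itemsBelow f′ p + bit x) (sym full) ⟩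
    itemsBelow f′ p + bit (isFull (f (suc j)))         ≡⟨ itemsBelow-update f (suc j) E p 1+j<p ⟩
    itemsBelow f p + 0                                 ∎)
    where
    open ≡-Reasoning
    f′ = update f (suc j) E
    empty′ : isFull (f′ j) ≡ false
    empty′ = trans (cong isFull (update-other f (suc j) E j (λ ()))) empty
    1+j<p : suc j < p
    1+j<p with m≤n⇒m<n∨m≡n (≰⇒> p≰j)
    ... | inj₁ 1+j<p = 1+j<p
    ... | inj₂ 1+j≡p = ⊥-elim (p≢1+j (sym 1+j≡p))

  itemsBelow-tickAll : ∀ f p → itemsBelow (tickAll f) p ≡ itemsBelow f p
  itemsBelow-tickAll f p = itemsBelow-ext _ _ p (λ k _ → isFull-tickCell (f k))

  itemsBelow-mono : ∀ f p q → p ≤ q → itemsBelow f p ≤ itemsBelow f q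
  itemsBelow-mono f zero zero z≤n = ≤-refl
  itemsBelow-mono f p (suc q) le with m≤n⇒m<n∨m≡n le
  ... | inj₂ refl = ≤-refl
  ... | inj₁ lt = ≤-trans (itemsBelow-mono f p q (≤-pred lt)) (m≤m+n (itemsBelow f q) _)

  budget-move-down : ∀ j pending b r s → r ≤ 1 → suc j + 2 * pending ≤ b + 1 + r + 2 * (s + 0) → j + 2 *
      pending ≤ b + 1 + 0 + 2 * s
  budget-move-down j pending b r s r1 h = ≤-pred
      (≤-trans h (≤-trans (+-monoˡ-≤ (2 * (s + 0)) (+-monoʳ-≤ (b + 1) r1)) (≤-reflexive (eq b s))))
    where
    eq : ∀ b s → b + 1 + 1 + 2 * (s + 0) ≡ suc (b + 1 + 0 + 2 * s)
    eq = solve-∀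

  budget-enter : ∀ x pending b r s → r ≤ 1 → x + 2 * pending ≤ b + 1 + r + 2 * s → x + 2 * pending ≤ b + 1 + 0 + 2 * (s + 1)
  budget-enter x pending b r s r1 h = ≤-trans h (≤-trans (+-monoˡ-≤ (2 * s) (+-monoʳ-≤ (b + 1) r1))
                        (≤-trans (m≤m+n _ 1) (≤-reflexive (sym (eq b s)))))
    where
    eq : ∀ b s → b + 1 + 0 + 2 * (s + 1) ≡ b + 1 + 1 + 2 * s + 1
    eq = solve-∀

  budget-leave : ∀ p c₀ c₁ b r s → p + 2 * (c₀ + suc c₁) ≤ b + 1 + r + 2 * (s + 1) → p + 2 * (c₀ + c₁) ≤ b + 1 + r + 2 * s
  budget-leave p c₀ c₁ b r s h = +-cancelʳ-≤ 2 _ _ (subst₂ _≤_ (e1 p c₀ c₁) (e2 b r s) h)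
    where
    e1 : ∀ p c₀ c₁ → p + 2 * (c₀ + suc c₁) ≡ p + 2 * (c₀ + c₁) + 2
    e1 = solve-∀
    e2 : ∀ b r s → b + 1 + r + 2 * (s + 1) ≡ b + 1 + r + 2 * s + 2
    e2 = solve-∀

  budget-tick : ∀ p pending b s → p + 2 * pending ≤ suc b + 1 + 0 + 2 * s → p + 2 * pending ≤ b + 1 + 1 + 2 * s
  budget-tick p pending b s h = ≤-trans h (≤-reflexive (e b s))
    where
    e : ∀ b s → suc b + 1 + 0 + 2 * s ≡ b + 1 + 1 + 2 * s
    e = solve-∀

  budget-tick-behind : ∀ q pending b s → q + 2 * pending ≤ suc b + 1 + 0 + 2 * s → BudgetCovers b pending (suc q) false (s + 1)
  budget-tick-behind q pending b s h = ≤-trans (s≤s h) (≤-reflexive (e b s))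
    where
    e : ∀ b s → suc (suc b + 1 + 0 + 2 * s) ≡ b + 1 + 0 + 2 * (s + 1)
    e = solve-∀

  budget-pos-entry : ∀ x c₀ c₁ b → 1 ≤ c₀ → x + 2 * (c₀ + c₁) ≤ b + 1 + 0 + 2 * c₁ → 1 ≤ b
  budget-pos-entry x (suc c₀) c₁ zero _ h = ⊥-elim
      (1+n≰n (≤-trans (≤-trans (≤-reflexive (e c₁)) (≤-trans (m≤n+m _ (x + 2 * c₀)) (≤-reflexive (e2 x c₀ c₁)))) h))
    where
    e : ∀ c₁ → suc (0 + 1 + 0 + 2 * c₁) ≡ 2 + 2 * c₁
    e = solve-∀
    e2 : ∀ x c₀ c₁ → x + 2 * c₀ + (2 + 2 * c₁) ≡ x + 2 * (suc c₀ + c₁)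
    e2 = solve-∀
  budget-pos-entry x (suc c₀) c₁ (suc b) _ h = s≤s z≤n

  budget-pos-item : ∀ p pending b s → suc s ≤ pending → BudgetCovers b pending p false s → 1 ≤ b
  budget-pos-item p pending zero s st h = ⊥-elim
      (1+n≰n (≤-trans (≤-trans (≤-reflexive (e s)) (≤-trans (*-monoʳ-≤ 2 st) (m≤n+m _ p))) h))
    where
    e : ∀ s → suc (0 + 1 + 0 + 2 * s) ≡ 2 * suc s
    e = solve-∀
  budget-pos-item p pending (suc b) s st h = s≤s z≤n

  itemsBelow-pos : ∀ f p → 1 ≤ itemsBelow f p → Σ ℕ λ k → k < p × isFull (f k) ≡ true
  itemsBelow-pos f (suc p) h with isFull (f p) in e
  ... | true = p , ≤-refl , e
  ... | false with itemsBelow-pos f p (subst (1 ≤_) (+-identityʳ _) h)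
  ...   | k , lt , ek = k , ≤-trans lt (n≤1+n p) , ek

  ready-F : ∀ f p → f p ≡ F → ready f p ≡ false
  ready-F f zero e rewrite e = refl
  ready-F f (suc p) e rewrite e = refl

  ready-ext : ∀ f g p → f p ≡ g p → (∀ q → p ≡ suc q → isEᵘ (f q) ≡ isEᵘ (g q)) → ready f p ≡ ready g p
  ready-ext f g zero e h = cong isTicked e
  ready-ext f g (suc q) e h = cong₂ _∧_ (cong isTicked e) (h q refl)

  full⇒¬Eᵘ : ∀ c → isFull c ≡ true → isEᵘ c ≡ false
  full⇒¬Eᵘ F _ = refl
  full⇒¬Eᵘ Fᵘ _ = refl
  full⇒¬Eᵘ E ()
  full⇒¬Eᵘ Eᵘ ()

  -- The budget b covers the time the pipe may still need: the item in a full cell p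
  -- reaches the output within p further time steps, and it and the items behind it
  -- (c₀ + c₁ − itemsBelow p of them, counting those of waiting users) leave at most
  -- two time steps apart; ready p saves a time step when that item can move at once.
  -- entry-budget is the same account for the next item to enter at cell L.
  record PipeInv (P : Proc Bool) (c₀ c₁ b : ℕ) : Set₁ where
    field
      cells        : ℕ → CellState
      is-pipeAt    : P ≡ pipeAt cells
      c₁≡          : c₁ ≡ itemsBelow cells (suc L)
      item-budget  : ∀ p → p ≤ L → isFull (cells p) ≡ true → BudgetCovers b (c₀ + c₁) p (ready cells p) (itemsBelow cells p)
      entry-budget : 1 ≤ c₀ → BudgetCovers b (c₀ + c₁) (suc L) (isEᵘ (cells L)) (itemsBelow cells (suc L))

  L≢0 : L ≢ 0
  L≢0 = 1+n≢0

  item-budget-after-move : ∀ b k f j → j ≤ N → isFull (f (suc j)) ≡ true → isFull (f j) ≡ false →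
    (∀ p → p ≤ L → isFull (f p) ≡ true → BudgetCovers b k p (ready f p) (itemsBelow f p)) →
    ∀ p → p ≤ L → isFull (move f j p) ≡ true → BudgetCovers b k p (ready (move f j) p) (itemsBelow (move f j) p)
  item-budget-after-move b k f j j≤N full empty item-budget p p≤L fp with p ≟ j
  ... | yes refl = subst₂ (BudgetCovers b k p) (sym (ready-F (move f p) p (move-at f p)))
                     (sym (itemsBelow-move f p p full empty (λ e → 1+n≢n (sym e))))
                     (budget-move-down p k b _ (itemsBelow f p) (bit≤1 _)
                       (subst (λ z → BudgetCovers b k (suc p) (ready f (suc p)) (itemsBelow f p + bit z)) empty
                         (item-budget (suc p) (s≤s j≤N) full)))
  ... | no p≢j with p ≟ suc j
  ...   | yes refl = ⊥-elim (false≢true (trans (sym (cong isFull (move-above f j))) fp))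
  ...   | no p≢1+j = subst₂ (BudgetCovers b k p) (sym ready≡) (sym (itemsBelow-move f j p full empty p≢1+j))
                       (item-budget p p≤L (trans (sym (cong isFull (move-other f j p p≢j p≢1+j))) fp))
    where
    ready≡ : ready (move f j) p ≡ ready f p
    ready≡ = ready-ext (move f j) f p (move-other f j p p≢j p≢1+j) below
      where
      below : ∀ q → p ≡ suc q → isEᵘ (move f j q) ≡ isEᵘ (f q)
      below q refl with q ≟ j
      ... | yes refl = ⊥-elim (p≢1+j refl)
      ... | no q≢j with q ≟ suc j
      ...   | yes refl = trans (cong isEᵘ (move-above f j)) (sym (full⇒¬Eᵘ _ full))
      ...   | no q≢1+j = cong isEᵘ (move-other f j q q≢j q≢1+j)

  inv-τ : ∀ {P P' c₀ c₁ b} → PipeInv P c₀ c₁ b → P ─⟨ τ ⟩→ P' → PipeInv P' c₀ c₁ b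
  inv-τ {c₀ = c₀} {c₁} {b} record { cells = f ; is-pipeAt = refl ; c₁≡ = c₁≡ ; item-budget = item-budget ;
      entry-budget = entry-budget } d with pipe-step-inv f d
  ... | pipe-in _ () _
  ... | pipe-out _ () _
  ... | pipe-move j j≤N full empty _ refl = record
    { cells = move f j ; is-pipeAt = refl ; c₁≡ = trans c₁≡ (sym (itemsBelow-move f j (suc L) full empty 2+N≢1+j))
    ; item-budget = item-budget-after-move b (c₀ + c₁) f j j≤N full empty item-budget ; entry-budget = entry-budget′ }
    where
    2+N≢1+j : suc L ≢ suc j
    2+N≢1+j e = 1+n≰n (≤-trans (≤-reflexive e) (s≤s j≤N))
    isEᵘ-L : isEᵘ (move f j L) ≡ isEᵘ (f L)
    isEᵘ-L with L ≟ suc j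
    ... | yes e  = trans (cong isEᵘ (trans (cong (move f j) e) (move-above f j)))
                     (sym (full⇒¬Eᵘ _ (trans (cong (λ z → isFull (f z)) e) full)))
    ... | no L≢1+j = cong isEᵘ (move-other f j L (λ e → 1+n≰n (≤-trans (s≤s j≤N) (≤-reflexive e))) L≢1+j)
    entry-budget′ : 1 ≤ c₀ → BudgetCovers b (c₀ + c₁) (suc L) (isEᵘ (move f j L)) (itemsBelow (move f j) (suc L))
    entry-budget′ h = subst₂ (BudgetCovers b (c₀ + c₁) (suc L)) (sym isEᵘ-L)
                        (sym (itemsBelow-move f j (suc L) full empty 2+N≢1+j)) (entry-budget h)

  inv-in : ∀ {P P' c₀ c₁ b} → PipeInv P (suc c₀) c₁ b → P ─⟨ vis inA ⟩→ P' → PipeInv P' c₀ (suc c₁) b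
  inv-in {c₀ = c₀} {c₁} {b} record { cells = f ; is-pipeAt = refl ; c₁≡ = c₁≡ ; item-budget = item-budget ;
      entry-budget = entry-budget } d with pipe-step-inv f d
  ... | pipe-out _ () _
  ... | pipe-move _ _ _ _ () _
  ... | pipe-in eL _ refl = record { cells = f' ; is-pipeAt = refl ; c₁≡ = c₁≡′ ; item-budget = item-budget′
      ; entry-budget = entry-budget′ }
    where
    f' = update f L F
    pending = c₀ + suc c₁
    tEq : suc c₀ + c₁ ≡ c₀ + suc c₁
    tEq = sym (+-suc c₀ c₁)
    entry-budget-now : suc L + 2 * pending ≤ b + 1 + bit (isEᵘ (f L)) + 2 * itemsBelow f (suc L)
    entry-budget-now = subst (λ k → BudgetCovers b k (suc L) (isEᵘ (f L)) (itemsBelow f (suc L))) tEq (entry-budget (s≤s z≤n))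
    itemsBelow-after-in : itemsBelow f' (suc L) ≡ itemsBelow f (suc L) + 1
    itemsBelow-after-in = trans (sym (+-identityʳ _)) (trans (cong (λ z → itemsBelow f' (suc L) + bit z) (sym eL))
        (itemsBelow-update f L F (suc L) ≤-refl))
    c₁≡′ : suc c₁ ≡ itemsBelow f' (suc L)
    c₁≡′ = trans (cong suc c₁≡) (trans (+-comm 1 _) (sym itemsBelow-after-in))
    item-budget′ : ∀ p → p ≤ L → isFull (f' p) ≡ true → BudgetCovers b pending p (ready f' p) (itemsBelow f' p)
    item-budget′ p pL fp with p ≟ L
    ... | yes refl = subst₂ (BudgetCovers b pending p) (sym (ready-F f' p (update-same f p F)))
                       (sym (itemsBelow-update-above f p F p ≤-refl))
                       (budget-move-down p pending b _ (itemsBelow f p) (bit≤1 _)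
                           (subst (λ z → BudgetCovers b pending (suc p) (isEᵘ (f p)) (itemsBelow f p + bit z))
                               eL entry-budget-now))
    ... | no ne = subst₂ (BudgetCovers b pending p) (sym ready≡) (sym (itemsBelow-update-above f L F p pL))
                    (subst (λ k → BudgetCovers b k p (ready f p) (itemsBelow f p)) tEq
                      (item-budget p pL (trans (sym (cong isFull (update-other f L F p ne))) fp)))
      where
      ready≡ : ready f' p ≡ ready f p
      ready≡ = ready-ext f' f p (update-other f L F p ne)
             (λ q e → cong isEᵘ (update-other f L F q (λ eq → 1+n≰n (≤-trans (≤-reflexive (sym (trans e (cong suc eq)))) pL))))
    entry-budget′ : 1 ≤ c₀ → BudgetCovers b pending (suc L) (isEᵘ (f' L)) (itemsBelow f' (suc L))
    entry-budget′ h = subst₂ (BudgetCovers b pending (suc L)) (sym (cong isEᵘ (update-same f L F))) (sym itemsBelow-after-in)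
               (budget-enter (suc L) pending b _ (itemsBelow f (suc L)) (bit≤1 _) entry-budget-now)

  inv-out : ∀ {P P' c₀ c₁ b} → PipeInv P c₀ (suc c₁) b → P ─⟨ vis outA ⟩→ P' → PipeInv P' c₀ c₁ b
  inv-out {c₀ = c₀} {c₁} {b} record { cells = f ; is-pipeAt = refl ; c₁≡ = c₁≡ ; item-budget = item-budget
      ; entry-budget = entry-budget } d with pipe-step-inv f d
  ... | pipe-in _ () _
  ... | pipe-move _ _ _ _ () _
  ... | pipe-out e0 _ refl = record { cells = f' ; is-pipeAt = refl ; c₁≡ = c₁≡′ ; item-budget = item-budget′
      ; entry-budget = entry-budget′ }
    where
    f' = update f 0 E
    pending = c₀ + c₁
    itemsBelow-after-out : ∀ p → itemsBelow f (suc p) ≡ itemsBelow f' (suc p) + 1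
    itemsBelow-after-out p = sym (trans (cong (λ z → itemsBelow f' (suc p) + bit z) (sym e0))
        (trans (itemsBelow-update f 0 E (suc p) (s≤s z≤n)) (+-identityʳ _)))
    c₁≡′ : c₁ ≡ itemsBelow f' (suc L)
    c₁≡′ = suc-injective (trans c₁≡ (trans (itemsBelow-after-out L) (+-comm _ 1)))
    item-budget′ : ∀ p → p ≤ L → isFull (f' p) ≡ true → BudgetCovers b pending p (ready f' p) (itemsBelow f' p)
    item-budget′ zero pL fp = ⊥-elim (false≢true (trans (sym (cong isFull (update-same f 0 E))) fp))
    item-budget′ (suc q) pL fp = subst (λ z → BudgetCovers b pending (suc q) z (itemsBelow f' (suc q))) (sym ready≡)
                            (budget-leave (suc q) c₀ c₁ b _ (itemsBelow f' (suc q))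
                              (subst (BudgetCovers b (c₀ + suc c₁) (suc q) (ready f (suc q))) (itemsBelow-after-out q)
                                (item-budget (suc q) pL (trans (sym (cong isFull (update-other f 0 E (suc q) (λ ())))) fp))))
      where
      ready≡ : ready f' (suc q) ≡ ready f (suc q)
      ready≡ = ready-ext f' f (suc q) (update-other f 0 E (suc q) (λ ())) h
        where
        h : ∀ q' → suc q ≡ suc q' → isEᵘ (f' q') ≡ isEᵘ (f q')
        h zero _ = trans (cong isEᵘ (update-same f 0 E)) (sym (full⇒¬Eᵘ _ e0))
        h (suc q') _ = cong isEᵘ (update-other f 0 E (suc q') (λ ()))
    entry-budget′ : 1 ≤ c₀ → BudgetCovers b pending (suc L) (isEᵘ (f' L)) (itemsBelow f' (suc L))
    entry-budget′ h = subst (λ z → BudgetCovers b pending (suc L) z (itemsBelow f' (suc L)))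
        (sym (cong isEᵘ (update-other f 0 E L L≢0)))
               (budget-leave (suc L) c₀ c₁ b _ (itemsBelow f' (suc L))
                 (subst (BudgetCovers b (c₀ + suc c₁) (suc L) (isEᵘ (f L))) (itemsBelow-after-out L) (entry-budget h)))

  ready-0-false : ∀ c → isFull c ≡ true → c ≢ Fᵘ → isTicked c ≡ false
  ready-0-false F _ _ = refl
  ready-0-false Fᵘ _ n = ⊥-elim (n refl)
  ready-0-false E () _
  ready-0-false Eᵘ () _

  ready-suc-false : ∀ c c' → isFull c ≡ true → ¬ (c ≡ Fᵘ × c' ≡ Eᵘ) → (isTicked c ∧ isEᵘ c') ≡ false
  ready-suc-false F c' _ _ = refl
  ready-suc-false Fᵘ Eᵘ _ n = ⊥-elim (n (refl , refl))
  ready-suc-false Fᵘ E _ _ = refl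
  ready-suc-false Fᵘ F _ _ = refl
  ready-suc-false Fᵘ Fᵘ _ _ = refl
  ready-suc-false E c' () _
  ready-suc-false Eᵘ c' () _

  ≢Eᵘ⇒isEᵘ≡false : ∀ c → c ≢ Eᵘ → isEᵘ c ≡ false
  ≢Eᵘ⇒isEᵘ≡false Eᵘ n = ⊥-elim (n refl)
  ≢Eᵘ⇒isEᵘ≡false E _ = refl
  ≢Eᵘ⇒isEᵘ≡false F _ = refl
  ≢Eᵘ⇒isEᵘ≡false Fᵘ _ = refl

  isEᵘ-tick-empty : ∀ c → isFull c ≡ false → isEᵘ (tickCell c) ≡ true
  isEᵘ-tick-empty E _ = refl
  isEᵘ-tick-empty Eᵘ _ = refl
  isEᵘ-tick-empty F ()
  isEᵘ-tick-empty Fᵘ ()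

  isEᵘ-tick-full : ∀ c → isFull c ≡ true → isEᵘ (tickCell c) ≡ false
  isEᵘ-tick-full F _ = refl
  isEᵘ-tick-full Fᵘ _ = refl
  isEᵘ-tick-full E ()
  isEᵘ-tick-full Eᵘ ()

  budget-pos : ∀ f c₀ c₁ b → c₁ ≡ itemsBelow f (suc L) →
         (∀ p → p ≤ L → isFull (f p) ≡ true → BudgetCovers b (c₀ + c₁) p false (itemsBelow f p)) →
         (1 ≤ c₀ → BudgetCovers b (c₀ + c₁) (suc L) false (itemsBelow f (suc L))) → 1 ≤ c₀ + c₁ → 1 ≤ b
  budget-pos f (suc c₀′) c₁ b c₁≡ it fu ha =
    budget-pos-entry (suc L) (suc c₀′) c₁ b (s≤s z≤n) (subst (BudgetCovers b (suc c₀′ + c₁) (suc L) false)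
        (sym c₁≡) (fu (s≤s z≤n)))
  budget-pos f zero c₁ b c₁≡ it fu ha with itemsBelow-pos f (suc L) (subst (1 ≤_) c₁≡ ha)
  ... | k , kl , fk = budget-pos-item k (0 + c₁) b (itemsBelow f k) st (it k (≤-pred kl) fk)
    where
    st : suc (itemsBelow f k) ≤ c₁
    st = subst (suc (itemsBelow f k) ≤_) (sym c₁≡)
           (≤-trans (≤-reflexive (trans (+-comm 1 (itemsBelow f k)) (cong (λ z → itemsBelow f k + bit z) (sym fk))))
               (itemsBelow-mono f (suc k) (suc L) kl))

  inv-after-tick : ∀ f c₀ c₁ b' {P'} → P' ≡ pipeAt (tickAll f) → c₁ ≡ itemsBelow f (suc L) →
         (∀ p → p ≤ L → isFull (f p) ≡ true → BudgetCovers (suc b') (c₀ + c₁) p false (itemsBelow f p)) →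
         (1 ≤ c₀ → BudgetCovers (suc b') (c₀ + c₁) (suc L) false (itemsBelow f (suc L))) → PipeInv P' c₀ c₁ b'
  inv-after-tick f c₀ c₁ b' is-pipeAt c₁≡ it fu = record { cells = tickAll f ; is-pipeAt = is-pipeAt ; c₁≡
      = trans c₁≡ (sym (itemsBelow-tickAll f (suc L))) ;
      item-budget = item-budget′ ; entry-budget = entry-budget′ }
    where
    pending = c₀ + c₁
    item-budget′ : ∀ p → p ≤ L → isFull (tickCell (f p)) ≡ true → BudgetCovers b' pending p (ready (tickAll f) p)
        (itemsBelow (tickAll f) p)
    item-budget′ zero pL fp = subst (λ r → BudgetCovers b' pending 0 r 0) (sym (isTicked-tickCell (f 0)))
                          (budget-tick 0 pending b' 0 (it 0 pL (trans (sym (isFull-tickCell (f 0))) fp)))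
    item-budget′ (suc q) pL fp with isFull (f q) in e
    ... | false = subst₂ (BudgetCovers b' pending (suc q))
                    (sym (cong₂ _∧_ (isTicked-tickCell (f (suc q))) (isEᵘ-tick-empty (f q) e)))
                        (sym (itemsBelow-tickAll f (suc q)))
                    (budget-tick (suc q) pending b' (itemsBelow f (suc q))
                        (it (suc q) pL (trans (sym (isFull-tickCell (f (suc q)))) fp)))
    ... | true = subst₂ (BudgetCovers b' pending (suc q))
                    (sym (trans (cong₂ _∧_ (isTicked-tickCell (f (suc q))) (isEᵘ-tick-full (f q) e)) refl))
                        (sym (trans (itemsBelow-tickAll f (suc q)) (cong (λ z → itemsBelow f q + bit z) e)))
                    (budget-tick-behind q pending b' (itemsBelow f q) (it q (≤-trans (n≤1+n q) pL) e))
    entry-budget′ : 1 ≤ c₀ → suc L + 2 * pending ≤ b' + 1 + bit (isEᵘ (tickCell (f L))) + 2 * itemsBelow (tickAll f) (suc L)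
    entry-budget′ h = bool-cases (isFull (f L))
      (λ e → subst₂ (BudgetCovers b' pending (suc L)) (sym (isEᵘ-tick-empty (f L) e))
               (sym (itemsBelow-tickAll f (suc L))) (budget-tick (suc L) pending b' (itemsBelow f (suc L)) (fu h)))
      (λ e → subst₂ (BudgetCovers b' pending (suc L)) (sym (isEᵘ-tick-full (f L) e))
               (sym (trans (itemsBelow-tickAll f (suc L)) (cong (λ z → itemsBelow f L + bit z) e)))
               (budget-tick-behind L pending b' (itemsBelow f L) (it L ≤-refl e)))

  inv-tick : ∀ {P P' X c₀ c₁ b} → PipeInv P c₀ c₁ b → P ─[ X ]→ P' → (1 ≤ c₀ → X inA) →
          (1 ≤ c₁ → X outA) → 1 ≤ c₀ + c₁ → Σ ℕ λ b' → b ≡ suc b' × PipeInv P' c₀ c₁ b'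
  inv-tick {X = X} {c₀} {c₁} {b} record { cells = f ; is-pipeAt = refl ; c₁≡ = c₁≡ ; item-budget = item-budget
      ; entry-budget = entry-budget } d hi ho ha =
    consume-budget b (budget-pos f c₀ c₁ b c₁≡ item-budget₀ entry-budget₀ ha) item-budget₀ entry-budget₀
    where
    pending = c₀ + c₁
    no-handover : ∀ j → j ≤ N → ¬ (f (suc j) ≡ Fᵘ × f j ≡ Eᵘ)
    no-handover j jN (e1 , e2) = pipe-urgent-move f j jN e1 e2 d tt
    no-in : 1 ≤ c₀ → f L ≢ Eᵘ
    no-in h e = pipe-urgent-in f e d (hi h)
    no-out : f 0 ≢ Fᵘ
    no-out e = pipe-urgent-out f e d (ho c1pos)
      where
      c1pos : 1 ≤ c₁
      c1pos = subst (1 ≤_) (sym c₁≡) (≤-trans (≤-reflexive (cong bit (sym (cong isFull e))))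
          (itemsBelow-mono f 1 (suc L) (s≤s z≤n)))
    not-ready : ∀ p → p ≤ L → isFull (f p) ≡ true → ready f p ≡ false
    not-ready zero _ fp = ready-0-false (f 0) fp no-out
    not-ready (suc q) pL fp = ready-suc-false (f (suc q)) (f q) fp (no-handover q (≤-pred pL))
    item-budget₀ : ∀ p → p ≤ L → isFull (f p) ≡ true → BudgetCovers b pending p false (itemsBelow f p)
    item-budget₀ p pL fp = subst (λ z → BudgetCovers b pending p z (itemsBelow f p)) (not-ready p pL fp) (item-budget p pL fp)
    entry-budget₀ : 1 ≤ c₀ → BudgetCovers b pending (suc L) false (itemsBelow f (suc L))
    entry-budget₀ h = subst (λ z → BudgetCovers b pending (suc L) z (itemsBelow f (suc L)))
        (≢Eᵘ⇒isEᵘ≡false (f L) (no-in h)) (entry-budget h)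
    consume-budget : ∀ b → 1 ≤ b → (∀ p → p ≤ L → isFull (f p) ≡ true → BudgetCovers b pending p false (itemsBelow f p)) →
                     (1 ≤ c₀ → BudgetCovers b pending (suc L) false (itemsBelow f (suc L))) →
                     Σ ℕ λ b' → b ≡ suc b' × PipeInv _ c₀ c₁ b'
    consume-budget (suc b') _ it fu = b' , refl , inv-after-tick f c₀ c₁ b' (pipe-tick-inv f d) c₁≡ it fu

  open Budget.ClosedSystem.BudgetArgument cellBody PipeInv inv-τ inv-in inv-out inv-tick

  itemsBelow-empty : ∀ p → itemsBelow (λ _ → E) p ≡ 0
  itemsBelow-empty zero    = refl
  itemsBelow-empty (suc p) = trans (+-identityʳ _) (itemsBelow-empty p)

  pipe-ticks≤ : ∀ n {ws R} → Steps (start (Pipe N) ∥ U (suc n)) ws R → ¬ (act ω ∈ eraseτ ws) →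
                ζ (eraseτ ws) ≤ 2 * suc n + N + 1
  pipe-ticks≤ n steps ¬ω = ticks≤budget-initially n steps ¬ω record
    { cells = λ _ → E ; is-pipeAt = start≡pipeAt ; c₁≡ = sym (itemsBelow-empty (suc L)) ; item-budget = λ _ _ ()
    ; entry-budget = λ _ → subst (λ s → suc L + 2 * (suc n + 0) ≤ 2 * suc n + N + 1 + 1 + 0 + 2 * s)
                        (sym (itemsBelow-empty (suc L))) (≤-reflexive (initially N n)) }
    where
    initially : ∀ N n → suc (suc N) + 2 * (suc n + 0) ≡ 2 * suc n + N + 1 + 1 + 0 + 2 * 0
    initially = solve-∀

module PipeRun (N : ℕ) where

  open import Defs
  open BoolCmp
  open FunUpdate
  open Cells
  open Timed
  open Users
  open Budget
  open PipeProcess N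
  open import Data.Nat using (zero; suc; _+_; _*_; _≤_; _<_; z≤n; s≤s; _≟_)
  open import Data.Nat.Properties
  open import Data.Nat.Tactic.RingSolver using (solve-∀)
  open import Data.Product using (Σ; _×_; _,_; proj₁)
  open import Data.Sum using (_⊎_; inj₁; inj₂)
  open import Data.Empty using (⊥-elim)
  open import Data.Bool using (Bool; true; false)
  open import Relation.Nullary using (¬_; yes; no)
  open import Relation.Binary.Definitions using (tri<; tri≈; tri>)
  open import Relation.Binary.PropositionalEquality using (_≡_; _≢_; refl; cong; cong₂; sym; trans; subst; subst₂)

  open Semantics cellBody
  open TimeSteps cellBody
  open UserProcesses cellBody
  open ClosedSystem cellBody

  chain-out-step : ∀ f i → isFull (f 0) ≡ true → chain f i ─⟨ vis outA ⟩→ chain (update f 0 E) i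
  chain-out-step f zero e = subst (λ z → pipeCell 0 (f 0) ─⟨ vis outA ⟩→ pipeCell 0 z) (sym (update-same f 0 E))
      (pipeCell-out-step 0 (f 0) e)
  chain-out-step f (suc i) e = subst (λ z → chain f (suc i) ─⟨ vis outA ⟩→ z) (chain-update-below f 0 E i z≤n)
      (parL (λ ()) (chain-out-step f i e))

  pipe-out-step : ∀ f → isFull (f 0) ≡ true → pipeAt f ─⟨ vis outA ⟩→ pipeAt (update f 0 E)
  pipe-out-step f e = relA (chain-out-step f L e)

  pipe-in-step : ∀ f → isFull (f L) ≡ false → pipeAt f ─⟨ vis inA ⟩→ pipeAt (update f L F)
  pipe-in-step f e = relA (subst (chain f L ─⟨ vis inA ⟩→_) (chain-update-top f F N)
    (parR (λ ()) (subst (λ α → pipeCell L (f L) ─⟨ α ⟩→ pipeCell L F) inLabel-L (pipeCell-in-step L (f L) e))))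

  chain-δ-in-step : ∀ f j → j ≤ N → isFull (f j) ≡ false → chain f j ─⟨ vis (δ j) ⟩→ chain (update f j F) j
  chain-δ-in-step f zero jN e = subst₂ (λ z u → pipeCell 0 (f 0) ─⟨ z ⟩→ pipeCell 0 u) (inLabel-δ 0 jN)
      (sym (update-same f 0 F)) (pipeCell-in-step 0 (f 0) e)
  chain-δ-in-step f (suc j) jN e = subst (λ z → chain f (suc j) ─⟨ vis (δ (suc j)) ⟩→ z) (chain-update-top f F j)
    (parR (λ eq → 1+n≢n (δ-injective eq)) (subst (λ z → pipeCell (suc j) (f (suc j)) ─⟨ z ⟩→ pipeCell (suc j) F)
        (inLabel-δ (suc j) jN)
      (pipeCell-in-step (suc j) (f (suc j)) e)))

  chain-move-lift : ∀ f j i → suc j ≤ i → chain f (suc j) ─⟨ vis (δ j) ⟩→ chain (move f j) (suc j) →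
           chain f i ─⟨ vis (δ j) ⟩→ chain (move f j) i
  chain-move-lift f j zero () d
  chain-move-lift f j (suc i) le d with m≤n⇒m<n∨m≡n le
  ... | inj₂ refl = d
  ... | inj₁ lt = subst (λ z → chain f (suc i) ─⟨ vis (δ j) ⟩→ z) (chain-move-below f j i (≤-pred lt))
                    (parL (λ eq → 1+n≰n (≤-trans (≤-pred lt) (≤-reflexive (sym (δ-injective eq)))))
                        (chain-move-lift f j i (≤-pred lt) d))

  pipe-move-step : ∀ f j → j ≤ N → isFull (f (suc j)) ≡ true → isFull (f j) ≡ false → pipeAt f ─⟨ τ ⟩→ pipeAt (move f j)
  pipe-move-step f j jN e1 e2 = subst (λ z → pipeAt f ─⟨ z ⟩→ pipeAt (move f j)) (hide-δ j (≤-trans jN (n≤1+n N)))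
    (relA (chain-move-lift f j L (s≤s jN)
      (subst (λ z → chain f (suc j) ─⟨ vis (δ j) ⟩→ z) (chain-move-top f j)
          (sync refl (chain-δ-in-step f j jN e2) (pipeCell-out-step (suc j) (f (suc j)) e1)))))

  run-pipe-tick : ∀ f n g → (∀ j → j ≤ N → ¬ (f (suc j) ≡ Fᵘ × f j ≡ Eᵘ)) →
             (f L ≡ Eᵘ → ∀ i → i ≤ n → g i ≢ wantsIn) → (f 0 ≡ Fᵘ → ∀ i → i ≤ n → g i ≢ wantsOut) →
             (Σ ℕ λ i → i ≤ n × g i ≢ wantsω) → Run (withUsers (pipeAt f) n g) (withUsers (pipeAt (tickAll f)) n g) 1
  run-pipe-tick f n g no-handover in-blocked out-blocked unfinished =
    run-tick (pipe-tick f (λ j → refuses-δ f j no-handover)) cover (refuses-other f ω (λ m ()) (λ ()) (λ ())) unfinished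
    where
    cover : ∀ a → ¬ (a ≡ ω) → ChainRefusal f L a ⊎ UsersRefusal n g a
    cover inA _ with _≟ᶜ_ (f L) Eᵘ
    ... | yes e = inj₂ ((λ _ → in-blocked e) , (λ ()) , (λ ()))
    ... | no ne = inj₁ (refuses-in f ne)
    cover outA _ with _≟ᶜ_ (f 0) Fᵘ
    ... | yes e = inj₂ ((λ ()) , (λ _ → out-blocked e) , (λ ()))
    ... | no ne = inj₁ (refuses-out f ne)
    cover (δ j) _ = inj₁ (refuses-δ f j no-handover)
    cover ω ne = ⊥-elim (ne refl)
    cover (w x) _ = inj₁ (refuses-other f (w x) (λ m ()) (λ ()) (λ ()))
    cover (ρ x) _ = inj₁ (refuses-other f (ρ x) (λ m ()) (λ ()) (λ ()))
    cover (other x) _ = inj₁ (refuses-other f (other x) (λ m ()) (λ ()) (λ ()))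

  moves-down : ∀ n g p f → p ≤ L → isFull (f p) ≡ true → (∀ k → k < p → isFull (f k) ≡ false) →
           Σ (ℕ → CellState) λ f' → Run (withUsers (pipeAt f) n g) (withUsers (pipeAt f') n g) 0 ×
             (isFull (f' 0) ≡ true) × (∀ k → 1 ≤ k → k ≤ p → f' k ≡ E) × (∀ k → p < k → f' k ≡ f k)
  moves-down n g zero f _ e0 _ = f , run-refl , e0 , (λ { k (s≤s z≤n) () }) , (λ _ _ → refl)
  moves-down n g (suc q) f pL ep below with moves-down n g q (move f q) (≤-trans (n≤1+n q) pL)
      (cong isFull (move-at f q)) below'
    where
    below' : ∀ k → k < q → isFull (move f q k) ≡ false
    below' k lt = trans (cong isFull (move-other f q k (<⇒≢ lt) (<⇒≢ (≤-trans lt (n≤1+n q))))) (below k (≤-trans lt (n≤1+n q)))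
  ... | f' , r , e0 , mid , above = f' , (run-τ {n = n} {g = g} (pipe-move-step f q qN ep (below q ≤-refl)) ▸ r)
      , e0 , mid' , above'
    where
    qN : q ≤ N
    qN = ≤-pred pL
    mid' : ∀ k → 1 ≤ k → k ≤ suc q → f' k ≡ E
    mid' k k1 kq with m≤n⇒m<n∨m≡n kq
    ... | inj₁ lt = mid k k1 (≤-pred lt)
    ... | inj₂ refl = trans (above (suc q) ≤-refl) (move-above f q)
    above' : ∀ k → suc q < k → f' k ≡ f k
    above' k lt = trans (above k (≤-trans (n≤1+n _) lt)) (move-other f q k (λ e → <⇒≢ (≤-trans (n≤1+n _) lt) (sym e))
        (λ e → <⇒≢ lt (sym e)))

  -- The last item is slow: a cell it has just moved into is F, not yet urgent, so a
  -- time step may pass before each of its moves.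
  Staircase : ℕ → (ℕ → CellState) → Set
  Staircase p f = (f p ≡ F) × (∀ k → k < p → f k ≡ Eᵘ) × (∀ k → p < k → k ≤ L → isFull (f k) ≡ false)

  staircase-no-Fᵘ : ∀ p f → Staircase p f → ∀ k → k ≤ L → f k ≢ Fᵘ
  staircase-no-Fᵘ p f (ep , lo , hi) k kL e with <-cmp k p
  ... | tri< lt _ _ = lem (trans (sym (lo k lt)) e)
    where
    lem : Eᵘ ≢ Fᵘ
    lem ()
  ... | tri≈ _ refl _ = lem (trans (sym ep) e)
    where
    lem : F ≢ Fᵘ
    lem ()
  ... | tri> _ _ gt = lem (trans (sym (hi k gt kL)) (cong isFull e))
    where
    lem : false ≢ true
    lem ()

  moves-ticking : ∀ n g p f → p ≤ N → Staircase p f → (∀ i → i ≤ n → g i ≢ wantsIn) → (Σ ℕ λ i → i ≤ n × g i ≢ wantsω) →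
           Σ (ℕ → CellState) λ f' → Run (withUsers (pipeAt f) n g) (withUsers (pipeAt f') n g) (suc p) × isFull (f' 0) ≡ true
  moves-ticking n g p f pN inv np0 ex = go p f pN inv
    where
    tickR : ∀ p f → Staircase p f → Run (withUsers (pipeAt f) n g) (withUsers (pipeAt (tickAll f)) n g) 1
    tickR p f inv = run-pipe-tick f n g (λ j jN (e1 , _) → staircase-no-Fᵘ p f inv (suc j) (s≤s jN) e1)
                      (λ _ → np0) (λ e → ⊥-elim (staircase-no-Fᵘ p f inv 0 z≤n e)) ex
    go : ∀ p f → p ≤ N → Staircase p f →
         Σ (ℕ → CellState) λ f' → Run (withUsers (pipeAt f) n g) (withUsers (pipeAt f') n g) (suc p) × isFull (f' 0) ≡ true
    go zero f _ inv = tickAll f , tickR 0 f inv , cong (λ c → isFull (tickCell c)) (proj₁ inv)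
    go (suc q) f pN inv@(ep , lo , hi) with go q (move (tickAll f) q) (≤-trans (n≤1+n q) pN) inv'
      where
      f₁ = tickAll f
      inv' : Staircase q (move f₁ q)
      inv' = move-at f₁ q ,
             (λ k lt → trans (move-other f₁ q k (<⇒≢ lt) (<⇒≢ (≤-trans lt (n≤1+n q))))
                 (cong tickCell (lo k (≤-trans lt (n≤1+n q))))) ,
             (λ k lt kL → hiq k lt kL)
        where
        hiq : ∀ k → q < k → k ≤ L → isFull (move f₁ q k) ≡ false
        hiq k lt kL with m≤n⇒m<n∨m≡n lt
        ... | inj₂ refl = cong isFull (move-above f₁ q)
        ... | inj₁ lt2 = trans (cong isFull (move-other f₁ q k (λ e → <⇒≢ lt (sym e)) (λ e → <⇒≢ lt2 (sym e))))
                           (trans (isFull-tickCell (f k)) (hi k lt2 kL))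
    ... | f' , r , e0 = f' , (tickR (suc q) f inv ▸ run-τ {n = n} {g = g} (pipe-move-step (tickAll f) q (≤-trans (n≤1+n q) pN)
                              (cong (λ c → isFull (tickCell c)) ep) (cong (λ c → isFull (tickCell c)) (lo q ≤-refl))) ▸ r) , e0

  allEmpty : ℕ → CellState
  allEmpty _ = E

  f₁ : ℕ → CellState
  f₁ = tickAll allEmpty

  f₂-below : ∀ k → k ≤ L → k ≢ L → tickAll (update f₁ L F) k ≡ Eᵘ
  f₂-below k kL ne = cong tickCell (update-other f₁ L F k ne)

  L≢N : L ≢ N
  L≢N = 1+n≢n

  first-in : ∀ n g u → u ≤ n → g u ≡ wantsIn →
    Run (withUsers (pipeAt allEmpty) n g) (withUsers (pipeAt (tickAll (update f₁ L F))) n (update g u wantsOut)) 2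
  first-in n g u le gu = r1 ▸ r2 ▸ r3
    where
    g1 = update g u wantsOut
    r1 : Run (withUsers (pipeAt allEmpty) n g) (withUsers (pipeAt f₁) n g) 1
    r1 = run-pipe-tick allEmpty n g (λ j _ ()) (λ ()) (λ ()) (u , le , λ e → wantsIn≢wantsω (trans (sym gu) e))
    r2 : Run (withUsers (pipeAt f₁) n g) (withUsers (pipeAt (update f₁ L F)) n g1) 0
    r2 = run-in u le gu (pipe-in-step f₁ refl)
    nr : ∀ j → j ≤ N → ¬ (update f₁ L F (suc j) ≡ Fᵘ × update f₁ L F j ≡ Eᵘ)
    nr j _ (e1 , _) with suc j ≟ L
    ... | yes eq = lem (trans (sym (trans (cong (update f₁ L F) eq) (update-same f₁ L F))) e1)
      where
      lem : F ≢ Fᵘ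
      lem ()
    ... | no ne = lem (trans (sym (update-other f₁ L F (suc j) ne)) e1)
      where
      lem : Eᵘ ≢ Fᵘ
      lem ()
    r3 : Run (withUsers (pipeAt (update f₁ L F)) n g1) (withUsers (pipeAt (tickAll (update f₁ L F))) n g1) 1
    r3 = run-pipe-tick (update f₁ L F) n g1 nr (λ e → ⊥-elim (lem (trans (sym (update-same f₁ L F)) e)))
           (λ e → ⊥-elim (lem2 (trans (sym (update-other f₁ L F 0 (λ e' → L≢0 (sym e')))) e)))
           (u , le , λ e → wantsOut≢wantsω (trans (sym (update-same g u wantsOut)) e))
      where
      lem : F ≢ Eᵘ
      lem ()
      lem2 : Eᵘ ≢ Fᵘ
      lem2 ()
      L≢0 : L ≢ 0
      L≢0 = 1+n≢0

  serve : ∀ n g u → u ≤ n → g u ≡ wantsIn →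
           Run (withUsers (pipeAt allEmpty) n g) (withUsers (pipeAt allEmpty) n (update (update g u wantsOut) u wantsω)) 2
  serve n g u le gu with moves-down n (update g u wantsOut) L (tickAll (update f₁ L F)) ≤-refl
                            (cong (λ c → isFull (tickCell c)) (update-same f₁ L F))
                            (λ k lt → cong isFull (f₂-below k (≤-trans (n≤1+n k) lt) (<⇒≢ lt)))
  ... | f' , r , e0 , mid , _ = Run-subst refl (cong (λ z → z ∥ Users n (update (update g u wantsOut) u wantsω))
      (pipeAt-cong _ allEmpty h)) refl
                                  (first-in n g u le gu ▸ r ▸ run-out u le (update-same g u wantsOut) (pipe-out-step f' e0))
    where
    h : ∀ k → k ≤ L → update f' 0 E k ≡ E
    h zero _ = update-same f' 0 E
    h (suc k) kL = trans (update-other f' 0 E (suc k) (λ ())) (mid (suc k) (s≤s z≤n) kL)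

  serve-last : ∀ n g → g n ≡ wantsIn → (∀ i → i < n → g i ≡ wantsω) → Σ (Proc Bool) λ Q → Run
      (withUsers (pipeAt allEmpty) n g) Q (N + 3)
  serve-last n g gn lo with moves-ticking n g1 N f4 ≤-refl inv np0
      (n , ≤-refl , λ e → wantsOut≢wantsω (trans (sym (update-same g n wantsOut)) e))
    where
    g1 = update g n wantsOut
    f3 = tickAll (update f₁ L F)
    f4 = move f3 N
    inv : Staircase N f4
    inv = move-at f3 N ,
          (λ k lt → trans (move-other f3 N k (<⇒≢ lt) (<⇒≢ (≤-trans lt (n≤1+n N))))
              (f₂-below k (≤-trans (<⇒≤ lt) (n≤1+n N)) (λ e → <⇒≢ (≤-trans lt (n≤1+n N)) e))) ,
          (λ k lt kL → hiq k lt kL)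
      where
      hiq : ∀ k → N < k → k ≤ L → isFull (f4 k) ≡ false
      hiq k lt kL with m≤n⇒m<n∨m≡n lt
      ... | inj₂ refl = cong isFull (move-above f3 N)
      ... | inj₁ lt2 = ⊥-elim (1+n≰n (≤-trans lt2 kL))
    np0 : ∀ i → i ≤ n → g1 i ≢ wantsIn
    np0 i le e with i ≟ n
    ... | yes refl = lem (trans (sym (update-same g i wantsOut)) e)
      where
      lem : wantsOut ≢ wantsIn
      lem ()
    ... | no ne = lem (trans (sym (trans (update-other g n wantsOut i ne) (lo i (≤∧≢⇒< le ne)))) e)
      where
      lem : wantsω ≢ wantsIn
      lem ()
  ... | f5 , r , e0 = _ , Run-subst refl refl (ticks N)
      (first-in n g n ≤-refl gn ▸ run-τ {n = n} {g = update g n wantsOut} mv0 ▸ r ▸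
                              run-out n ≤-refl (update-same g n wantsOut) (pipe-out-step f5 e0))
    where
    f3' = tickAll (update f₁ L F)
    mv0 : pipeAt f3' ─⟨ τ ⟩→ pipeAt (move f3' N)
    mv0 = pipe-move-step f3' N ≤-refl (cong (λ c → isFull (tickCell c)) (update-same f₁ L F))
            (cong isFull (f₂-below N (n≤1+n N) (λ e → L≢N (sym e))))
    ticks : ∀ N → 1 + (0 + (1 + (0 + (suc N + 0)))) ≡ N + 3
    ticks = solve-∀

  serve-from : ∀ n k u → k + u ≡ n → Run (withUsers (pipeAt allEmpty) n (servedBelow u))
      (withUsers (pipeAt allEmpty) n (servedBelow n)) (2 * k)
  serve-from n zero u refl = run-refl
  serve-from n (suc k) u eq = Run-subst refl refl (two+ k)
    (Run-subst refl (cong (λ z → pipeAt allEmpty ∥ z) (Users-cong n _ _ (λ j _ → serve-next u j))) refl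
       (serve n (servedBelow u) u (≤-trans (m≤n+m u (suc k)) (≤-reflexive eq)) (servedBelow-self u))
     ▸ serve-from n k (suc u) (trans (+-suc k u) eq))
    where
    two+ : ∀ k → 2 + 2 * k ≡ 2 * suc k
    two+ = solve-∀

  pipe-reaches : ∀ n → RPAtLeast (Pipe N) (suc n) (2 * suc n + N + 1)
  pipe-reaches n with serve-last n (servedBelow n) (servedBelow-self n) (servedBelow-below n)
  ... | _ , last = run⇒RPAtLeast (Run-subst (cong₂ _∥_ (sym start≡pipeAt) (sym (U≡Users n))) refl (total n N)
                                   (serve-from n n 0 (+-identityʳ n) ▸ last))
    where
    total : ∀ n N → 2 * n + (N + 3) ≡ 2 * suc n + N + 1
    total = solve-∀

open import Data.Nat using (suc; _*_; z≤n; s≤s)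
open import Data.Nat.Properties
open import Data.Nat.DivMod using (m*n/n≡m; /-monoˡ-≤; m/n*n≤m)
open import Data.Nat.Tactic.RingSolver using (solve-∀)
open import Data.Product using (_,_)
open import Function.Bundles using (mk⇔; module Equivalence)
open import Relation.Binary.PropositionalEquality using (_≡_; refl; sym; subst)

RPBoundedBy : System → ℕ → ℕ → Set₁
RPBoundedBy S n b = ∀ k → RPAtLeast S n k → k ≤ b

RPAtLeast-mono : ∀ {S n j k} → j ≤ k → RPAtLeast S n k → RPAtLeast S n j
RPAtLeast-mono j≤k (v , trace , ¬ω , k≤ζ) = v , trace , ¬ω , ≤-trans j≤k k≤ζ

RP≤-intro : ∀ {P Q n a b} → RPBoundedBy P n a → RPAtLeast Q n b → a ≤ b → RP≤ P Q n
RP≤-intro bounded reaches a≤b k atLeast = RPAtLeast-mono (≤-trans (bounded k atLeast) a≤b) reaches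

RP≤-elim : ∀ {P Q n a b} → RP≤ P Q n → RPAtLeast P n a → RPBoundedBy Q n b → a ≤ b
RP≤-elim P≤Q reaches bounded = bounded _ (P≤Q _ reaches)

fifo-bounded : ∀ N n → RPBoundedBy (Fifo N) (suc n) (2 * suc n)
fifo-bounded N n k (_ , (_ , _ , steps , refl) , ¬ω , k≤) = ≤-trans k≤ (FifoBound.fifo-ticks≤ N n steps ¬ω)

buff-bounded : ∀ N .{{_ : NonZero N}} n → RPBoundedBy (Buff N) (suc n) (4 * suc n)
buff-bounded N n k (_ , (_ , _ , steps , refl) , ¬ω , k≤) = ≤-trans k≤ (BuffBound.buff-ticks≤ N n steps ¬ω)

pipe-bounded : ∀ N n → RPBoundedBy (Pipe N) (suc n) (2 * suc n + N + 1)
pipe-bounded N n k (_ , (_ , _ , steps , refl) , ¬ω , k≤) = ≤-trans k≤ (PipeBound.pipe-ticks≤ N n steps ¬ω)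

2n≤m⇔n≤m/2 : ∀ n m → 2 * n ≤ m ⇔ n ≤ m / 2
2n≤m⇔n≤m/2 n m = mk⇔
  (λ 2n≤m → subst (_≤ m / 2) (m*n/n≡m n 2) (/-monoˡ-≤ 2 (subst (_≤ m) (*-comm 2 n) 2n≤m)))
  (λ n≤m/2 → subst (_≤ m) (*-comm n 2) (≤-trans (*-monoˡ-≤ 2 n≤m/2) (m/n*n≤m m 2)))

4n≤2n+m⇔2n≤m : ∀ n m → 4 * n ≤ 2 * n + m ⇔ 2 * n ≤ m
4n≤2n+m⇔2n≤m n m = mk⇔
  (λ 4n≤ → +-cancelˡ-≤ (2 * n) _ _ (subst (_≤ 2 * n + m) (four n) 4n≤))
  (λ 2n≤m → subst (_≤ 2 * n + m) (sym (four n)) (+-monoʳ-≤ (2 * n) 2n≤m))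
  where
  four : ∀ n → 4 * n ≡ 2 * n + 2 * n
  four = solve-∀

corollary1 : (N : ℕ) → .{{_ : NonZero N}} →
    ((n : ℕ) → 1 ≤ n → RP≤ (Fifo N) (Pipe N) n × RP≤ (Fifo N) (Buff N) n)
    × ((n : ℕ) → 1 ≤ n → (RP≤ (Buff N) (Pipe N) n ⇔ n ≤ (N + 1) / 2))
corollary1 N = fifo-fastest , buff-vs-pipe
  where
  fifo-fastest : (n : ℕ) → 1 ≤ n → RP≤ (Fifo N) (Pipe N) n × RP≤ (Fifo N) (Buff N) n
  fifo-fastest (suc n) _ =
    RP≤-intro (fifo-bounded N n) (PipeRun.pipe-reaches N n) (≤-trans (m≤m+n _ N) (m≤m+n _ 1)) ,
    RP≤-intro (fifo-bounded N n) (BuffRun.buff-reaches N n) (*-monoˡ-≤ (suc n) {2} {4} (s≤s (s≤s z≤n)))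
  pipe-rp≡ : ∀ s → 2 * s + N + 1 ≡ 2 * s + (N + 1)
  pipe-rp≡ s = +-assoc (2 * s) N 1
  buff-vs-pipe : (n : ℕ) → 1 ≤ n → (RP≤ (Buff N) (Pipe N) n ⇔ n ≤ (N + 1) / 2)
  buff-vs-pipe (suc n) _ = mk⇔
    (λ Buff≤Pipe → to (2n≤m⇔n≤m/2 (suc n) (N + 1)) (to (4n≤2n+m⇔2n≤m (suc n) (N + 1))
      (subst (4 * suc n ≤_) (pipe-rp≡ (suc n)) (RP≤-elim Buff≤Pipe (BuffRun.buff-reaches N n) (pipe-bounded N n)))))
    (λ n≤ → RP≤-intro (buff-bounded N n) (PipeRun.pipe-reaches N n)
      (subst (4 * suc n ≤_) (sym (pipe-rp≡ (suc n)))
          (from (4n≤2n+m⇔2n≤m (suc n) (N + 1)) (from (2n≤m⇔n≤m/2 (suc n) (N + 1)) n≤))))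
    where open Equivalence
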